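{- Let $\Gamma=(V,E)$, $B$, $\mathbb{K}$, $u$ be as in the context, and let $\widetilde{\Gamma}$ be the graph obtained from $\Gamma$ by adding edges between every pair of distinct boundary nodes. If the arrangement $\mathcal{A}(\Gamma,u)$ is hypersolvable, then the graph $\widetilde{\Gamma}$ is hypersolvable.
   Context: $\Gamma=(V,E)$ is a finite connected graph without loops or multiple edges; $B\subseteq V$ is a set of at least $2$ pairwise nonadjacent vertices (boundary nodes); $\mathbb{K}$ is a field of characteristic $0$; $u:B\to\mathbb{K}$ is injective. $\mathcal{A}(\Gamma,u)$ is the central arrangement in $\mathbb{K}^{(V\setminus B)\cup\{0\}}$ consisting of: for each edge $ij\in E$ with no endpoint in $B$, the hyperplane $x_i=x_j$; for each edge $ij$ with $j\in B$, the hyperplane $x_i=u(j)x_0$; and the hyperplane $x_0=0$. Hypersolvable arrangement: for a central arrangement $\mathcal{A}$ and $X\subseteq Y\subseteq\mathcal{A}$ (a set of hyperplanes being dependent iff its normal vectors are linearly dependent), $X\subseteq Y$ is closed if $X\ne Y$ and $\{a,b,c\}$ is independent for all distinct $a,b\in X$, $c\in Y\setminus X$; complete if $X\ne Y$ and for all distinct $a,b\in Y\setminus X$ some $\gamma\in X$ makes $\{a,b,\gamma\}$ dependent (for closed complete containments this $\gamma=f(a,b)$ is unique); solvable if closed, complete, and for all distinct $a,b,c\in Y\setminus X$ with $f(a,b),f(a,c),f(b,c)$ distinct, $\{f(a,b),f(a,c),f(b,c)\}$ is dependent. $\mathcal{A}$ is hypersolvable if there is a chain $X_1\subseteq\dots\subseteq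 X_k=\mathcal{A}$ with $|X_1|=1$ and each $X_i\subseteq X_{i+1}$ solvable. Hypersolvable graph: for a graph with edge set $F$ and $S\subseteq T\subseteq F$, $S\subseteq T$ is solvable if (a) no $3$-cycle has two edges in $S$ and one in $T\setminus S$, and (b) either $T\setminus S=\{e\}$ with neither endpoint of $e$ met by $S$, or there are distinct vertices $v_1,\dots,v_k,v$ met by $T$, with $v_1,\dots,v_k$ met by $S$, such that $S$ contains a clique on $\{v_1,\dots,v_k\}$ and $T\setminus S=\{vv_s\in F: s=1,\dots,k\}$. The graph is hypersolvable if there is a chain $S_1\subseteq\dots\subseteq S_k=F$ with $|S_1|=1$ and each $S_i\subseteq S_{i+1}$ solvable. -}

module Defs where

open import Level using (Level; _⊔_; suc; 0ℓ)
open import Algebra.Bundles using (CommutativeRing)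
open import Data.Nat as ℕ using (ℕ; zero) renaming (suc to sucℕ)
open import Data.Bool using (Bool; true; false; T; _∧_; _∨_; not; if_then_else_)
open import Data.Fin using (Fin; toℕ)
open import Data.Fin.Properties using (_≟_)
open import Data.Maybe using (Maybe; just; nothing)
open import Data.Product using (Σ; Σ-syntax; ∃; ∃-syntax; _×_; _,_; proj₁; proj₂)
open import Data.Sum using (_⊎_)
open import Data.List using (List; [])
open import Data.List.Membership.Propositional using (_∈_; _∉_)
open import Data.List.Relation.Unary.Unique.Propositional using (Unique)
open import Relation.Nullary using (¬_; does)
open import Relation.Binary.PropositionalEquality using (_≡_; _≢_)
open import Relation.Binary.Construct.Closure.ReflexiveTransitive using (Star)

record Field (c ℓ : Level) : Set (suc (c ⊔ ℓ)) where
  field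
    commutativeRing : CommutativeRing c ℓ
  open CommutativeRing commutativeRing public
  field
    1≉0     : ¬ (1# ≈ 0#)
    inverse : ∀ x → ¬ (x ≈ 0#) → Σ[ y ∈ Carrier ] (x * y ≈ 1#)

module FieldOps {c ℓ} (K : Field c ℓ) where
  open Field K
  _·1 : ℕ → Carrier
  zero ·1 = 0#
  sucℕ n ·1 = 1# + (n ·1)

CharZero : ∀ {c ℓ} → Field c ℓ → Set ℓ
CharZero K = ∀ (n : ℕ) → ¬ (Field._≈_ K (FieldOps._·1 K (sucℕ n)) (Field.0# K))

Adjacency : ℕ → Set
Adjacency n = Fin n → Fin n → Bool

-- simple graph: symmetric, no loops (multiple edges impossible by encoding)
IsSimpleGraph : ∀ {n} → Adjacency n → Set
IsSimpleGraph {n} E = (∀ (i j : Fin n) → E i j ≡ E j i) × (∀ (i : Fin n) → E i i ≡ false)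

Connected : ∀ {n} → Adjacency n → Set
Connected {n} E = ∀ (i j : Fin n) → Star (λ x y → T (E x y)) i j

_==_ : ∀ {n} → Fin n → Fin n → Bool
i == j = does (i ≟ j)

EdgeSet : ℕ → Set
EdgeSet n = Fin n → Fin n → Bool

module GraphHS {n : ℕ} (F : Adjacency n) where

  _∈ₑ_ : Fin n × Fin n → EdgeSet n → Set
  (x , y) ∈ₑ S = S x y ≡ true

  _⊆ₑ_ : EdgeSet n → EdgeSet n → Set
  S ⊆ₑ T' = ∀ x y → (x , y) ∈ₑ S → (x , y) ∈ₑ T'

  IsEdgeSubset : EdgeSet n → Set
  IsEdgeSubset S = (∀ x y → S x y ≡ S y x) × (S ⊆ₑ F)

  IsSingleton : EdgeSet n → Set
  IsSingleton S = Σ[ x ∈ Fin n ] Σ[ y ∈ Fin n ]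
    ((x , y) ∈ₑ S × (∀ x' y' → (x' , y') ∈ₑ S → (x' ≡ x × y' ≡ y) ⊎ (x' ≡ y × y' ≡ x)))

  MetBy : Fin n → EdgeSet n → Set
  MetBy v S = Σ[ w ∈ Fin n ] (v , w) ∈ₑ S

  diff : EdgeSet n → EdgeSet n → EdgeSet n
  diff T' S x y = T' x y ∧ not (S x y)

  Solvable : EdgeSet n → EdgeSet n → Set
  Solvable S T' =
    IsEdgeSubset S × IsEdgeSubset T' × S ⊆ₑ T' ×
    (¬ (Σ[ x ∈ Fin n ] Σ[ y ∈ Fin n ] Σ[ z ∈ Fin n ]
          (x ≢ y × y ≢ z × x ≢ z ×
           (x , y) ∈ₑ S × (y , z) ∈ₑ S × (x , z) ∈ₑ diff T' S))) ×
    ( (Σ[ x ∈ Fin n ] Σ[ y ∈ Fin n ]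
         ((x , y) ∈ₑ diff T' S
          × (∀ x' y' → (x' , y') ∈ₑ diff T' S → (x' ≡ x × y' ≡ y) ⊎ (x' ≡ y × y' ≡ x))
          × ¬ MetBy x S × ¬ MetBy y S))
    ⊎ (Σ[ vs ∈ List (Fin n) ] Σ[ v ∈ Fin n ]
         (vs ≢ [] × Unique vs × v ∉ vs
          × MetBy v T'
          × (∀ w → w ∈ vs → MetBy w S)
          × (∀ w w' → w ∈ vs → w' ∈ vs → w ≢ w' → (w , w') ∈ₑ S)
          × (∀ x y → (x , y) ∈ₑ diff T' S ⇔ₑ
               ((x , y) ∈ₑ F × ((x ≡ v × y ∈ vs) ⊎ (y ≡ v × x ∈ vs)))))))
    where
      _⇔ₑ_ : Set → Set → Set
      A ⇔ₑ B = (A → B) × (B → A)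
      infix 4 _⇔ₑ_

  data ChainFrom : EdgeSet n → Set where
    done : ∀ {S} → (∀ x y → S x y ≡ F x y) → ChainFrom S
    step : ∀ {S T'} → Solvable S T' → ChainFrom T' → ChainFrom S

  HypersolvableGraph : Set
  HypersolvableGraph = Σ[ S₁ ∈ EdgeSet n ] (IsEdgeSubset S₁ × IsSingleton S₁ × ChainFrom S₁)

-- A central arrangement is given by an
-- index type of its (pairwise distinct) hyperplanes and a normal vector
-- for each, in K^Coord.

module ArrHS {c ℓ} (K : Field c ℓ) {Idx Coord : Set} (normal : Idx → Coord → Field.Carrier K) where
  open Field K

  Dep : Idx → Idx → Idx → Set (c ⊔ ℓ)
  Dep a b d = Σ[ α ∈ Carrier ] Σ[ β ∈ Carrier ] Σ[ γ ∈ Carrier ]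
    (¬ (α ≈ 0# × β ≈ 0# × γ ≈ 0#) ×
     (∀ k → (α * normal a k + β * normal b k) + γ * normal d k ≈ 0#))

  Sub : Set₁
  Sub = Idx → Set

  _⊆ₕ_ : Sub → Sub → Set
  X ⊆ₕ Y = ∀ h → X h → Y h

  Closed : Sub → Sub → Set (c ⊔ ℓ)
  Closed X Y = (Σ[ h ∈ Idx ] (Y h × ¬ X h)) ×
    (∀ a b d → X a → X b → a ≢ b → Y d → ¬ X d → ¬ Dep a b d)

  Complete : Sub → Sub → Set (c ⊔ ℓ)
  Complete X Y = (Σ[ h ∈ Idx ] (Y h × ¬ X h)) ×
    (∀ a b → Y a → ¬ X a → Y b → ¬ X b → a ≢ b → Σ[ γ ∈ Idx ] (X γ × Dep a b γ))

  -- f(a,b) is the unique γ ∈ X with {a,b,γ} dependent (unique by closedness),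
  -- so "f(a,b) = p" is expressed as "p ∈ X and {a,b,p} dependent".
  Solvable : Sub → Sub → Set (c ⊔ ℓ)
  Solvable X Y = X ⊆ₕ Y × Closed X Y × Complete X Y ×
    (∀ a b d p q r →
       Y a → ¬ X a → Y b → ¬ X b → Y d → ¬ X d →
       a ≢ b → a ≢ d → b ≢ d →
       X p → Dep a b p → X q → Dep a d q → X r → Dep b d r →
       p ≢ q → p ≢ r → q ≢ r → Dep p q r)

  data ChainFrom : Sub → Set (suc (c ⊔ ℓ)) where
    done : ∀ {X} → (∀ h → X h) → ChainFrom X
    step : ∀ {X Y} → Solvable X Y → ChainFrom Y → ChainFrom X

  Hypersolvable : Set (suc (c ⊔ ℓ))
  Hypersolvable = Σ[ X₁ ∈ Sub ] ((Σ[ h ∈ Idx ] (X₁ h × ∀ h' → X₁ h' → h' ≡ h)) × ChainFrom X₁)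

module GraphicArr {c ℓ} (K : Field c ℓ) {n : ℕ} (E : Adjacency n) (inB : Fin n → Bool)
                  (u : Fin n → Field.Carrier K) where
  open Field K

  -- coordinates of K^{(V \ B) ∪ {0}}: nothing is the coordinate x₀
  Coord : Set
  Coord = Maybe (Σ[ i ∈ Fin n ] T (not (inB i)))

  -- canonical ordered representative (i,j) of an edge ij giving a hyperplane:
  -- i ∉ B, and either j ∈ B, or j ∉ B and i < j
  isRep : Fin n → Fin n → Bool
  isRep i j = E i j ∧ not (inB i) ∧ (inB j ∨ (toℕ i ℕ.<ᵇ toℕ j))

  -- hyperplanes: nothing is x₀ = 0; just (i,j) is the hyperplane of edge ij
  Idx : Set
  Idx = Maybe (Σ[ p ∈ Fin n × Fin n ] T (isRep (proj₁ p) (proj₂ p)))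

  δ : Fin n → Fin n → Carrier
  δ i k = if i == k then 1# else 0#

  normal : Idx → Coord → Carrier
  normal nothing nothing = 1#
  normal nothing (just _) = 0#
  -- edge ij with j ∈ B: x_i - u(j) x₀ ;  otherwise x_i - x_j
  normal (just ((i , j) , _)) nothing = if inB j then - (u j) else 0#
  normal (just ((i , j) , _)) (just (k , _)) =
    if inB j then δ i k else δ i k - δ j k

  open ArrHS K normal public using (Hypersolvable)

completeBoundary : ∀ {n} → Adjacency n → (Fin n → Bool) → Adjacency n
completeBoundary E inB i j = E i j ∨ (inB i ∧ inB j ∧ not (i == j))

module Submission where

-- A subarrangement X determines an edge set of Γ̃: the edges whose hyperplane
-- lies in X, together with all boundary pairs when x₀ = 0 lies in X.  Given a
-- chain X₁ ⊆ … ⊆ A(Γ,u) of solvable steps, we show that consecutive edge sets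
-- are joined by chains of solvable steps of Γ̃, and that the first one is
-- reached from a single edge.

open import Defs
open import Level using (Level)
open import Data.Nat as ℕ using (ℕ; zero; suc; _≤_; _<_; z≤n; s≤s)
open import Data.Nat.Properties using (≤-refl; <-≤-trans; +-mono-≤; +-mono-<-≤; +-mono-≤-<; <-asym; <-cmp; <ᵇ⇒<; <⇒<ᵇ)
open import Data.Bool using (Bool; true; false; T; _∧_; _∨_; not; if_then_else_)
open import Data.Bool.Properties using (T?; ∧-comm; ∨-comm; ∧-identityʳ) renaming (_≟_ to _≟ᵇ_)
open import Data.Unit using (tt)
open import Data.Fin as Fin using (Fin; toℕ)
open import Data.Fin.Properties using (_≟_; toℕ-injective; any?; all?; ¬∀⟶∃¬)
open import Data.Fin.Subset.Properties using (anySubset?)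
open import Data.Maybe using (just; nothing)
open import Data.Product using (Σ; Σ-syntax; _×_; _,_; proj₁; proj₂)
open import Data.Sum using (_⊎_; inj₁; inj₂; [_,_])
open import Data.Empty using (⊥; ⊥-elim)
open import Data.Vec using (Vec; lookup; tabulate)
open import Data.Vec.Properties using (lookup∘tabulate)
open import Data.List using (List; []; _∷_; filter; allFin)
open import Data.List.Membership.Propositional using (_∈_; _∉_)
open import Data.List.Membership.Propositional.Properties using (∈-filter⁺; ∈-filter⁻; ∈-allFin)
open import Data.List.Relation.Unary.Any using (here; there)
open import Data.List.Relation.Unary.Unique.Propositional using (Unique)
open import Data.List.Relation.Unary.Unique.Propositional.Properties using (filter⁺; allFin⁺)
open import Relation.Nullary using (¬_; does; yes; no; Dec)
open import Relation.Nullary.Decidable using (_×-dec_; _⊎-dec_; _→-dec_; ¬?; map′; dec-true; dec-false)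
open import Relation.Binary using (tri<; tri≈; tri>)
open import Relation.Binary.PropositionalEquality using (_≡_; _≢_; refl; sym; trans; cong; cong₂; subst; subst₂)

true≢false : ∀ {a : Bool} → a ≡ true → a ≡ false → ⊥
true≢false refl ()

bool-cases : ∀ (a : Bool) → a ≡ true ⊎ a ≡ false
bool-cases true = inj₁ refl
bool-cases false = inj₂ refl

bool-ext : ∀ {a b : Bool} → (a ≡ true → b ≡ true) → (b ≡ true → a ≡ true) → a ≡ b
bool-ext {true} f g = sym (f refl)
bool-ext {false} {true} f g = g refl
bool-ext {false} {false} f g = refl

T⇒≡ : ∀ {a} → T a → a ≡ true
T⇒≡ {true} _ = refl

≡⇒T : ∀ {a} → a ≡ true → T a
≡⇒T refl = tt

T-irrelevant : ∀ {a} (t t' : T a) → t ≡ t'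
T-irrelevant {true} _ _ = refl

∨-true⁻ : ∀ a {b} → a ∨ b ≡ true → a ≡ true ⊎ b ≡ true
∨-true⁻ true p = inj₁ refl
∨-true⁻ false p = inj₂ p

∨-trueˡ : ∀ {a} b → a ≡ true → a ∨ b ≡ true
∨-trueˡ b refl = refl

∨-trueʳ : ∀ a {b} → b ≡ true → a ∨ b ≡ true
∨-trueʳ true p = refl
∨-trueʳ false p = p

∨-false : ∀ {a b} → a ≡ false → b ≡ false → a ∨ b ≡ false
∨-false refl refl = refl

∨-false⁻ˡ : ∀ a {b} → a ∨ b ≡ false → a ≡ false
∨-false⁻ˡ false p = refl

∨-false⁻ʳ : ∀ a {b} → a ∨ b ≡ false → b ≡ false
∨-false⁻ʳ false p = p

∧-true⁻ : ∀ a {b} → a ∧ b ≡ true → a ≡ true × b ≡ true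
∧-true⁻ true p = refl , p

∧-true : ∀ {a b} → a ≡ true → b ≡ true → a ∧ b ≡ true
∧-true refl refl = refl

∧-falseˡ : ∀ {a} b → a ≡ false → a ∧ b ≡ false
∧-falseˡ b refl = refl

∧-falseʳ : ∀ a {b} → b ≡ false → a ∧ b ≡ false
∧-falseʳ true p = p
∧-falseʳ false p = refl

not-true⁻ : ∀ {a} → not a ≡ true → a ≡ false
not-true⁻ {false} p = refl

not-true : ∀ {a} → a ≡ false → not a ≡ true
not-true refl = refl

module _ {n : ℕ} where

  ==⇒≡ : ∀ {x y : Fin n} → (x == y) ≡ true → x ≡ y
  ==⇒≡ {x} {y} p with x ≟ y
  ... | yes q = q

  ≡⇒== : ∀ {x y : Fin n} → x ≡ y → (x == y) ≡ true
  ≡⇒== {x} {y} = dec-true (x ≟ y)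

  ≢⇒==false : ∀ {x y : Fin n} → x ≢ y → (x == y) ≡ false
  ≢⇒==false {x} {y} = dec-false (x ≟ y)

  ==false⇒≢ : ∀ {x y : Fin n} → (x == y) ≡ false → x ≢ y
  ==false⇒≢ p q = true≢false (≡⇒== q) p

  ==-refl : ∀ (x : Fin n) → (x == x) ≡ true
  ==-refl x = ≡⇒== {x} {x} refl

  ==-sym : ∀ (x y : Fin n) → (x == y) ≡ (y == x)
  ==-sym x y = bool-ext (λ p → ≡⇒== {y} {x} (sym (==⇒≡ p))) (λ p → ≡⇒== {x} {y} (sym (==⇒≡ p)))

  listOf : (Fin n → Bool) → List (Fin n)
  listOf P = filter (λ w → T? (P w)) (allFin n)

  listOf-complete : ∀ P w → P w ≡ true → w ∈ listOf P
  listOf-complete P w p = ∈-filter⁺ (λ w → T? (P w)) (∈-allFin w) (≡⇒T p)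

  listOf-sound : ∀ P w → w ∈ listOf P → P w ≡ true
  listOf-sound P w m = T⇒≡ (proj₂ (∈-filter⁻ (λ w → T? (P w)) {xs = allFin n} m))

  listOf-unique : ∀ P → Unique (listOf P)
  listOf-unique P = filter⁺ (λ w → T? (P w)) (allFin⁺ n)

¬¬-decide : ∀ {a} (A : Set a) → ¬ ¬ (Dec A)
¬¬-decide A k = k (no (λ x → k (yes x)))

¬¬-∀Fin : ∀ {a} {k : ℕ} {P : Fin k → Set a} → (∀ i → ¬ ¬ P i) → ¬ ¬ (∀ i → P i)
¬¬-∀Fin {k = zero} f ng = ng (λ ())
¬¬-∀Fin {k = suc k} {P} f ng =
  f Fin.zero (λ p0 → ¬¬-∀Fin {k = k} {P = λ i → P (Fin.suc i)} (λ i → f (Fin.suc i))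
                        (λ ps → ng (λ { Fin.zero → p0 ; (Fin.suc i) → ps i })))

¬¬-∀T : ∀ {a} (b : Bool) {Q : T b → Set a} → (∀ t → ¬ ¬ Q t) → ¬ ¬ (∀ t → Q t)
¬¬-∀T true f ng = f tt (λ q → ng (λ t → q))
¬¬-∀T false f ng = ng (λ ())

-- Two ways of growing an edge set S ⊆ F solvably (condition (b) of the
-- definition): adding one isolated edge, or adding the star from a new
-- centre v to a clique P of S.
module SolvableExtensions {n : ℕ} (F : Adjacency n) (Fsym : ∀ x y → F x y ≡ F y x) where
  open GraphHS F

  _∪ₑ_ : EdgeSet n → EdgeSet n → EdgeSet n
  (S ∪ₑ N) x y = S x y ∨ N x y

  starEdges : Fin n → (Fin n → Bool) → EdgeSet n
  starEdges v P x y = ((x == v) ∧ P y ∧ F x y) ∨ ((y == v) ∧ P x ∧ F x y)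

  oneEdge : Fin n → Fin n → EdgeSet n
  oneEdge a b x y = ((x == a) ∧ (y == b)) ∨ ((x == b) ∧ (y == a))

  addStar : EdgeSet n → Fin n → (Fin n → Bool) → EdgeSet n
  addStar S v P = S ∪ₑ starEdges v P

  addEdge : EdgeSet n → Fin n → Fin n → EdgeSet n
  addEdge S a b = S ∪ₑ oneEdge a b

  ValidStar : EdgeSet n → Fin n → (Fin n → Bool) → Set
  ValidStar S v P =
    IsEdgeSubset S ×
    P v ≡ false ×
    (Σ[ w ∈ Fin n ] (P w ≡ true × F v w ≡ true)) ×
    (∀ w → P w ≡ true → MetBy w S) ×
    (∀ w w' → P w ≡ true → P w' ≡ true → w ≢ w' → S w w' ≡ true) ×
    (∀ w → P w ≡ true → S v w ≡ false) ×
    (∀ w y → P w ≡ true → F v w ≡ true → S v y ≡ true → S y w ≡ false)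

  ValidEdge : EdgeSet n → Fin n → Fin n → Set
  ValidEdge S a b = IsEdgeSubset S × F a b ≡ true × ¬ MetBy a S × ¬ MetBy b S

  starEdges-sym : ∀ v P x y → starEdges v P x y ≡ starEdges v P y x
  starEdges-sym v P x y rewrite Fsym x y = ∨-comm ((x == v) ∧ P y ∧ F y x) _

  starEdges-cases : ∀ v P x y → starEdges v P x y ≡ true →
                    (x ≡ v × P y ≡ true × F x y ≡ true) ⊎ (y ≡ v × P x ≡ true × F x y ≡ true)
  starEdges-cases v P x y h with ∨-true⁻ ((x == v) ∧ P y ∧ F x y) h
  ... | inj₁ a = let (p , q) = ∧-true⁻ (x == v) a in inj₁ (==⇒≡ p , ∧-true⁻ (P y) q)
  ... | inj₂ a = let (p , q) = ∧-true⁻ (y == v) a in inj₂ (==⇒≡ p , ∧-true⁻ (P x) q)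

  starEdges-F : ∀ v P x y → starEdges v P x y ≡ true → F x y ≡ true
  starEdges-F v P x y h with starEdges-cases v P x y h
  ... | inj₁ (_ , _ , f) = f
  ... | inj₂ (_ , _ , f) = f

  starEdges-out : ∀ v P {x y} → P y ≡ true → F x y ≡ true → x ≡ v → starEdges v P x y ≡ true
  starEdges-out v P {x} {y} py f refl = ∨-trueˡ _ (∧-true (==-refl x) (∧-true py f))

  starEdges-in : ∀ v P {x y} → P x ≡ true → F x y ≡ true → y ≡ v → starEdges v P x y ≡ true
  starEdges-in v P {x} {y} px f refl =
    ∨-trueʳ ((x == y) ∧ P y ∧ F x y) (∧-true (==-refl y) (∧-true px f))

  oneEdge-cases : ∀ a b x y → oneEdge a b x y ≡ true → (x ≡ a × y ≡ b) ⊎ (x ≡ b × y ≡ a)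
  oneEdge-cases a b x y h with ∨-true⁻ ((x == a) ∧ (y == b)) h
  ... | inj₁ p = let (p1 , p2) = ∧-true⁻ (x == a) p in inj₁ (==⇒≡ p1 , ==⇒≡ p2)
  ... | inj₂ p = let (p1 , p2) = ∧-true⁻ (x == b) p in inj₂ (==⇒≡ p1 , ==⇒≡ p2)

  oneEdge-sym : ∀ a b x y → oneEdge a b x y ≡ oneEdge a b y x
  oneEdge-sym a b x y =
    trans (cong₂ _∨_ (∧-comm (x == a) (y == b)) (∧-comm (x == b) (y == a))) (∨-comm ((y == b) ∧ (x == a)) ((y == a) ∧ (x == b)))

  oneEdge-ab : ∀ a b → oneEdge a b a b ≡ true
  oneEdge-ab a b rewrite ==-refl a | ==-refl b = refl

  oneEdge-ba : ∀ a b → oneEdge a b b a ≡ true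
  oneEdge-ba a b = trans (oneEdge-sym a b b a) (oneEdge-ab a b)

  oneEdge-F : ∀ {a b} → F a b ≡ true → ∀ x y → oneEdge a b x y ≡ true → F x y ≡ true
  oneEdge-F fab x y h with oneEdge-cases _ _ x y h
  ... | inj₁ (refl , refl) = fab
  ... | inj₂ (refl , refl) = trans (Fsym x y) fab

  ∪-edgeSubset : ∀ {S} N → IsEdgeSubset S → (∀ x y → N x y ≡ N y x) →
                 (∀ x y → N x y ≡ true → F x y ≡ true) → IsEdgeSubset (S ∪ₑ N)
  ∪-edgeSubset {S} N (Ssym , S⊆F) Nsym N⊆F =
    (λ x y → cong₂ _∨_ (Ssym x y) (Nsym x y)) ,
    (λ x y h → [ S⊆F x y , N⊆F x y ] (∨-true⁻ (S x y) h))

  diff-∪ : ∀ S N x y → diff (S ∪ₑ N) S x y ≡ true → S x y ≡ false × N x y ≡ true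
  diff-∪ S N x y h with S x y | ∧-true⁻ (S x y ∨ N x y) h
  ... | false | (p , _) = refl , p

  ∪-diff : ∀ S N {x y} → S x y ≡ false → N x y ≡ true → diff (S ∪ₑ N) S x y ≡ true
  ∪-diff S N s n rewrite s | n = refl

  ⊆-∪ : ∀ S N → S ⊆ₑ (S ∪ₑ N)
  ⊆-∪ S N x y h = ∨-trueˡ _ h

  starSolvable : ∀ S v P → ValidStar S v P → Solvable S (addStar S v P)
  starSolvable S v P (es@(Ssym , _) , pv , (w0 , pw0 , fw0) , met , cl , nw , noTri) =
    es , ∪-edgeSubset (starEdges v P) es (starEdges-sym v P) (starEdges-F v P) , ⊆-∪ S _ , noTriangle ,
    inj₂ (listOf P , v , nonempty , listOf-unique P , v∉P , metv , metw , clique , diff⇔)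
    where
      T' : EdgeSet n
      T' = addStar S v P
      noTriangle : ¬ (Σ[ x ∈ Fin n ] Σ[ y ∈ Fin n ] Σ[ z ∈ Fin n ]
          (x ≢ y × y ≢ z × x ≢ z × (x , y) ∈ₑ S × (y , z) ∈ₑ S × (x , z) ∈ₑ diff T' S))
      noTriangle (x , y , z , _ , _ , _ , sxy , syz , dxz)
        with starEdges-cases v P x z (proj₂ (diff-∪ S (starEdges v P) x z dxz))
      ... | inj₁ (refl , pz , fz) = true≢false syz (noTri z y pz fz sxy)
      ... | inj₂ (refl , px , fx) = true≢false (trans (Ssym y x) sxy)
                                      (noTri x y px (trans (Fsym v x) fx) (trans (Ssym v y) syz))
      nonempty : listOf P ≢ []
      nonempty e with subst (w0 ∈_) e (listOf-complete P w0 pw0)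
      ... | ()
      v∉P : v ∉ listOf P
      v∉P m = true≢false (listOf-sound P v m) pv
      metv : MetBy v T'
      metv = w0 , ∨-trueʳ (S v w0) (starEdges-out v P pw0 fw0 refl)
      metw : ∀ w → w ∈ listOf P → MetBy w S
      metw w m = met w (listOf-sound P w m)
      clique : ∀ w w' → w ∈ listOf P → w' ∈ listOf P → w ≢ w' → (w , w') ∈ₑ S
      clique w w' m m' = cl w w' (listOf-sound P w m) (listOf-sound P w' m')
      StarEdge : Fin n → Fin n → Set
      StarEdge x y = F x y ≡ true × ((x ≡ v × y ∈ listOf P) ⊎ (y ≡ v × x ∈ listOf P))
      diff⇔ : ∀ x y → (diff T' S x y ≡ true → StarEdge x y) × (StarEdge x y → diff T' S x y ≡ true)
      diff⇔ x y = fwd , bwd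
        where
          fwd : diff T' S x y ≡ true → StarEdge x y
          fwd h with starEdges-cases v P x y (proj₂ (diff-∪ S (starEdges v P) x y h))
          ... | inj₁ (e , p , f) = f , inj₁ (e , listOf-complete P y p)
          ... | inj₂ (e , p , f) = f , inj₂ (e , listOf-complete P x p)
          bwd : StarEdge x y → diff T' S x y ≡ true
          bwd (f , inj₁ (refl , m)) = ∪-diff S (starEdges v P) (nw y (listOf-sound P y m)) (starEdges-out v P (listOf-sound P y m) f refl)
          bwd (f , inj₂ (refl , m)) = ∪-diff S (starEdges v P) (trans (Ssym x y) (nw x (listOf-sound P x m)))
                                             (starEdges-in v P (listOf-sound P x m) f refl)

  edgeSolvable : ∀ S a b → ValidEdge S a b → Solvable S (addEdge S a b)
  edgeSolvable S a b (es , fab , na , nb) =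
    es , ∪-edgeSubset (oneEdge a b) es (oneEdge-sym a b) (oneEdge-F fab) , ⊆-∪ S _ , noTriangle ,
    inj₁ (a , b , ∪-diff S (oneEdge a b) sab (oneEdge-ab a b) , only , na , nb)
    where
      noTriangle : ¬ (Σ[ x ∈ Fin n ] Σ[ y ∈ Fin n ] Σ[ z ∈ Fin n ]
          (x ≢ y × y ≢ z × x ≢ z × (x , y) ∈ₑ S × (y , z) ∈ₑ S × (x , z) ∈ₑ diff (addEdge S a b) S))
      noTriangle (x , y , z , _ , _ , _ , sxy , syz , dxz) with oneEdge-cases a b x z (proj₂ (diff-∪ S (oneEdge a b) x z dxz))
      ... | inj₁ (refl , refl) = na (y , sxy)
      ... | inj₂ (refl , refl) = nb (y , sxy)
      sab : S a b ≡ false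
      sab with S a b in e
      ... | false = refl
      ... | true = ⊥-elim (na (b , e))
      only : ∀ x y → diff (addEdge S a b) S x y ≡ true → (x ≡ a × y ≡ b) ⊎ (x ≡ b × y ≡ a)
      only x y h = oneEdge-cases a b x y (proj₂ (diff-∪ S (oneEdge a b) x y h))

-- Finite sums over Fin k, used to count the edges still missing from an
-- edge set; each solvable step strictly decreases this count.
sumFin : ∀ {k} → (Fin k → ℕ) → ℕ
sumFin {zero} f = 0
sumFin {suc k} f = f Fin.zero ℕ.+ sumFin (λ i → f (Fin.suc i))

sumFin-mono : ∀ {k} (f g : Fin k → ℕ) → (∀ i → f i ≤ g i) → sumFin f ≤ sumFin g
sumFin-mono {zero} f g h = z≤n
sumFin-mono {suc k} f g h =
  +-mono-≤ (h Fin.zero) (sumFin-mono (λ i → f (Fin.suc i)) (λ i → g (Fin.suc i)) (λ i → h (Fin.suc i)))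

sumFin-strict : ∀ {k} (f g : Fin k → ℕ) → (∀ i → f i ≤ g i) → ∀ j → f j < g j → sumFin f < sumFin g
sumFin-strict {suc k} f g h Fin.zero lt =
  +-mono-<-≤ lt (sumFin-mono (λ i → f (Fin.suc i)) (λ i → g (Fin.suc i)) (λ i → h (Fin.suc i)))
sumFin-strict {suc k} f g h (Fin.suc j) lt =
  +-mono-≤-< (h Fin.zero) (sumFin-strict (λ i → f (Fin.suc i)) (λ i → g (Fin.suc i)) (λ i → h (Fin.suc i)) j lt)

sumFin-cong : ∀ {k} (f g : Fin k → ℕ) → (∀ i → f i ≡ g i) → sumFin f ≡ sumFin g
sumFin-cong {zero} f g h = refl
sumFin-cong {suc k} f g h =
  cong₂ ℕ._+_ (h Fin.zero) (sumFin-cong (λ i → f (Fin.suc i)) (λ i → g (Fin.suc i)) (λ i → h (Fin.suc i)))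

-- 1 exactly when a pair is an edge of F (first flag) missing from S (second)
missingFlag : Bool → Bool → ℕ
missingFlag true false = 1
missingFlag _ _ = 0

missingFlag-anti : ∀ f s s' → (s ≡ true → s' ≡ true) → missingFlag f s' ≤ missingFlag f s
missingFlag-anti true true s' h rewrite h refl = z≤n
missingFlag-anti true false true h = z≤n
missingFlag-anti true false false h = s≤s z≤n
missingFlag-anti false s s' h = z≤n

-- Chains of solvable steps from S up to F, in a finite encoding: a step is
-- named by a code (an edge, or a centre and a subset), so that "S grows
-- into F in at most f steps" is a decidable proposition.
module Plans {n : ℕ} (F : Adjacency n) (Fsym : ∀ x y → F x y ≡ F y x) where
  open GraphHS F
  open SolvableExtensions F Fsym public

  data StepCode : Set where
    edge : Fin n → Fin n → StepCode
    star : Fin n → Vec Bool n → StepCode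

  ValidCode : EdgeSet n → StepCode → Set
  ValidCode S (edge a b) = ValidEdge S a b
  ValidCode S (star v p) = ValidStar S v (lookup p)

  apply : EdgeSet n → StepCode → EdgeSet n
  apply S (edge a b) = addEdge S a b
  apply S (star v p) = addStar S v (lookup p)

  IsFull : EdgeSet n → Set
  IsFull S = ∀ x y → S x y ≡ F x y

  Completable : ℕ → EdgeSet n → Set
  Completable zero S = IsFull S
  Completable (suc f) S = IsFull S ⊎ Σ StepCode (λ c → ValidCode S c × Completable f (apply S c))

  validSolvable : ∀ S c → ValidCode S c → Solvable S (apply S c)
  validSolvable S (edge a b) V = edgeSolvable S a b V
  validSolvable S (star v p) V = starSolvable S v (lookup p) V

  completable⇒chain : ∀ f S → Completable f S → ChainFrom S
  completable⇒chain zero S g = done g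
  completable⇒chain (suc f) S (inj₁ g) = done g
  completable⇒chain (suc f) S (inj₂ (c , V , g)) = step (validSolvable S c V) (completable⇒chain f (apply S c) g)

  -- decidability: every quantifier ranges over a finite set
  true? : ∀ (b : Bool) → Dec (b ≡ true)
  true? b = b ≟ᵇ true

  false? : ∀ (b : Bool) → Dec (b ≡ false)
  false? b = b ≟ᵇ false

  metBy? : ∀ w S → Dec (MetBy w S)
  metBy? w S = any? (λ y → true? (S w y))

  isFull? : ∀ S → Dec (IsFull S)
  isFull? S = all? (λ x → all? (λ y → S x y ≟ᵇ F x y))

  isEdgeSubset? : ∀ S → Dec (IsEdgeSubset S)
  isEdgeSubset? S = all? (λ x → all? (λ y → S x y ≟ᵇ S y x)) ×-dec
                    all? (λ x → all? (λ y → true? (S x y) →-dec true? (F x y)))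

  validStar? : ∀ S v P → Dec (ValidStar S v P)
  validStar? S v P =
    isEdgeSubset? S ×-dec false? (P v) ×-dec
    any? (λ w → true? (P w) ×-dec true? (F v w)) ×-dec
    all? (λ w → true? (P w) →-dec metBy? w S) ×-dec
    all? (λ w → all? (λ w' → true? (P w) →-dec true? (P w') →-dec ¬? (w ≟ w') →-dec true? (S w w'))) ×-dec
    all? (λ w → true? (P w) →-dec false? (S v w)) ×-dec
    all? (λ w → all? (λ y → true? (P w) →-dec true? (F v w) →-dec true? (S v y) →-dec false? (S y w)))

  validCode? : ∀ S c → Dec (ValidCode S c)
  validCode? S (edge a b) = isEdgeSubset? S ×-dec true? (F a b) ×-dec ¬? (metBy? a S) ×-dec ¬? (metBy? b S)
  validCode? S (star v p) = validStar? S v (lookup p)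

  someCode? : (Q : StepCode → Set) → (∀ c → Dec (Q c)) → Dec (Σ StepCode Q)
  someCode? Q dq = map′ fwd bwd
    (any? (λ a → any? (λ b → dq (edge a b))) ⊎-dec any? (λ v → anySubset? (λ p → dq (star v p))))
    where
      fwd : (Σ[ a ∈ Fin n ] Σ[ b ∈ Fin n ] Q (edge a b)) ⊎ (Σ[ v ∈ Fin n ] Σ[ p ∈ Vec Bool n ] Q (star v p)) → Σ StepCode Q
      fwd (inj₁ (a , b , q)) = edge a b , q
      fwd (inj₂ (v , p , q)) = star v p , q
      bwd : Σ StepCode Q → (Σ[ a ∈ Fin n ] Σ[ b ∈ Fin n ] Q (edge a b)) ⊎ (Σ[ v ∈ Fin n ] Σ[ p ∈ Vec Bool n ] Q (star v p))
      bwd (edge a b , q) = inj₁ (a , b , q)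
      bwd (star v p , q) = inj₂ (v , p , q)

  completable? : ∀ f S → Dec (Completable f S)
  completable? zero S = isFull? S
  completable? (suc f) S = isFull? S ⊎-dec someCode? _ (λ c → validCode? S c ×-dec completable? f (apply S c))

  _≐_ : EdgeSet n → EdgeSet n → Set
  S ≐ S' = ∀ x y → S x y ≡ S' x y

  ≐-sym : ∀ {S S'} → S ≐ S' → S' ≐ S
  ≐-sym eq x y = sym (eq x y)

  ∪-≐ : ∀ {S} N {S'} → S ⊆ₑ S' → N ⊆ₑ S' → (∀ x y → S' x y ≡ true → S x y ≡ true ⊎ N x y ≡ true) →
        (S ∪ₑ N) ≐ S'
  ∪-≐ {S} N S⊆ N⊆ cover x y = bool-ext (λ h → [ S⊆ x y , N⊆ x y ] (∨-true⁻ (S x y) h))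
                                       (λ h → [ ∨-trueˡ _ , ∨-trueʳ (S x y) ] (cover x y h))

  private
    ≐-true : ∀ {S S'} → S ≐ S' → ∀ {x y} → S x y ≡ true → S' x y ≡ true
    ≐-true eq {x} {y} h = trans (sym (eq x y)) h

    ≐-false : ∀ {S S'} → S ≐ S' → ∀ {x y} → S x y ≡ false → S' x y ≡ false
    ≐-false eq {x} {y} h = trans (sym (eq x y)) h

    ≐-edgeSubset : ∀ {S S'} → S ≐ S' → IsEdgeSubset S → IsEdgeSubset S'
    ≐-edgeSubset eq (sy , sub) = (λ x y → trans (sym (eq x y)) (trans (sy x y) (eq y x))) ,
                                 (λ x y h → sub x y (≐-true (≐-sym eq) h))

    ≐-metBy : ∀ {S S'} → S ≐ S' → ∀ w → MetBy w S → MetBy w S'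
    ≐-metBy eq w (y , h) = y , ≐-true eq h

    ≐-valid : ∀ {S S'} → S ≐ S' → ∀ c → ValidCode S c → ValidCode S' c
    ≐-valid eq (edge a b) (es , f , na , nb) =
      ≐-edgeSubset eq es , f , (λ m → na (≐-metBy (≐-sym eq) a m)) , (λ m → nb (≐-metBy (≐-sym eq) b m))
    ≐-valid eq (star v p) (es , pv , hw , met , cl , nw , noTri) =
      ≐-edgeSubset eq es , pv , hw , (λ w pw → ≐-metBy eq w (met w pw)) ,
      (λ w w' a b c → ≐-true eq (cl w w' a b c)) , (λ w pw → ≐-false eq (nw w pw)) ,
      (λ w y a b c → ≐-false eq (noTri w y a b (≐-true (≐-sym eq) c)))

    ≐-apply : ∀ {S S'} → S ≐ S' → ∀ c → apply S c ≐ apply S' c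
    ≐-apply eq (edge a b) x y = cong (_∨ oneEdge a b x y) (eq x y)
    ≐-apply eq (star v p) x y = cong (_∨ starEdges v (lookup p) x y) (eq x y)

  ≐-completable : ∀ f {S S'} → S ≐ S' → Completable f S → Completable f S'
  ≐-completable zero eq g x y = trans (sym (eq x y)) (g x y)
  ≐-completable (suc f) eq (inj₁ g) = inj₁ (λ x y → trans (sym (eq x y)) (g x y))
  ≐-completable (suc f) eq (inj₂ (c , V , g)) = inj₂ (c , ≐-valid eq c V , ≐-completable f (≐-apply eq c) g)

-- The relation  S ⇝ S'  ("S leads to S'") says that S can be grown into S'
-- by solvable steps, in the form needed later: whenever S' is completable
-- (up to double negation) within every budget bounding its number of
-- missing edges, so is S.  Double negation is unavoidable because the
-- subarrangements driving the construction are undecidable predicates; it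
-- is removed at the very end because completability is decidable.
module Reachability {n : ℕ} (F : Adjacency n) (Fsym : ∀ x y → F x y ≡ F y x) where
  open GraphHS F
  open Plans F Fsym public

  missing : EdgeSet n → ℕ
  missing S = sumFin (λ x → sumFin (λ y → missingFlag (F x y) (S x y)))

  missing-decreases : ∀ S S' → S ⊆ₑ S' → ∀ a b → F a b ≡ true → S a b ≡ false → S' a b ≡ true →
                      missing S' < missing S
  missing-decreases S S' sub a b fab sab s'ab =
    sumFin-strict _ _ (λ x → sumFin-mono _ _ (λ y → missingFlag-anti (F x y) (S x y) (S' x y) (sub x y))) a
      (sumFin-strict _ _ (λ y → missingFlag-anti (F a y) (S a y) (S' a y) (sub a y)) b lt)
    where
      lt : missingFlag (F a b) (S' a b) < missingFlag (F a b) (S a b)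
      lt rewrite fab | sab | s'ab = s≤s z≤n

  missing-cong : ∀ {S S'} → S ≐ S' → missing S ≡ missing S'
  missing-cong eq = sumFin-cong _ _ (λ x → sumFin-cong _ _ (λ y → cong (missingFlag (F x y)) (eq x y)))

  -- every valid step adds an edge of F not yet present
  missing-apply : ∀ S c → ValidCode S c → missing (apply S c) < missing S
  missing-apply S (edge a b) (es , fab , na , nb) =
    missing-decreases S _ (⊆-∪ S _) a b fab sab (∨-trueʳ (S a b) (oneEdge-ab a b))
    where
      sab : S a b ≡ false
      sab with S a b in e
      ... | false = refl
      ... | true = ⊥-elim (na (b , e))
  missing-apply S (star v p) (es , pv , (w , pw , fw) , _ , _ , nw , _) =
    missing-decreases S _ (⊆-∪ S _) v w fw (nw w pw) (∨-trueʳ (S v w) (starEdges-out v (lookup p) pw fw refl))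

  ¬¬Completable : ℕ → EdgeSet n → Set
  ¬¬Completable f S = ¬ ¬ Completable f S

  infix 4 _⇝_
  _⇝_ : EdgeSet n → EdgeSet n → Set
  S ⇝ S' = ∀ f → missing S ≤ f → (∀ f' → missing S' ≤ f' → ¬¬Completable f' S') → ¬¬Completable f S

  ⇝-refl : ∀ {S} → S ⇝ S
  ⇝-refl f le k = k f le

  ⇝-trans : ∀ {S S' S''} → S ⇝ S' → S' ⇝ S'' → S ⇝ S''
  ⇝-trans st1 st2 f le k = st1 f le (λ f' le' → st2 f' le' k)

  ⇝-≐ : ∀ {S S'} → S ≐ S' → S ⇝ S'
  ⇝-≐ {S} {S'} eq f le k ng =
    k f (subst (_≤ f) (missing-cong eq) le) (λ g → ng (≐-completable f (≐-sym eq) g))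

  ⇝-code : ∀ S c → ValidCode S c → S ⇝ apply S c
  ⇝-code S c V zero le k = ⊥-elim (n≮0 (<-≤-trans (missing-apply S c V) le))
    where
      n≮0 : ∀ {a} → a < 0 → ⊥
      n≮0 ()
  ⇝-code S c V (suc f) le k ng = k f (pred-< (<-≤-trans (missing-apply S c V) le)) (λ g → ng (inj₂ (c , V , g)))
    where
      pred-< : ∀ {a} → a < suc f → a ≤ f
      pred-< (s≤s x) = x

  ⇝-edge : ∀ S a b → ValidEdge S a b → S ⇝ addEdge S a b
  ⇝-edge S a b V = ⇝-code S (edge a b) V

  -- a star step on an arbitrary predicate P goes through its tabulation
  ⇝-star : ∀ S v P → ValidStar S v P → S ⇝ addStar S v P
  ⇝-star S v P (es , pv , (w , pw , fw) , met , cl , nw , noTri) =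
    ⇝-trans (⇝-code S (star v (tabulate P)) V')
            (⇝-≐ (λ x y → cong (S x y ∨_) (starEdges-cong x y)))
    where
      tab : ∀ w → lookup (tabulate P) w ≡ P w
      tab = lookup∘tabulate P
      V' : ValidStar S v (lookup (tabulate P))
      V' = es , trans (tab v) pv , (w , trans (tab w) pw , fw) ,
           (λ w pw → met w (trans (sym (tab w)) pw)) ,
           (λ w w' a b c → cl w w' (trans (sym (tab w)) a) (trans (sym (tab w')) b) c) ,
           (λ w pw → nw w (trans (sym (tab w)) pw)) ,
           (λ w y pw → noTri w y (trans (sym (tab w)) pw))
      starEdges-cong : ∀ x y → starEdges v (lookup (tabulate P)) x y ≡ starEdges v P x y
      starEdges-cong x y rewrite tab x | tab y = refl

  ⇝-≐ʳ : ∀ {S S' S''} → S ⇝ S' → S' ≐ S'' → S ⇝ S''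
  ⇝-≐ʳ st eq = ⇝-trans st (⇝-≐ eq)

-- Signs ±1 appear because an
-- edge hyperplane x_i - x_j is only determined up to orientation.
module FieldLemmas {c ℓ} (K : Field c ℓ) where
  open Field K hiding (refl; sym; trans)
  open Field K using () renaming (refl to ≈-refl; sym to ≈-sym; trans to ≈-trans)
  open import Algebra.Properties.Ring ring public
  open import Relation.Binary.Reasoning.Setoid setoid

  x-0≈x : ∀ x → x - 0# ≈ x
  x-0≈x x = begin x + - 0# ≈⟨ +-congˡ -0#≈0# ⟩ x + 0# ≈⟨ +-identityʳ x ⟩ x ∎

  0-x≈-x : ∀ x → 0# - x ≈ - x
  0-x≈-x x = +-identityˡ (- x)

  0-0≈0 : 0# - 0# ≈ 0#
  0-0≈0 = x-0≈x 0#

  +≈0⇒≈- : ∀ a b → a + b ≈ 0# → b ≈ - a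
  +≈0⇒≈- a b h = +-inverseʳ-unique a b h

  -1≉0 : ¬ (- 1# ≈ 0#)
  -1≉0 h = 1≉0 (begin 1# ≈⟨ ≈-sym (-‿involutive 1#) ⟩ - (- 1#) ≈⟨ -‿cong h ⟩ - 0# ≈⟨ -0#≈0# ⟩ 0# ∎)

  IsSign : Carrier → Set ℓ
  IsSign s = (s ≈ 1#) ⊎ (s ≈ - 1#)

  sign≉0 : ∀ {s} → IsSign s → ¬ (s ≈ 0#)
  sign≉0 (inj₁ h) z = 1≉0 (≈-trans (≈-sym h) z)
  sign≉0 (inj₂ h) z = -1≉0 (≈-trans (≈-sym h) z)

  cancelʳ : ∀ x y → x * y ≈ 0# → ¬ (y ≈ 0#) → x ≈ 0#
  cancelʳ x y h nz with inverse y nz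
  ... | (w , yw) = begin
      x ≈⟨ ≈-sym (*-identityʳ x) ⟩ x * 1# ≈⟨ *-congˡ (≈-sym yw) ⟩ x * (y * w)
        ≈⟨ ≈-sym (*-assoc x y w) ⟩ (x * y) * w ≈⟨ *-congʳ h ⟩ 0# * w ≈⟨ zeroˡ w ⟩ 0# ∎

  -*≈- : ∀ a x → (- a) * x ≈ - (a * x)
  -*≈- a x = ≈-sym (-‿distribˡ-* a x)

  -[x-y]≈y-x : ∀ p q → - (p - q) ≈ q - p
  -[x-y]≈y-x p q = ⁻¹-anti-homo‿- p q

  -- the three edge vectors of a triangle are dependent
  telescope : ∀ p q r → ((p - q) + (q - r)) + - (p - r) ≈ 0#
  telescope p q r = begin
      ((p - q) + (q - r)) + - (p - r) ≈⟨ +-congˡ (-[x-y]≈y-x p r) ⟩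
      ((p - q) + (q - r)) + (r - p) ≈⟨ +-assoc (p - q) (q - r) (r - p) ⟩
      (p - q) + ((q - r) + (r - p)) ≈⟨ +-congˡ (+-assoc q (- r) (r - p)) ⟩
      (p - q) + (q + (- r + (r - p))) ≈⟨ +-congˡ (+-congˡ (≈-sym (+-assoc (- r) r (- p)))) ⟩
      (p - q) + (q + ((- r + r) - p)) ≈⟨ +-congˡ (+-congˡ (+-congʳ (-‿inverseˡ r))) ⟩
      (p - q) + (q + (0# - p)) ≈⟨ +-congˡ (+-congˡ (+-identityˡ (- p))) ⟩
      (p - q) + (q - p) ≈⟨ +-assoc p (- q) (q - p) ⟩
      p + (- q + (q - p)) ≈⟨ +-congˡ (≈-sym (+-assoc (- q) q (- p))) ⟩
      p + ((- q + q) - p) ≈⟨ +-congˡ (+-congʳ (-‿inverseˡ q)) ⟩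
      p + (0# - p) ≈⟨ +-congˡ (+-identityˡ (- p)) ⟩
      p - p ≈⟨ -‿inverseʳ p ⟩
      0# ∎

  sign-cancel : ∀ α {s} → IsSign s → α * s ≈ 0# → α ≈ 0#
  sign-cancel α p h = cancelʳ α _ h (sign≉0 p)

  -- coefficient computation for two hyperplanes x_i = a x₀ and x_i = b x₀, a ≠ b
  pairCancel : ∀ x y a b → x + y ≈ 0# → x * (- a) + y * (- b) ≈ 0# → ¬ (b - a ≈ 0#) → x ≈ 0#
  pairCancel x y a b h1 h2 nz = cancelʳ x (b - a) h3 nz
    where
      y≈ : y ≈ - x
      y≈ = +≈0⇒≈- x y h1
      e1 : y * (- b) ≈ x * b
      e1 = begin y * (- b) ≈⟨ *-congʳ y≈ ⟩ (- x) * (- b) ≈⟨ -*≈- x (- b) ⟩ - (x * - b)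
             ≈⟨ -‿cong (≈-sym (-‿distribʳ-* x b)) ⟩ - (- (x * b)) ≈⟨ -‿involutive (x * b) ⟩ x * b ∎
      h3 : x * (b - a) ≈ 0#
      h3 = begin x * (b - a) ≈⟨ x[y-z]≈xy-xz x b a ⟩ x * b - x * a ≈⟨ +-comm (x * b) (- (x * a)) ⟩
             - (x * a) + x * b ≈⟨ +-cong (-‿distribʳ-* x a) (≈-sym e1) ⟩ x * (- a) + y * (- b) ≈⟨ h2 ⟩ 0# ∎

  -- evaluating a relation at a coordinate where two of the vectors vanish
  drop-zeros : ∀ A B C → (A + B * 0#) + C * 0# ≈ A
  drop-zeros A B C = begin (A + B * 0#) + C * 0# ≈⟨ +-cong (+-congˡ (zeroʳ B)) (zeroʳ C) ⟩
                (A + 0#) + 0# ≈⟨ +-identityʳ _ ⟩ A + 0# ≈⟨ +-identityʳ A ⟩ A ∎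

  -- coefficient computation for x_p - x_q, x_p - u₁ x₀ and x_q - u₂ x₀ at the
  -- coordinates p, q and x₀: with u₁ ≠ u₂ the relation is trivial
  spreadCancel : ∀ α s β γ u1 u2 → IsSign s →
           (α * s + β * 1#) + γ * 0# ≈ 0# →
           (α * (- s) + β * 0#) + γ * 1# ≈ 0# →
           (α * 0# + β * (- u1)) + γ * (- u2) ≈ 0# →
           ¬ (u2 - u1 ≈ 0#) → α ≈ 0# × β ≈ 0# × γ ≈ 0#
  spreadCancel α s β γ u1 u2 ps e1 e2 e3 nz = sign-cancel α ps As≈0 , β0 , ≈-trans γ≈ As≈0
    where
      A : Carrier
      A = α * s
      e1' : A + β ≈ 0#
      e1' = ≈-trans (≈-sym (≈-trans (+-identityʳ _) (+-congˡ (*-identityʳ β)))) (≈-trans (+-congˡ (≈-sym (zeroʳ γ))) e1)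
      e2' : - A + γ ≈ 0#
      e2' = begin - A + γ ≈⟨ +-congʳ (-‿distribʳ-* α s) ⟩ α * (- s) + γ ≈⟨ +-congˡ (≈-sym (*-identityʳ γ)) ⟩
              α * (- s) + γ * 1# ≈⟨ +-congʳ (≈-sym (+-identityʳ _)) ⟩ (α * (- s) + 0#) + γ * 1#
              ≈⟨ +-congʳ (+-congˡ (≈-sym (zeroʳ β))) ⟩ (α * (- s) + β * 0#) + γ * 1# ≈⟨ e2 ⟩ 0# ∎
      e3' : β * (- u1) + γ * (- u2) ≈ 0#
      e3' = ≈-trans (+-congʳ (≈-sym (≈-trans (+-congʳ (zeroʳ α)) (+-identityˡ _)))) e3
      β≈ : β ≈ - A
      β≈ = +≈0⇒≈- A β e1'
      γ≈ : γ ≈ A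
      γ≈ = ≈-trans (+≈0⇒≈- (- A) γ e2') (-‿involutive A)
      sum : β + γ ≈ 0#
      sum = begin β + γ ≈⟨ +-cong β≈ γ≈ ⟩ - A + A ≈⟨ -‿inverseˡ A ⟩ 0# ∎
      β0 : β ≈ 0#
      β0 = pairCancel β γ u1 u2 sum e3' nz
      As≈0 : A ≈ 0#
      As≈0 = begin A ≈⟨ ≈-sym (-‿involutive A) ⟩ - (- A) ≈⟨ -‿cong (≈-sym β≈) ⟩ - β ≈⟨ -‿cong β0 ⟩ - 0# ≈⟨ -0#≈0# ⟩ 0# ∎

  -- (a - b) x₀ + (x_i - a x₀) - (x_i - b x₀) = 0, at the coordinate x₀ and at any
  -- other coordinate
  originRelation-x₀ : ∀ a b → ((a - b) * 1# + 1# * (- a)) + (- 1#) * (- b) ≈ 0#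
  originRelation-x₀ a b = begin
      ((a - b) * 1# + 1# * (- a)) + (- 1#) * (- b) ≈⟨ +-cong (+-cong (*-identityʳ _) (*-identityˡ _)) (-1*x≈-x (- b)) ⟩
      ((a - b) + - a) + - (- b) ≈⟨ +-congˡ (-‿involutive b) ⟩
      ((a - b) + - a) + b ≈⟨ +-congʳ (+-comm (a - b) (- a)) ⟩
      (- a + (a - b)) + b ≈⟨ +-congʳ (≈-sym (+-assoc (- a) a (- b))) ⟩
      ((- a + a) - b) + b ≈⟨ +-congʳ (+-congʳ (-‿inverseˡ a)) ⟩
      (0# - b) + b ≈⟨ +-congʳ (+-identityˡ (- b)) ⟩
      - b + b ≈⟨ -‿inverseˡ b ⟩ 0# ∎

  originRelation-interior : ∀ α X Y → X ≈ Y → (α * 0# + 1# * X) + (- 1#) * Y ≈ 0#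
  originRelation-interior α X Y e = begin
      (α * 0# + 1# * X) + (- 1#) * Y ≈⟨ +-cong (+-cong (zeroʳ α) (*-identityˡ X)) (-1*x≈-x Y) ⟩
      (0# + X) - Y ≈⟨ +-congʳ (+-identityˡ X) ⟩ X - Y ≈⟨ +-congˡ (-‿cong (≈-sym e)) ⟩ X - X ≈⟨ -‿inverseʳ X ⟩ 0# ∎

-- The normal of
-- the edge hyperplane ij is  v_i - v_j , where the vertex vector v_x is the
-- unit vector of x for an interior vertex and  u(x)·e₀  for a boundary vertex;
-- the normal of x₀ = 0 is e₀.  The main facts: two distinct hyperplanes are
-- independent, in a dependent triple every interior endpoint of one member
-- lies on another member, the edges of a triangle are dependent, and so is
-- {x₀ = 0, x_i = u(b)x₀, x_i = u(b')x₀}; while {x_p = x_q, x_p = u(b)x₀,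
-- x_q = u(b')x₀} is independent when b ≠ b' (this is where injectivity of u
-- on the boundary is used).
module ArrangementNormals {c ℓ} (K : Field c ℓ) {n : ℕ} (E : Adjacency n) (inB : Fin n → Bool)
  (u : Fin n → Field.Carrier K)
  (Esym : ∀ i j → E i j ≡ E j i) (Eirr : ∀ i → E i i ≡ false)
  (bdNA : ∀ b b' → inB b ≡ true → inB b' ≡ true → E b b' ≡ false)
  (uinj : ∀ b b' → inB b ≡ true → inB b' ≡ true → Field._≈_ K (u b) (u b') → b ≡ b') where

  open Field K hiding (refl; sym; trans)
  open Field K using () renaming (refl to ≈-refl; sym to ≈-sym; trans to ≈-trans)
  open FieldLemmas K
  open GraphicArr K E inB u
  open ArrHS K normal using (Dep)
  open import Relation.Binary.Reasoning.Setoid setoid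

  E-irrefl : ∀ {i j} → E i j ≡ true → i ≢ j
  E-irrefl {i} e refl = true≢false e (Eirr i)

  interior≢boundary : ∀ {z w} → inB z ≡ false → inB w ≡ true → z ≢ w
  interior≢boundary p q e = true≢false q (trans (cong inB (sym e)) p)

  rep-edge : ∀ {i j} → T (isRep i j) → E i j ≡ true
  rep-edge {i} {j} t = proj₁ (∧-true⁻ (E i j) (T⇒≡ t))

  rep-first-interior : ∀ {i j} → T (isRep i j) → inB i ≡ false
  rep-first-interior {i} {j} t = not-true⁻ (proj₁ (∧-true⁻ (not (inB i)) (proj₂ (∧-true⁻ (E i j) (T⇒≡ t)))))

  rep-second : ∀ {i j} → T (isRep i j) → inB j ≡ true ⊎ (toℕ i ℕ.<ᵇ toℕ j) ≡ true
  rep-second {i} {j} t = ∨-true⁻ (inB j) (proj₂ (∧-true⁻ (not (inB i)) (proj₂ (∧-true⁻ (E i j) (T⇒≡ t)))))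

  <ᵇ-asym : ∀ (a b : Fin n) → (toℕ a ℕ.<ᵇ toℕ b) ≡ true → (toℕ b ℕ.<ᵇ toℕ a) ≡ true → ⊥
  <ᵇ-asym a b p q = <-asym (<ᵇ⇒< (toℕ a) (toℕ b) (≡⇒T p)) (<ᵇ⇒< (toℕ b) (toℕ a) (≡⇒T q))

  rep-unique : ∀ {x y} → T (isRep x y) → T (isRep y x) → ⊥
  rep-unique {x} {y} t t' with rep-second t | rep-second t'
  ... | inj₁ b | _ = true≢false b (rep-first-interior t')
  ... | inj₂ _ | inj₁ b = true≢false b (rep-first-interior t)
  ... | inj₂ l1 | inj₂ l2 = <ᵇ-asym x y l1 l2

  isRep-true : ∀ i j → E i j ≡ true → inB i ≡ false → inB j ≡ true ⊎ (toℕ i ℕ.<ᵇ toℕ j) ≡ true →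
               isRep i j ≡ true
  isRep-true i j e ii o rewrite e | ii = [ ∨-trueˡ _ , ∨-trueʳ (inB j) ] o

  rep-exists : ∀ x y → E x y ≡ true → isRep x y ≡ false → isRep y x ≡ false → ⊥
  rep-exists x y exy r1 r2 with bool-cases (inB x) | bool-cases (inB y)
  ... | inj₁ bx | inj₁ by = true≢false exy (bdNA x y bx by)
  ... | inj₁ bx | inj₂ iy = true≢false (isRep-true y x (trans (Esym y x) exy) iy (inj₁ bx)) r2
  ... | inj₂ ix | inj₁ by = true≢false (isRep-true x y exy ix (inj₁ by)) r1
  ... | inj₂ ix | inj₂ iy with <-cmp (toℕ x) (toℕ y)
  ...   | tri< lt _ _ = true≢false (isRep-true x y exy ix (inj₂ (T⇒≡ (<⇒<ᵇ lt)))) r1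
  ...   | tri> _ _ gt = true≢false (isRep-true y x (trans (Esym y x) exy) iy (inj₂ (T⇒≡ (<⇒<ᵇ gt)))) r2
  ...   | tri≈ _ eq _ = E-irrefl exy (toℕ-injective eq)

  just-≡ : ∀ {i j i' j'} {t : T (isRep i j)} {t' : T (isRep i' j')} → i ≡ i' → j ≡ j' →
           just ((i , j) , t) ≡ just ((i' , j') , t')
  just-≡ {t = t} {t' = t'} refl refl = cong (λ z → just (_ , z)) (T-irrelevant t t')

  just-injective : ∀ {i j i' j'} {t : T (isRep i j)} {t' : T (isRep i' j')} → _≡_ {A = Idx} (just ((i , j) , t)) (just ((i' , j') , t')) → i ≡ i' × j ≡ j'
  just-injective refl = refl , refl

  EdgeHyp : Idx → Fin n → Fin n → Set
  EdgeHyp h x y = Σ[ i ∈ Fin n ] Σ[ j ∈ Fin n ] Σ[ t ∈ T (isRep i j) ]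
                (h ≡ just ((i , j) , t) × ((i ≡ x × j ≡ y) ⊎ (i ≡ y × j ≡ x)))

  just-edgeHyp : ∀ i j t → EdgeHyp (just ((i , j) , t)) i j
  just-edgeHyp i j t = i , j , t , refl , inj₁ (refl , refl)

  edgeHyp-swap : ∀ {h x y} → EdgeHyp h x y → EdgeHyp h y x
  edgeHyp-swap (i , j , t , e , inj₁ (a , b)) = i , j , t , e , inj₂ (a , b)
  edgeHyp-swap (i , j , t , e , inj₂ (a , b)) = i , j , t , e , inj₁ (a , b)

  edgeHyp-ends : ∀ {h x y z w} → EdgeHyp h x y → EdgeHyp h z w → (x ≡ z × y ≡ w) ⊎ (x ≡ w × y ≡ z)
  edgeHyp-ends (i , j , t , refl , o1) (i' , j' , t' , e' , o2) with just-injective e'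
  edgeHyp-ends (i , j , t , refl , inj₁ (refl , refl)) (i , j , t' , e' , inj₁ (refl , refl)) | refl , refl = inj₁ (refl , refl)
  edgeHyp-ends (i , j , t , refl , inj₁ (refl , refl)) (i , j , t' , e' , inj₂ (refl , refl)) | refl , refl = inj₂ (refl , refl)
  edgeHyp-ends (i , j , t , refl , inj₂ (refl , refl)) (i , j , t' , e' , inj₁ (refl , refl)) | refl , refl = inj₂ (refl , refl)
  edgeHyp-ends (i , j , t , refl , inj₂ (refl , refl)) (i , j , t' , e' , inj₂ (refl , refl)) | refl , refl = inj₁ (refl , refl)

  edgeHyp-unique : ∀ {h h' x y} → EdgeHyp h x y → EdgeHyp h' x y → h ≡ h'
  edgeHyp-unique (i , j , t , refl , inj₁ (refl , refl)) (i' , j' , t' , refl , inj₁ (refl , refl)) = just-≡ refl refl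
  edgeHyp-unique (i , j , t , refl , inj₂ (refl , refl)) (i' , j' , t' , refl , inj₂ (refl , refl)) = just-≡ refl refl
  edgeHyp-unique (i , j , t , refl , inj₁ (refl , refl)) (i' , j' , t' , refl , inj₂ (refl , refl)) = ⊥-elim (rep-unique t t')
  edgeHyp-unique (i , j , t , refl , inj₂ (refl , refl)) (i' , j' , t' , refl , inj₁ (refl , refl)) = ⊥-elim (rep-unique t t')

  edgeHyp-≢ : ∀ {P p q} → EdgeHyp P p q → p ≢ q
  edgeHyp-≢ (i , j , t , _ , inj₁ (refl , refl)) e = E-irrefl (rep-edge t) e
  edgeHyp-≢ (i , j , t , _ , inj₂ (refl , refl)) e = E-irrefl (rep-edge t) (sym e)

  edgeHyp-E : ∀ {h x y} → EdgeHyp h x y → E x y ≡ true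
  edgeHyp-E (i , j , t , refl , inj₁ (refl , refl)) = rep-edge t
  edgeHyp-E (i , j , t , refl , inj₂ (refl , refl)) = trans (Esym _ _) (rep-edge t)

  selectHyp : ∀ x y b1 → isRep x y ≡ b1 → ∀ b2 → isRep y x ≡ b2 → Idx
  selectHyp x y true e1 _ _ = just ((x , y) , ≡⇒T e1)
  selectHyp x y false _ true e2 = just ((y , x) , ≡⇒T e2)
  selectHyp x y false _ false _ = nothing

  hypOf : Fin n → Fin n → Idx
  hypOf x y = selectHyp x y (isRep x y) refl (isRep y x) refl

  selectHyp-edgeHyp : ∀ x y → E x y ≡ true → ∀ b1 (e1 : isRep x y ≡ b1) b2 (e2 : isRep y x ≡ b2) → EdgeHyp (selectHyp x y b1 e1 b2 e2) x y
  selectHyp-edgeHyp x y exy true e1 b2 e2 = x , y , ≡⇒T e1 , refl , inj₁ (refl , refl)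
  selectHyp-edgeHyp x y exy false e1 true e2 = y , x , ≡⇒T e2 , refl , inj₂ (refl , refl)
  selectHyp-edgeHyp x y exy false e1 false e2 = ⊥-elim (rep-exists x y exy e1 e2)

  hypOf-edgeHyp : ∀ {x y} → E x y ≡ true → EdgeHyp (hypOf x y) x y
  hypOf-edgeHyp {x} {y} exy = selectHyp-edgeHyp x y exy (isRep x y) refl (isRep y x) refl

  selectHyp-just : ∀ i j (t : T (isRep i j)) b1 (e1 : isRep i j ≡ b1) b2 (e2 : isRep j i ≡ b2) → selectHyp i j b1 e1 b2 e2 ≡ just ((i , j) , t)
  selectHyp-just i j t true e1 b2 e2 = just-≡ refl refl
  selectHyp-just i j t false e1 b2 e2 = ⊥-elim (true≢false (T⇒≡ t) e1)

  hypOf-just : ∀ i j (t : T (isRep i j)) → hypOf i j ≡ just ((i , j) , t)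
  hypOf-just i j t = selectHyp-just i j t (isRep i j) refl (isRep j i) refl

  edgeHyp-hypOf : ∀ {h x y} → EdgeHyp h x y → h ≡ hypOf x y
  edgeHyp-hypOf e = edgeHyp-unique e (hypOf-edgeHyp (edgeHyp-E e))

  hypOf-sym : ∀ {x y} → E x y ≡ true → hypOf x y ≡ hypOf y x
  hypOf-sym {x} {y} e = edgeHyp-unique (hypOf-edgeHyp e) (edgeHyp-swap (hypOf-edgeHyp (trans (Esym y x) e)))

  touches : Idx → Fin n → Bool
  touches nothing z = false
  touches (just ((i , j) , _)) z = (z == i) ∨ (z == j)

  touches-cases : ∀ {i j t z} → touches (just ((i , j) , t)) z ≡ true → z ≡ i ⊎ z ≡ j
  touches-cases {i} {j} {t} {z} h with ∨-true⁻ (z == i) h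
  ... | inj₁ p = inj₁ (==⇒≡ p)
  ... | inj₂ p = inj₂ (==⇒≡ p)

  touches-false : ∀ {i j t z} → touches (just ((i , j) , t)) z ≡ false → z ≢ i × z ≢ j
  touches-false {i} {j} {t} {z} h = ==false⇒≢ (∨-false⁻ˡ (z == i) h) , ==false⇒≢ (∨-false⁻ʳ (z == i) h)

  touches-first : ∀ {i j t} → touches (just ((i , j) , t)) i ≡ true
  touches-first {i} rewrite ==-refl i = refl

  touches-second : ∀ {i j t} → touches (just ((i , j) , t)) j ≡ true
  touches-second {i} {j} rewrite ==-refl j = ∨-trueʳ (j == i) refl

  touches-edgeHyp : ∀ {h x y z} → EdgeHyp h x y → touches h z ≡ true → z ≡ x ⊎ z ≡ y
  touches-edgeHyp (i , j , t , refl , inj₁ (refl , refl)) v = touches-cases {i} {j} {t} v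
  touches-edgeHyp (i , j , t , refl , inj₂ (refl , refl)) v with touches-cases {i} {j} {t} v
  ... | inj₁ a = inj₂ a
  ... | inj₂ a = inj₁ a

  touches-edgeHyp-first : ∀ {h x y} → EdgeHyp h x y → touches h x ≡ true
  touches-edgeHyp-first (i , j , t , refl , inj₁ (refl , refl)) = touches-first {i} {j} {t}
  touches-edgeHyp-first (i , j , t , refl , inj₂ (refl , refl)) = touches-second {i} {j} {t}

  touches-edgeHyp-second : ∀ {h x y} → EdgeHyp h x y → touches h y ≡ true
  touches-edgeHyp-second e = touches-edgeHyp-first (edgeHyp-swap e)

  touches-edgeHyp-false : ∀ {h x y z} → EdgeHyp h x y → z ≢ x → z ≢ y → touches h z ≡ false
  touches-edgeHyp-false (i , j , t , refl , inj₁ (refl , refl)) a b = ∨-false (≢⇒==false a) (≢⇒==false b)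
  touches-edgeHyp-false (i , j , t , refl , inj₂ (refl , refl)) a b = ∨-false (≢⇒==false b) (≢⇒==false a)

  coordOf : (x : Fin n) → inB x ≡ false → Coord
  coordOf x p = just (x , subst (λ b → T (not b)) (sym p) tt)

  vertexVec : Fin n → Coord → Carrier
  vertexVec p nothing = if inB p then u p else 0#
  vertexVec p (just (k , _)) = if inB p then 0# else δ p k

  normal-edge : ∀ i j t c → normal (just ((i , j) , t)) c ≈ vertexVec i c - vertexVec j c
  normal-edge i j t nothing with inB i | rep-first-interior {i} {j} t
  ... | false | _ with inB j
  ...   | true = ≈-sym (0-x≈-x (u j))
  ...   | false = ≈-sym 0-0≈0
  normal-edge i j t (just (k , _)) with inB i | rep-first-interior {i} {j} t
  ... | false | _ with inB j
  ...   | true = ≈-sym (x-0≈x _)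
  ...   | false = ≈-refl

  vertexVec-same : ∀ x (p : inB x ≡ false) → vertexVec x (coordOf x p) ≈ 1#
  vertexVec-same x p rewrite p | ==-refl x = ≈-refl

  vertexVec-other : ∀ y x (p : inB x ≡ false) → y ≢ x → vertexVec y (coordOf x p) ≈ 0#
  vertexVec-other y x p ne with inB y
  ... | true = ≈-refl
  ... | false rewrite ≢⇒==false ne = ≈-refl

  vertexVec-x₀-interior : ∀ y → inB y ≡ false → vertexVec y nothing ≈ 0#
  vertexVec-x₀-interior y p rewrite p = ≈-refl

  vertexVec-x₀-boundary : ∀ y → inB y ≡ true → vertexVec y nothing ≈ u y
  vertexVec-x₀-boundary y p rewrite p = ≈-refl

  -‿cong₂ : ∀ {a b c d} → a ≈ b → c ≈ d → a - c ≈ b - d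
  -‿cong₂ p q = +-cong p (-‿cong q)

  normal-off : ∀ h z (p : inB z ≡ false) → touches h z ≡ false → normal h (coordOf z p) ≈ 0#
  normal-off nothing z p v = ≈-refl
  normal-off (just ((i , j) , t)) z p v = begin
      normal (just ((i , j) , t)) (coordOf z p) ≈⟨ normal-edge i j t (coordOf z p) ⟩
      vertexVec i (coordOf z p) - vertexVec j (coordOf z p)
        ≈⟨ -‿cong₂ (vertexVec-other i z p (λ e → proj₁ (touches-false {i} {j} {t} v) (sym e)))
                   (vertexVec-other j z p (λ e → proj₂ (touches-false {i} {j} {t} v) (sym e))) ⟩
      0# - 0# ≈⟨ 0-0≈0 ⟩ 0# ∎

  normal-on : ∀ h z (p : inB z ≡ false) → touches h z ≡ true → Σ[ s ∈ Carrier ] (IsSign s × normal h (coordOf z p) ≈ s)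
  normal-on nothing z p ()
  normal-on (just ((i , j) , t)) z p v with touches-cases {i} {j} {t} {z} v
  ... | inj₁ refl = 1# , inj₁ ≈-refl , (begin
        normal (just ((z , j) , t)) (coordOf z p) ≈⟨ normal-edge z j t (coordOf z p) ⟩
        vertexVec z (coordOf z p) - vertexVec j (coordOf z p) ≈⟨ -‿cong₂ (vertexVec-same z p) (vertexVec-other j z p (λ e → E-irrefl (rep-edge t) (sym e))) ⟩
        1# - 0# ≈⟨ x-0≈x 1# ⟩ 1# ∎)
  ... | inj₂ refl = - 1# , inj₂ ≈-refl , (begin
        normal (just ((i , z) , t)) (coordOf z p) ≈⟨ normal-edge i z t (coordOf z p) ⟩
        vertexVec i (coordOf z p) - vertexVec z (coordOf z p) ≈⟨ -‿cong₂ (vertexVec-other i z p (E-irrefl (rep-edge t))) (vertexVec-same z p) ⟩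
        0# - 1# ≈⟨ 0-x≈-x 1# ⟩ - 1# ∎)

  normal-at-first : ∀ i j t (p : inB i ≡ false) → normal (just ((i , j) , t)) (coordOf i p) ≈ 1#
  normal-at-first i j t p = begin
      normal (just ((i , j) , t)) (coordOf i p) ≈⟨ normal-edge i j t (coordOf i p) ⟩
      vertexVec i (coordOf i p) - vertexVec j (coordOf i p) ≈⟨ -‿cong₂ (vertexVec-same i p) (vertexVec-other j i p (λ e → E-irrefl (rep-edge t) (sym e))) ⟩
      1# - 0# ≈⟨ x-0≈x 1# ⟩ 1# ∎

  normal-at-second : ∀ i j t (p : inB j ≡ false) → normal (just ((i , j) , t)) (coordOf j p) ≈ - 1#
  normal-at-second i j t p = begin
      normal (just ((i , j) , t)) (coordOf j p) ≈⟨ normal-edge i j t (coordOf j p) ⟩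
      vertexVec i (coordOf j p) - vertexVec j (coordOf j p) ≈⟨ -‿cong₂ (vertexVec-other i j p (E-irrefl (rep-edge t))) (vertexVec-same j p) ⟩
      0# - 1# ≈⟨ 0-x≈-x 1# ⟩ - 1# ∎

  normal-x₀-interior : ∀ i j t → inB j ≡ false → normal (just ((i , j) , t)) nothing ≈ 0#
  normal-x₀-interior i j t p = begin
      normal (just ((i , j) , t)) nothing ≈⟨ normal-edge i j t nothing ⟩
      vertexVec i nothing - vertexVec j nothing ≈⟨ -‿cong₂ (vertexVec-x₀-interior i (rep-first-interior t)) (vertexVec-x₀-interior j p) ⟩
      0# - 0# ≈⟨ 0-0≈0 ⟩ 0# ∎

  normal-x₀-boundary : ∀ i j t → inB j ≡ true → normal (just ((i , j) , t)) nothing ≈ - u j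
  normal-x₀-boundary i j t p = begin
      normal (just ((i , j) , t)) nothing ≈⟨ normal-edge i j t nothing ⟩
      vertexVec i nothing - vertexVec j nothing ≈⟨ -‿cong₂ (vertexVec-x₀-interior i (rep-first-interior t)) (vertexVec-x₀-boundary j p) ⟩
      0# - u j ≈⟨ 0-x≈-x (u j) ⟩ - u j ∎

  edgeHyp-orient : ∀ {h x y} → EdgeHyp h x y → Σ[ s ∈ Carrier ] (IsSign s × (∀ k → s * normal h k ≈ vertexVec x k - vertexVec y k))
  edgeHyp-orient (i , j , t , refl , inj₁ (refl , refl)) = 1# , inj₁ ≈-refl , (λ k → ≈-trans (*-identityˡ _) (normal-edge i j t k))
  edgeHyp-orient (i , j , t , refl , inj₂ (refl , refl)) = - 1# , inj₂ ≈-refl , λ k → begin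
      - 1# * normal (just ((i , j) , t)) k ≈⟨ -1*x≈-x _ ⟩ - normal (just ((i , j) , t)) k
      ≈⟨ -‿cong (normal-edge i j t k) ⟩ - (vertexVec i k - vertexVec j k) ≈⟨ -[x-y]≈y-x (vertexVec i k) (vertexVec j k) ⟩ vertexVec j k - vertexVec i k ∎

  edgeHyp-values : ∀ {P p q} → EdgeHyp P p q → (ip : inB p ≡ false) (iq : inB q ≡ false) →
            Σ[ s ∈ Carrier ] (IsSign s × normal P (coordOf p ip) ≈ s × normal P (coordOf q iq) ≈ - s × normal P nothing ≈ 0#)
  edgeHyp-values (i , j , t , refl , inj₁ (refl , refl)) ip iq = 1# , inj₁ ≈-refl , normal-at-first i j t ip , normal-at-second i j t iq , normal-x₀-interior i j t iq
  edgeHyp-values (i , j , t , refl , inj₂ (refl , refl)) ip iq = - 1# , inj₂ ≈-refl , normal-at-second i j t ip ,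
              ≈-trans (normal-at-first i j t iq) (≈-sym (-‿involutive 1#)) , normal-x₀-interior i j t ip

  dep-swap₁₂ : ∀ {a b d} → Dep a b d → Dep b a d
  dep-swap₁₂ {a} {b} {d} (α , β , γ , nt , r) = β , α , γ , (λ { (x , y , z) → nt (y , x , z) }) ,
    (λ k → ≈-trans (+-congʳ (+-comm _ _)) (r k))

  dep-swap₂₃ : ∀ {a b d} → Dep a b d → Dep a d b
  dep-swap₂₃ {a} {b} {d} (α , β , γ , nt , r) = α , γ , β , (λ { (x , y , z) → nt (x , z , y) }) ,
    (λ k → ≈-trans (swap-last _ _ _) (r k))
    where
      swap-last : ∀ A B C → (A + C) + B ≈ (A + B) + C
      swap-last A B C = begin (A + C) + B ≈⟨ +-assoc A C B ⟩ A + (C + B) ≈⟨ +-congˡ (+-comm C B) ⟩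
                        A + (B + C) ≈⟨ ≈-sym (+-assoc A B C) ⟩ (A + B) + C ∎

  dep-rotate : ∀ {a b d} → Dep a b d → Dep d a b
  dep-rotate {a} {b} {d} D = dep-swap₁₂ {a} {d} {b} (dep-swap₂₃ {a} {b} {d} D)

  PairRelation : Carrier → Idx → Carrier → Idx → Set ℓ
  PairRelation β b γ d = ∀ k → β * normal b k + γ * normal d k ≈ 0#

  relation-swap : ∀ β b γ d → PairRelation β b γ d → PairRelation γ d β b
  relation-swap β b γ d r k = ≈-trans (+-comm _ _) (r k)

  lone-independent : ∀ d γ → (∀ k → γ * normal d k ≈ 0#) → γ ≈ 0#
  lone-independent nothing γ r = ≈-trans (≈-sym (*-identityʳ γ)) (r nothing)
  lone-independent (just ((i , j) , t)) γ r =
    cancelʳ γ 1# (≈-trans (*-congˡ (≈-sym (normal-at-first i j t (rep-first-interior t))))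
                          (r (coordOf i (rep-first-interior t)))) 1≉0

  private-coordinate : ∀ b d β γ → PairRelation β b γ d →
           ∀ z (p : inB z ≡ false) → touches b z ≡ true → touches d z ≡ false → β ≈ 0# × γ ≈ 0#
  private-coordinate b d β γ r z p vb vd with normal-on b z p vb
  ... | (s , ps , e) = β0 , lone-independent d γ r'
    where
      β0 : β ≈ 0#
      β0 = sign-cancel β ps (begin β * s ≈⟨ ≈-sym (+-identityʳ _) ⟩ β * s + 0# ≈⟨ +-cong (*-congˡ (≈-sym e)) (≈-sym (zeroʳ γ)) ⟩
              β * normal b (coordOf z p) + γ * 0# ≈⟨ +-congˡ (*-congˡ (≈-sym (normal-off d z p vd))) ⟩
              β * normal b (coordOf z p) + γ * normal d (coordOf z p) ≈⟨ r (coordOf z p) ⟩ 0# ∎)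
      r' : ∀ k → γ * normal d k ≈ 0#
      r' k = begin γ * normal d k ≈⟨ ≈-sym (+-identityˡ _) ⟩ 0# + γ * normal d k
               ≈⟨ +-congʳ (≈-sym (≈-trans (*-congʳ β0) (zeroˡ _))) ⟩ β * normal b k + γ * normal d k ≈⟨ r k ⟩ 0# ∎

  private-coordinateʳ : ∀ b d β γ → PairRelation β b γ d →
           ∀ z (p : inB z ≡ false) → touches d z ≡ true → touches b z ≡ false → β ≈ 0# × γ ≈ 0#
  private-coordinateʳ b d β γ r z p vd vb =
    let (γ0 , β0) = private-coordinate d b γ β (relation-swap β b γ d r) z p vd vb in β0 , γ0

  -- two hyperplanes of edges i j and i j' with j ≠ j': if j or j' is interior
  -- it is a private vertex, otherwise compare the coordinates x_i and x₀
  sameFirst-independent : ∀ i j j' (t : T (isRep i j)) (t' : T (isRep i j')) → j ≢ j' → ∀ β γ →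
                          PairRelation β (just ((i , j) , t)) γ (just ((i , j') , t')) → β ≈ 0# × γ ≈ 0#
  sameFirst-independent i j j' t t' jj' β γ r with bool-cases (inB j) | bool-cases (inB j')
  ... | inj₂ ij | _ = private-coordinate _ _ β γ r j ij (touches-second {i} {j} {t})
                        (∨-false (≢⇒==false (λ e → E-irrefl (rep-edge t) (sym e))) (≢⇒==false jj'))
  ... | inj₁ _ | inj₂ ij' = private-coordinateʳ _ _ β γ r j' ij' (touches-second {i} {j'} {t'})
                              (∨-false (≢⇒==false (λ e → E-irrefl (rep-edge t') (sym e))) (≢⇒==false (λ e → jj' (sym e))))
  ... | inj₁ bj | inj₁ bj' = β0 , γ0
    where
      p : inB i ≡ false
      p = rep-first-interior t
      at-xᵢ : β + γ ≈ 0#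
      at-xᵢ = begin β + γ ≈⟨ +-cong (≈-sym (*-identityʳ β)) (≈-sym (*-identityʳ γ)) ⟩ β * 1# + γ * 1#
                ≈⟨ +-cong (*-congˡ (≈-sym (normal-at-first i j t p))) (*-congˡ (≈-sym (normal-at-first i j' t' p))) ⟩
                _ ≈⟨ r (coordOf i p) ⟩ 0# ∎
      at-x₀ : β * (- u j) + γ * (- u j') ≈ 0#
      at-x₀ = ≈-trans (+-cong (*-congˡ (≈-sym (normal-x₀-boundary i j t bj))) (*-congˡ (≈-sym (normal-x₀-boundary i j' t' bj'))))
                      (r nothing)
      u-distinct : ¬ (u j' - u j ≈ 0#)
      u-distinct h = jj' (sym (uinj j' j bj' bj (x∙y⁻¹≈ε⇒x≈y (u j') (u j) h)))
      β0 : β ≈ 0#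
      β0 = pairCancel β γ (u j) (u j') at-xᵢ at-x₀ u-distinct
      γ0 : γ ≈ 0#
      γ0 = begin γ ≈⟨ +≈0⇒≈- β γ at-xᵢ ⟩ - β ≈⟨ -‿cong β0 ⟩ - 0# ≈⟨ -0#≈0# ⟩ 0# ∎

  -- distinct hyperplanes have independent normals: either they share their
  -- first (interior) endpoint, or one of them has a private interior vertex
  pair-independent : ∀ b d → b ≢ d → ∀ β γ → PairRelation β b γ d → β ≈ 0# × γ ≈ 0#
  pair-independent nothing nothing ne β γ r = ⊥-elim (ne refl)
  pair-independent nothing (just ((i , j) , t)) ne β γ r =
    private-coordinateʳ nothing _ β γ r i (rep-first-interior t) (touches-first {i} {j} {t}) refl
  pair-independent (just ((i , j) , t)) nothing ne β γ r =
    private-coordinate _ nothing β γ r i (rep-first-interior t) (touches-first {i} {j} {t}) refl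
  pair-independent (just ((i1 , j1) , t1)) (just ((i2 , j2) , t2)) ne β γ r with i1 ≟ i2
  ... | yes refl = sameFirst-independent i1 j1 j2 t1 t2 (λ e → ne (just-≡ refl e)) β γ r
  ... | no i12 with touches (just ((i2 , j2) , t2)) i1 in e1 | touches (just ((i1 , j1) , t1)) i2 in e2
  ...   | false | _ = private-coordinate _ _ β γ r i1 (rep-first-interior t1) (touches-first {i1} {j1} {t1}) e1
  ...   | true | false = private-coordinateʳ _ _ β γ r i2 (rep-first-interior t2) (touches-first {i2} {j2} {t2}) e2
  ...   | true | true with touches-cases {i2} {j2} {t2} e1 | touches-cases {i1} {j1} {t1} e2
  ...     | inj₁ e | _ = ⊥-elim (i12 e)
  ...     | inj₂ _ | inj₁ e = ⊥-elim (i12 (sym e))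
  ...     | inj₂ refl | inj₂ refl = ⊥-elim (rep-unique t1 t2)

  -- in a dependent triple {a , b , d}, an interior vertex touched by a is
  -- touched by b or d: otherwise the coefficient of a vanishes and b , d
  -- would be dependent
  dependent-covers : ∀ a b d → b ≢ d → Dep a b d → ∀ z (p : inB z ≡ false) → touches a z ≡ true → touches b z ≡ false → touches d z ≡ false → ⊥
  dependent-covers a b d ne (α , β , γ , nt , r) z p va vb vd with normal-on a z p va
  ... | (s , ps , e) = nt (α0 , pair-independent b d ne β γ r' )
    where
      α0 : α ≈ 0#
      α0 = sign-cancel α ps (begin α * s ≈⟨ ≈-sym (drop-zeros (α * s) β γ) ⟩ (α * s + β * 0#) + γ * 0#
             ≈⟨ +-cong (+-cong (*-congˡ (≈-sym e)) (*-congˡ (≈-sym (normal-off b z p vb)))) (*-congˡ (≈-sym (normal-off d z p vd))) ⟩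
             _ ≈⟨ r (coordOf z p) ⟩ 0# ∎)
      r' : ∀ k → β * normal b k + γ * normal d k ≈ 0#
      r' k = begin β * normal b k + γ * normal d k ≈⟨ +-congʳ (≈-sym (+-identityˡ _)) ⟩
               (0# + β * normal b k) + γ * normal d k ≈⟨ +-congʳ (+-congʳ (≈-sym (≈-trans (*-congʳ α0) (zeroˡ _)))) ⟩
               _ ≈⟨ r k ⟩ 0# ∎

  triangle-dependent : ∀ {a b d x y z} → EdgeHyp a x y → EdgeHyp b y z → EdgeHyp d x z → Dep a b d
  triangle-dependent {a} {b} {d} {x} {y} {z} ea eb ed with edgeHyp-orient ea | edgeHyp-orient eb | edgeHyp-orient ed
  ... | (sa , pa , ra) | (sb , pb , rb) | (sd , pd , rd) =
    sa , sb , - sd , (λ { (h , _ , _) → sign≉0 pa h }) , λ k → begin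
      (sa * normal a k + sb * normal b k) + (- sd) * normal d k ≈⟨ +-cong (+-cong (ra k) (rb k)) (≈-trans (-*≈- sd _) (-‿cong (rd k))) ⟩
      ((vertexVec x k - vertexVec y k) + (vertexVec y k - vertexVec z k)) + - (vertexVec x k - vertexVec z k) ≈⟨ telescope (vertexVec x k) (vertexVec y k) (vertexVec z k) ⟩
      0# ∎

  originPair-dependent : ∀ i b b' t t' → inB b ≡ true → inB b' ≡ true → Dep nothing (just ((i , b) , t)) (just ((i , b') , t'))
  originPair-dependent i b b' t t' pb pb' = (u b - u b') , 1# , - 1# , (λ { (_ , h , _) → 1≉0 h }) , rel
    where
      vb0 : ∀ c → vertexVec b (just c) ≈ 0#
      vb0 c rewrite pb = ≈-refl
      vb0' : ∀ c → vertexVec b' (just c) ≈ 0#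
      vb0' c rewrite pb' = ≈-refl
      rel : ∀ k → ((u b - u b') * normal nothing k + 1# * normal (just ((i , b) , t)) k) + (- 1#) * normal (just ((i , b') , t')) k ≈ 0#
      rel nothing = ≈-trans (+-cong (+-congˡ (*-congˡ (normal-x₀-boundary i b t pb))) (*-congˡ (normal-x₀-boundary i b' t' pb'))) (originRelation-x₀ (u b) (u b'))
      rel (just c) = originRelation-interior (u b - u b') _ _ (begin
          normal (just ((i , b) , t)) (just c) ≈⟨ normal-edge i b t (just c) ⟩ vertexVec i (just c) - vertexVec b (just c)
          ≈⟨ -‿cong₂ ≈-refl (≈-trans (vb0 c) (≈-sym (vb0' c))) ⟩ vertexVec i (just c) - vertexVec b' (just c)
          ≈⟨ ≈-sym (normal-edge i b' t' (just c)) ⟩ normal (just ((i , b') , t')) (just c) ∎)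

  spread-independent : ∀ {P p q b b' t1 t2} → EdgeHyp P p q → inB b ≡ true → inB b' ≡ true →
        Dep P (just ((p , b) , t1)) (just ((q , b') , t2)) → b ≡ b'
  spread-independent {P} {p} {q} {b} {b'} {t1} {t2} eP pb pb' (α , β , γ , nt , r) with b ≟ b'
  ... | yes e = e
  ... | no ne with edgeHyp-values eP (rep-first-interior t1) (rep-first-interior t2)
  ...   | (s , ps , at-p , at-q , at-x₀) = ⊥-elim (nt (spreadCancel α s β γ (u b) (u b') ps e1 e2 e3 nzu))
    where
      ip : inB p ≡ false
      ip = rep-first-interior t1
      iq : inB q ≡ false
      iq = rep-first-interior t2
      p≢b' : p ≢ b'
      p≢b' e = true≢false pb' (trans (cong inB (sym e)) ip)
      q≢b : q ≢ b
      q≢b e = true≢false pb (trans (cong inB (sym e)) iq)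
      p≢q : p ≢ q
      p≢q = edgeHyp-≢ eP
      Q1 Q2 : Idx
      Q1 = just ((p , b) , t1)
      Q2 = just ((q , b') , t2)
      q1q : normal Q1 (coordOf q iq) ≈ 0#
      q1q = normal-off Q1 q iq (∨-false (≢⇒==false (λ e → p≢q (sym e))) (≢⇒==false q≢b))
      q2p : normal Q2 (coordOf p ip) ≈ 0#
      q2p = normal-off Q2 p ip (∨-false (≢⇒==false p≢q) (≢⇒==false p≢b'))
      -- the relation evaluated at the coordinates x_p , x_q and x₀
      e1 : (α * s + β * 1#) + γ * 0# ≈ 0#
      e1 = ≈-trans (+-cong (+-cong (*-congˡ (≈-sym at-p)) (*-congˡ (≈-sym (normal-at-first p b t1 ip)))) (*-congˡ (≈-sym q2p))) (r (coordOf p ip))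
      e2 : (α * (- s) + β * 0#) + γ * 1# ≈ 0#
      e2 = ≈-trans (+-cong (+-cong (*-congˡ (≈-sym at-q)) (*-congˡ (≈-sym q1q))) (*-congˡ (≈-sym (normal-at-first q b' t2 iq)))) (r (coordOf q iq))
      e3 : (α * 0# + β * (- u b)) + γ * (- u b') ≈ 0#
      e3 = ≈-trans (+-cong (+-cong (*-congˡ (≈-sym at-x₀)) (*-congˡ (≈-sym (normal-x₀-boundary p b t1 pb)))) (*-congˡ (≈-sym (normal-x₀-boundary q b' t2 pb')))) (r nothing)
      nzu : ¬ (u b' - u b ≈ 0#)
      nzu h = ne (sym (uinj b' b pb' pb (x∙y⁻¹≈ε⇒x≈y (u b') (u b) h)))

-- If two distinct edge hyperplanes a , b are dependent with a third
-- hyperplane γ, then a and b share a vertex v, say a = v w₁ , b = v w₂, and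
-- either γ is the edge w₁ w₂ (a triangle), or w₁ , w₂ are boundary vertices,
-- v is interior and γ is x₀ = 0 or another boundary edge at v.  Likewise a
-- triple {x₀ = 0 , e , γ} forces e and γ to be boundary edges at a common
-- interior vertex.
module DependentTriples {c ℓ} (K : Field c ℓ) {n : ℕ} (E : Adjacency n) (inB : Fin n → Bool)
  (u : Fin n → Field.Carrier K)
  (Esym : ∀ i j → E i j ≡ E j i) (Eirr : ∀ i → E i i ≡ false)
  (bdNA : ∀ b b' → inB b ≡ true → inB b' ≡ true → E b b' ≡ false)
  (uinj : ∀ b b' → inB b ≡ true → inB b' ≡ true → Field._≈_ K (u b) (u b') → b ≡ b') where

  open ArrangementNormals K E inB u Esym Eirr bdNA uinj public
  open GraphicArr K E inB u public
  open ArrHS K normal using (Dep) public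

  boundary-neighbour-interior : ∀ {h v w} → EdgeHyp h v w → inB w ≡ true → inB v ≡ false
  boundary-neighbour-interior {h} {v} {w} e bw with bool-cases (inB v)
  ... | inj₂ p = p
  ... | inj₁ p = ⊥-elim (true≢false (edgeHyp-E e) (bdNA v w p bw))

  boundaryHyp-form : ∀ {h v w} → EdgeHyp h v w → inB w ≡ true → Σ[ t ∈ T (isRep v w) ] h ≡ just ((v , w) , t)
  boundaryHyp-form {h} {v} {w} e bw = t , trans (edgeHyp-hypOf e) (hypOf-just v w t)
    where
      t : T (isRep v w)
      t = ≡⇒T (isRep-true v w (edgeHyp-E e) (boundary-neighbour-interior e bw) (inj₁ bw))

  touches-two : ∀ (γ : Idx) {p q} → touches γ p ≡ true → touches γ q ≡ true → p ≢ q → EdgeHyp γ p q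
  touches-two nothing () _ _
  touches-two (just ((i , j) , t)) {p} {q} vp vq ne with touches-cases {i} {j} {t} {p} vp | touches-cases {i} {j} {t} {q} vq
  ... | inj₁ refl | inj₁ refl = ⊥-elim (ne refl)
  ... | inj₁ refl | inj₂ refl = i , j , t , refl , inj₁ (refl , refl)
  ... | inj₂ refl | inj₁ refl = i , j , t , refl , inj₂ (refl , refl)
  ... | inj₂ refl | inj₂ refl = ⊥-elim (ne refl)

  touches? : ∀ h z → touches h z ≡ true ⊎ touches h z ≡ false
  touches? h z = bool-cases (touches h z)

  DependentShape : Idx → Idx → Idx → Set
  DependentShape a b γ = Σ[ v ∈ Fin n ] Σ[ w1 ∈ Fin n ] Σ[ w2 ∈ Fin n ]
    (EdgeHyp a v w1 × EdgeHyp b v w2 × w1 ≢ w2 ×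
     (EdgeHyp γ w1 w2 ⊎ (inB w1 ≡ true × inB w2 ≡ true × inB v ≡ false ×
                       (γ ≡ nothing ⊎ Σ[ b'' ∈ Fin n ] (EdgeHyp γ v b'' × inB b'' ≡ true)))))

  module Cov {a b γ : Idx} (ab : a ≢ b) (γa : γ ≢ a) (γb : γ ≢ b) (D : Dep a b γ) where
    covA : ∀ z (p : inB z ≡ false) → touches a z ≡ true → touches b z ≡ false → touches γ z ≡ true
    covA z p va vb with touches? γ z
    ... | inj₁ x = x
    ... | inj₂ x = ⊥-elim (dependent-covers a b γ (λ e → γb (sym e)) D z p va vb x)
    covB : ∀ z (p : inB z ≡ false) → touches b z ≡ true → touches a z ≡ false → touches γ z ≡ true
    covB z p vb va with touches? γ z
    ... | inj₁ x = x
    ... | inj₂ x = ⊥-elim (dependent-covers b a γ (λ e → γa (sym e)) (dep-swap₁₂ {a} {b} {γ} D) z p vb va x)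
    covG : ∀ z (p : inB z ≡ false) → touches γ z ≡ true → touches a z ≡ false → touches b z ≡ false → ⊥
    covG z p vg va vb = dependent-covers γ a b ab (dep-rotate {a} {b} {γ} D) z p vg va vb

  sharedVertex-mixed : ∀ {a b γ v w1 w2} → a ≢ b → γ ≢ a → γ ≢ b → Dep a b γ → EdgeHyp a v w1 → EdgeHyp b v w2 → w1 ≢ w2 →
           inB w1 ≡ false → inB w2 ≡ true → EdgeHyp γ w1 w2
  sharedVertex-mixed {a} {b} {γ} {v} {w1} {w2} ab γa γb D ea eb w12 i1 b2 = γ-is-w₁w₂ γ refl
    where
      open Cov ab γa γb D
      vw1 : v ≢ w1
      vw1 = edgeHyp-≢ ea
      g1 : touches γ w1 ≡ true
      g1 = covA w1 i1 (touches-edgeHyp-second ea) (touches-edgeHyp-false eb (λ e → vw1 (sym e)) w12)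
      iv : inB v ≡ false
      iv = boundary-neighbour-interior eb b2
      γ-is-w₁w₂ : ∀ g → g ≡ γ → EdgeHyp γ w1 w2
      γ-is-w₁w₂ nothing refl = ⊥-elim (true≢false g1 refl)
      γ-is-w₁w₂ (just ((i3 , j3) , t3)) refl with touches-cases {i3} {j3} {t3} {w1} g1
      ... | inj₂ refl = ⊥-elim cov-o
        where
          cov-o : ⊥
          cov-o with i3 ≟ v
          ... | yes refl = γa (edgeHyp-unique (i3 , w1 , t3 , refl , inj₁ (refl , refl)) ea)
          ... | no ov = covG i3 (rep-first-interior t3) (touches-first {i3} {j3} {t3}) (touches-edgeHyp-false ea ov (λ e → E-irrefl (rep-edge t3) e))
                          (touches-edgeHyp-false eb ov (λ e → true≢false b2 (trans (cong inB (sym e)) (rep-first-interior t3))))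
      ... | inj₁ refl with bool-cases (inB j3)
      ...   | inj₂ ij = ⊥-elim (cov-o2 ij)
        where
          cov-o2 : inB j3 ≡ false → ⊥
          cov-o2 p with j3 ≟ v
          ... | yes refl = γa (edgeHyp-unique (w1 , v , t3 , refl , inj₁ (refl , refl)) (edgeHyp-swap ea))
          ... | no ov = covG j3 p (touches-second {w1} {j3} {t3}) (touches-edgeHyp-false ea ov (λ e → E-irrefl (rep-edge t3) (sym e)))
                         (touches-edgeHyp-false eb ov (λ e → true≢false b2 (trans (cong inB (sym e)) p)))
      ...   | inj₁ bj with boundaryHyp-form eb b2
      ...     | (tb , refl) with spread-independent {a} {v} {w1} {w2} {j3} {tb} {t3} ea b2 bj D
      ...       | refl = w1 , w2 , t3 , refl , inj₁ (refl , refl)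

  sharedVertex-shape : ∀ {a b γ v w1 w2} → a ≢ b → γ ≢ a → γ ≢ b → Dep a b γ → EdgeHyp a v w1 → EdgeHyp b v w2 → DependentShape a b γ
  sharedVertex-shape {a} {b} {γ} {v} {w1} {w2} ab γa γb D ea eb = v , w1 , w2 , ea , eb , w12 , res
    where
      open Cov ab γa γb D
      w12 : w1 ≢ w2
      w12 refl = ab (edgeHyp-unique ea eb)
      vw1 : v ≢ w1
      vw1 = edgeHyp-≢ ea
      vw2 : v ≢ w2
      vw2 = edgeHyp-≢ eb
      res : EdgeHyp γ w1 w2 ⊎ (inB w1 ≡ true × inB w2 ≡ true × inB v ≡ false ×
                       (γ ≡ nothing ⊎ Σ[ b'' ∈ Fin n ] (EdgeHyp γ v b'' × inB b'' ≡ true)))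
      res with bool-cases (inB w1) | bool-cases (inB w2)
      ... | inj₂ i1 | inj₂ i2 = inj₁ (touches-two γ (covA w1 i1 (touches-edgeHyp-second ea) (touches-edgeHyp-false eb (λ e → vw1 (sym e)) w12))
                                             (covB w2 i2 (touches-edgeHyp-second eb) (touches-edgeHyp-false ea (λ e → vw2 (sym e)) (λ e → w12 (sym e)))) w12)
      ... | inj₂ i1 | inj₁ b2 = inj₁ (sharedVertex-mixed ab γa γb D ea eb w12 i1 b2)
      ... | inj₁ b1 | inj₂ i2 = inj₁ (edgeHyp-swap (sharedVertex-mixed {b} {a} {γ} (λ e → ab (sym e)) γb γa (dep-swap₁₂ {a} {b} {γ} D) eb ea (λ e → w12 (sym e)) i2 b1))
      ... | inj₁ b1 | inj₁ b2 = inj₂ (b1 , b2 , iv , γ-at-v γ refl)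
        where
          iv : inB v ≡ false
          iv = boundary-neighbour-interior ea b1
          γ-at-v : ∀ g → g ≡ γ → γ ≡ nothing ⊎ Σ[ b'' ∈ Fin n ] (EdgeHyp γ v b'' × inB b'' ≡ true)
          γ-at-v nothing refl = inj₁ refl
          γ-at-v (just ((i3 , j3) , t3)) refl with i3 ≟ v
          ... | no iv3 = ⊥-elim (covG i3 (rep-first-interior t3) (touches-first {i3} {j3} {t3}) (touches-edgeHyp-false ea iv3 (interior≢boundary (rep-first-interior t3) b1))
                                  (touches-edgeHyp-false eb iv3 (interior≢boundary (rep-first-interior t3) b2)))
          ... | yes refl with bool-cases (inB j3)
          ...   | inj₁ bj = inj₂ (j3 , just-edgeHyp i3 j3 t3 , bj)
          ...   | inj₂ ij = ⊥-elim (covG j3 ij (touches-second {i3} {j3} {t3})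
                                  (touches-edgeHyp-false ea (λ e → E-irrefl (rep-edge t3) (sym e)) (interior≢boundary ij b1))
                                  (touches-edgeHyp-false eb (λ e → E-irrefl (rep-edge t3) (sym e)) (interior≢boundary ij b2)))

  interiorEnd : ∀ {h x y} → EdgeHyp h x y → Σ[ p ∈ Fin n ] Σ[ q ∈ Fin n ]
           (EdgeHyp h p q × inB p ≡ false × ((p ≡ x × q ≡ y) ⊎ (p ≡ y × q ≡ x)))
  interiorEnd e@(i , j , t , refl , inj₁ (refl , refl)) = i , j , e , rep-first-interior t , inj₁ (refl , refl)
  interiorEnd e@(i , j , t , refl , inj₂ (refl , refl)) = i , j , edgeHyp-swap e , rep-first-interior t , inj₂ (refl , refl)

  -- two edge hyperplanes without common vertex are not part of a dependent
  -- triple: γ would join their interior ends, and the remaining ends would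
  -- be boundary vertices, contradicting spread-independent
  disjoint-independent : ∀ {a b γ ia oa ib ob} → a ≢ b → γ ≢ a → γ ≢ b → Dep a b γ →
             EdgeHyp a ia oa → EdgeHyp b ib ob → inB ia ≡ false → inB ib ≡ false →
             ia ≢ ib → ia ≢ ob → oa ≢ ib → oa ≢ ob → ⊥
  disjoint-independent {a} {b} {γ} {ia} {oa} {ib} {ob} ab γa γb D ea eb pa pb n1 n2 n3 n4 = final
    where
      open Cov ab γa γb D
      ga : touches γ ia ≡ true
      ga = covA ia pa (touches-edgeHyp-first ea) (touches-edgeHyp-false eb n1 n2)
      gb : touches γ ib ≡ true
      gb = covB ib pb (touches-edgeHyp-first eb) (touches-edgeHyp-false ea (λ e → n1 (sym e)) (λ e → n3 (sym e)))
      eγ : EdgeHyp γ ia ib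
      eγ = touches-two γ ga gb n1
      boa : inB oa ≡ true
      boa with bool-cases (inB oa)
      ... | inj₁ x = x
      ... | inj₂ x with touches-edgeHyp eγ (covA oa x (touches-edgeHyp-second ea) (touches-edgeHyp-false eb n3 n4))
      ...   | inj₁ e = ⊥-elim (edgeHyp-≢ ea (sym e))
      ...   | inj₂ e = ⊥-elim (n3 e)
      bob : inB ob ≡ true
      bob with bool-cases (inB ob)
      ... | inj₁ x = x
      ... | inj₂ x with touches-edgeHyp eγ (covB ob x (touches-edgeHyp-second eb) (touches-edgeHyp-false ea (λ e → n2 (sym e)) (λ e → n4 (sym e))))
      ...   | inj₁ e = ⊥-elim (n2 (sym e))
      ...   | inj₂ e = ⊥-elim (edgeHyp-≢ eb (sym e))
      final : ⊥
      final with boundaryHyp-form ea boa | boundaryHyp-form eb bob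
      ... | (ta , refl) | (tb , refl) = n4 (spread-independent {γ} {ia} {ib} {oa} {ob} {ta} {tb} eγ boa bob (dep-rotate {a} {b} {γ} D))

  -- the classification: two edge hyperplanes in a dependent triple share a
  -- vertex, and then sharedVertex-shape applies
  dependent-shape : ∀ {a b γ x y z w} → a ≢ b → γ ≢ a → γ ≢ b → Dep a b γ → EdgeHyp a x y → EdgeHyp b z w → DependentShape a b γ
  dependent-shape {a} {b} {γ} {x} {y} {z} {w} ab γa γb D ea eb with x ≟ z | x ≟ w | y ≟ z | y ≟ w
  ... | yes refl | _ | _ | _ = sharedVertex-shape ab γa γb D ea eb
  ... | no _ | yes refl | _ | _ = sharedVertex-shape ab γa γb D ea (edgeHyp-swap eb)
  ... | no _ | no _ | yes refl | _ = sharedVertex-shape ab γa γb D (edgeHyp-swap ea) eb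
  ... | no _ | no _ | no _ | yes refl = sharedVertex-shape ab γa γb D (edgeHyp-swap ea) (edgeHyp-swap eb)
  ... | no n1 | no n2 | no n3 | no n4 with interiorEnd ea | interiorEnd eb
  ...   | (ia , oa , ea' , pa , sa) | (ib , ob , eb' , pb , sb) =
          ⊥-elim (disjoint-independent ab γa γb D ea' eb' pa pb (distinctEnds sa sb) (distinctEnds sa (swapEnds sb)) (distinctEnds (swapEnds sa) sb) (distinctEnds (swapEnds sa) (swapEnds sb)))
    where
      swapEnds : ∀ {p q r s : Fin n} → ((p ≡ r × q ≡ s) ⊎ (p ≡ s × q ≡ r)) → ((q ≡ r × p ≡ s) ⊎ (q ≡ s × p ≡ r))
      swapEnds (inj₁ (e1 , e2)) = inj₂ (e2 , e1)
      swapEnds (inj₂ (e1 , e2)) = inj₁ (e2 , e1)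
      distinctEnds : ∀ {p q p' q'} → ((p ≡ x × q ≡ y) ⊎ (p ≡ y × q ≡ x)) → ((p' ≡ z × q' ≡ w) ⊎ (p' ≡ w × q' ≡ z)) → p ≢ p'
      distinctEnds (inj₁ (refl , _)) (inj₁ (refl , _)) = n1
      distinctEnds (inj₁ (refl , _)) (inj₂ (refl , _)) = n2
      distinctEnds (inj₂ (refl , _)) (inj₁ (refl , _)) = n3
      distinctEnds (inj₂ (refl , _)) (inj₂ (refl , _)) = n4

  edgeHyp-≢x₀ : ∀ {h x y} → EdgeHyp h x y → h ≢ nothing
  edgeHyp-≢x₀ (i , j , t , refl , _) ()

  dependent-with-x₀ : ∀ {e γ x y} → γ ≢ e → γ ≢ nothing → Dep nothing e γ → EdgeHyp e x y →
        Σ[ i ∈ Fin n ] Σ[ c' ∈ Fin n ] Σ[ b ∈ Fin n ]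
          (EdgeHyp e i c' × inB i ≡ false × inB c' ≡ true × EdgeHyp γ i b × inB b ≡ true × b ≢ c')
  dependent-with-x₀ {e} {γ} {x} {y} γe γO D ee with interiorEnd ee
  ... | (i , c' , ee' , pi , _) =
    let (b , eγ , bb) = γ-shape γ refl
    in i , c' , b , ee' , pi , bc , eγ , bb , (λ h → γe (edgeHyp-unique (subst (EdgeHyp γ i) h eγ) ee'))
    where
      D' : Dep e nothing γ
      D' = dep-swap₁₂ {nothing} {e} {γ} D
      covE : ∀ z (p : inB z ≡ false) → touches e z ≡ true → touches γ z ≡ true
      covE z p ve with touches? γ z
      ... | inj₁ q = q
      ... | inj₂ q = ⊥-elim (dependent-covers e nothing γ (λ h → γO (sym h)) D' z p ve refl q)
      covG : ∀ z (p : inB z ≡ false) → touches γ z ≡ true → touches e z ≡ false → ⊥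
      covG z p vg ve = dependent-covers γ e nothing (edgeHyp-≢x₀ ee) (dep-rotate {e} {nothing} {γ} D') z p vg ve refl
      gi : touches γ i ≡ true
      gi = covE i pi (touches-edgeHyp-first ee')
      bc : inB c' ≡ true
      bc with bool-cases (inB c')
      ... | inj₁ q = q
      ... | inj₂ q = ⊥-elim (γe (edgeHyp-unique (touches-two γ gi (covE c' q (touches-edgeHyp-second ee')) (edgeHyp-≢ ee')) ee'))
      -- γ touches the interior vertex i, so it is an edge hyperplane i b ; b is a boundary
      -- vertex since an interior b would be covered by neither e nor x₀
      γ-shape : ∀ g → g ≡ γ → Σ[ j ∈ Fin n ] (EdgeHyp γ i j × inB j ≡ true)
      γ-shape nothing refl = ⊥-elim (true≢false gi refl)
      γ-shape (just ((i3 , j3) , t3)) refl with i3 ≟ i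
      ... | no ne = ⊥-elim (covG i3 (rep-first-interior t3) (touches-first {i3} {j3} {t3}) (touches-edgeHyp-false ee' ne (interior≢boundary (rep-first-interior t3) bc)))
      ... | yes refl with bool-cases (inB j3)
      ...   | inj₁ bj = j3 , just-edgeHyp i3 j3 t3 , bj
      ...   | inj₂ ij = ⊥-elim (covG j3 ij (touches-second {i3} {j3} {t3}) (touches-edgeHyp-false ee' (λ h → E-irrefl (rep-edge t3) (sym h)) (interior≢boundary ij bc)))


-- A subarrangement X is recorded by eX (the edges whose hyperplane lies in
-- X) and oX (whether x₀ = 0 lies in X); its edge set in Γ̃ is  edgesOf eX oX ,
-- which adds all boundary pairs exactly when x₀ = 0 is present.  The record
-- SolvableShadow lists the consequences of "X ⊆ Y is solvable" in these
-- terms; the graph-theoretic half of the proof uses only these facts.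
module BoundaryCompletion {n : ℕ} (E : Adjacency n) (inB : Fin n → Bool)
  (Esym : ∀ i j → E i j ≡ E j i) (Eirr : ∀ i → E i i ≡ false)
  (bdNA : ∀ b b' → inB b ≡ true → inB b' ≡ true → E b b' ≡ false) where

  boundaryPair : Fin n → Fin n → Bool
  boundaryPair x y = inB x ∧ inB y ∧ not (x == y)

  F : Adjacency n
  F = completeBoundary E inB

  boundaryPair-sym : ∀ x y → boundaryPair x y ≡ boundaryPair y x
  boundaryPair-sym x y rewrite ==-sym x y with inB x | inB y
  ... | true | true = refl
  ... | true | false = refl
  ... | false | true = refl
  ... | false | false = refl

  Fsym : ∀ x y → F x y ≡ F y x
  Fsym x y rewrite Esym x y | boundaryPair-sym x y = refl

  open Reachability F Fsym public
  open GraphHS F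

  boundaryPair⁻ : ∀ {x y} → boundaryPair x y ≡ true → inB x ≡ true × inB y ≡ true × x ≢ y
  boundaryPair⁻ {x} {y} h = let (a , b) = ∧-true⁻ (inB x) h ; (c , d) = ∧-true⁻ (inB y) b in a , c , ==false⇒≢ (not-true⁻ d)

  boundaryPair-intro : ∀ {x y} → inB x ≡ true → inB y ≡ true → x ≢ y → boundaryPair x y ≡ true
  boundaryPair-intro a b c = ∧-true a (∧-true b (not-true (≢⇒==false c)))

  boundaryPair-F : ∀ {x y} → boundaryPair x y ≡ true → F x y ≡ true
  boundaryPair-F {x} h = ∨-trueʳ (E x _) h

  E⊆F : ∀ {x y} → E x y ≡ true → F x y ≡ true
  E⊆F h = ∨-trueˡ _ h

  E-irrefl : ∀ {i j} → E i j ≡ true → i ≢ j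
  E-irrefl {i} e refl = true≢false e (Eirr i)

  boundary≢interior : ∀ {z w} → inB z ≡ true → inB w ≡ false → z ≢ w
  boundary≢interior p q e = true≢false p (trans (cong inB e) q)

  E-boundary : ∀ {x y} → E x y ≡ true → inB x ≡ true → inB y ≡ false
  E-boundary {x} {y} e bx with bool-cases (inB y)
  ... | inj₂ p = p
  ... | inj₁ p = ⊥-elim (true≢false e (bdNA x y bx p))

  edgesOf : (Fin n → Fin n → Bool) → Bool → EdgeSet n
  edgesOf e o x y = e x y ∨ (boundaryPair x y ∧ o)

  edgesOf-cases : ∀ {e o x y} → edgesOf e o x y ≡ true → e x y ≡ true ⊎ (boundaryPair x y ≡ true × o ≡ true)
  edgesOf-cases {e} {o} {x} {y} h with ∨-true⁻ (e x y) h
  ... | inj₁ p = inj₁ p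
  ... | inj₂ p = inj₂ (∧-true⁻ (boundaryPair x y) p)

  edgesOf-edge : ∀ {e o x y} → e x y ≡ true → edgesOf e o x y ≡ true
  edgesOf-edge h = ∨-trueˡ _ h

  edgesOf-boundary : ∀ {e o x y} → boundaryPair x y ≡ true → o ≡ true → edgesOf e o x y ≡ true
  edgesOf-boundary {e} {o} {x} {y} h p = ∨-trueʳ (e x y) (∧-true h p)

  edgesOf-edgeSubset : ∀ e o → (∀ x y → e x y ≡ e y x) → (∀ x y → e x y ≡ true → E x y ≡ true) → IsEdgeSubset (edgesOf e o)
  edgesOf-edgeSubset e o sy sub =
    (λ x y → cong₂ _∨_ (sy x y) (cong (_∧ o) (boundaryPair-sym x y))) ,
    (λ x y h → [ (λ p → E⊆F (sub x y p)) , (λ p → boundaryPair-F (proj₁ p)) ] (edgesOf-cases {e} {o} h))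

  -- Closedness forbids triangles and
  -- origin pairs {x₀ , ib , ib'} with two members in X; completeness says
  -- how two new hyperplanes are linked through X; solvability gives
  -- solvable-originPairs; and as long as x₀ ∉ X each interior vertex has at
  -- most one boundary neighbour in X (oneBoundaryNeighbourX).
  record SolvableShadow (eX eY : Fin n → Fin n → Bool) (oX oY : Bool) : Set where
    eD : Fin n → Fin n → Bool
    eD x y = eY x y ∧ not (eX x y)
    field
      symX : ∀ x y → eX x y ≡ eX y x
      symY : ∀ x y → eY x y ≡ eY y x
      edgeY : ∀ x y → eY x y ≡ true → E x y ≡ true
      subE : ∀ x y → eX x y ≡ true → eY x y ≡ true
      subO : oX ≡ true → oY ≡ true
      nonempty : (oY ≡ true × oX ≡ false) ⊎ (Σ[ x ∈ Fin n ] Σ[ y ∈ Fin n ] eD x y ≡ true)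
      closed-triangle : ∀ x y z → eX x y ≡ true → eX y z ≡ true → eD x z ≡ true → ⊥
      closed-originPair : oX ≡ true → ∀ i b b' → inB b ≡ true → inB b' ≡ true → b ≢ b' →
              eX i b ≡ true → eD i b' ≡ true → ⊥
      complete-sharedVertex : ∀ v w1 w2 → w1 ≢ w2 → eD v w1 ≡ true → eD v w2 ≡ true →
           eX w1 w2 ≡ true ⊎ (inB w1 ≡ true × inB w2 ≡ true × inB v ≡ false ×
             (oX ≡ true ⊎ Σ[ b'' ∈ Fin n ] (inB b'' ≡ true × b'' ≢ w1 × b'' ≢ w2 × eX v b'' ≡ true)))
      complete-commonVertex : ∀ x y z w → eD x y ≡ true → eD z w ≡ true → ¬ ((x ≡ z × y ≡ w) ⊎ (x ≡ w × y ≡ z)) →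
            x ≡ z ⊎ x ≡ w ⊎ y ≡ z ⊎ y ≡ w
      complete-withOrigin : oY ≡ true → oX ≡ false → ∀ x y → eD x y ≡ true →
           Σ[ i ∈ Fin n ] Σ[ c ∈ Fin n ] Σ[ b ∈ Fin n ]
             (((x ≡ i × y ≡ c) ⊎ (x ≡ c × y ≡ i)) × inB i ≡ false × inB c ≡ true × inB b ≡ true × b ≢ c × eX i b ≡ true)
      solvable-originPairs : oY ≡ true → oX ≡ false → ∀ i j c b1 b2 → i ≢ j → eD i c ≡ true → eD j c ≡ true → inB c ≡ true →
           inB b1 ≡ true → inB b2 ≡ true → eX i b1 ≡ true → eX j b2 ≡ true → b1 ≡ b2
      oneBoundaryNeighbourX : oX ≡ false → ∀ i b b' → inB b ≡ true → inB b' ≡ true → eX i b ≡ true → eX i b' ≡ true → b ≡ b'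
      oneBoundaryNeighbourY : oY ≡ false → ∀ i b b' → inB b ≡ true → inB b' ≡ true → eY i b ≡ true → eY i b' ≡ true → b ≡ b'

  module ShadowFacts {eX eY oX oY} (fa : SolvableShadow eX eY oX oY) where
    open SolvableShadow fa public

    eD-Y : ∀ {x y} → eD x y ≡ true → eY x y ≡ true
    eD-Y {x} {y} h = proj₁ (∧-true⁻ (eY x y) h)

    eD-nX : ∀ {x y} → eD x y ≡ true → eX x y ≡ false
    eD-nX {x} {y} h = not-true⁻ (proj₂ (∧-true⁻ (eY x y) h))

    mkD : ∀ {x y} → eY x y ≡ true → eX x y ≡ false → eD x y ≡ true
    mkD a b = ∧-true a (not-true b)

    eD-sym : ∀ x y → eD x y ≡ eD y x
    eD-sym x y rewrite symX x y | symY x y = refl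

    eDs : ∀ {x y} → eD x y ≡ true → eD y x ≡ true
    eDs {x} {y} h = trans (sym (eD-sym x y)) h

    eX-E : ∀ {x y} → eX x y ≡ true → E x y ≡ true
    eX-E {x} {y} h = edgeY x y (subE x y h)

    eD-E : ∀ {x y} → eD x y ≡ true → E x y ≡ true
    eD-E {x} {y} h = edgeY x y (eD-Y h)

    eXs : ∀ {x y} → eX x y ≡ true → eX y x ≡ true
    eXs {x} {y} h = trans (sym (symX x y)) h

    eYs : ∀ {x y} → eY x y ≡ true → eY y x ≡ true
    eYs {x} {y} h = trans (sym (symY x y)) h

    SX SY : EdgeSet n
    SX = edgesOf eX oX
    SY = edgesOf eY oY

    esX : IsEdgeSubset SX
    esX = edgesOf-edgeSubset eX oX symX (λ x y → eX-E)

    eY-split : ∀ {x y} → eY x y ≡ true → eX x y ≡ true ⊎ eD x y ≡ true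
    eY-split {x} {y} h with bool-cases (eX x y)
    ... | inj₁ p = inj₁ p
    ... | inj₂ p = inj₂ (mkD h p)


-- Case I of the translation: x₀ = 0 lies in both or in neither of X ⊆ Y.
-- Then SY \ SX consists of the new edges eD, and any two of them share a
-- vertex and no three form a triangle, so they form a star with some centre v.
-- If every new neighbour of v is already met by SX, one star step adds them
-- all; otherwise some new neighbour w is unmet, the star is the single edge
-- vw, and it is added as a star from w to {v} or as an isolated edge.
module SameOrigin {n : ℕ} (E : Adjacency n) (inB : Fin n → Bool)
  (Esym : ∀ i j → E i j ≡ E j i) (Eirr : ∀ i → E i i ≡ false)
  (bdNA : ∀ b b' → inB b ≡ true → inB b' ≡ true → E b b' ≡ false) where

  open BoundaryCompletion E inB Esym Eirr bdNA
  open GraphHS F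

  module Step {eX eY oX oY} (sh : SolvableShadow eX eY oX oY) (oeq : oX ≡ oY) where
    open ShadowFacts sh

    -- a new edge is not in SX (a boundary pair is never an edge of Γ)
    SX-new : ∀ {x y} → eD x y ≡ true → SX x y ≡ false
    SX-new {x} {y} h = ∨-false (eD-nX h) notBoundaryPair
      where
        notBoundaryPair : boundaryPair x y ∧ oX ≡ false
        notBoundaryPair with bool-cases (inB x)
        ... | inj₂ p = ∧-falseˡ oX (∧-falseˡ (inB y ∧ not (x == y)) p)
        ... | inj₁ p = ∧-falseˡ oX (∧-falseʳ (inB x) (∧-falseˡ (not (x == y)) (E-boundary (eD-E h) p)))

    SX⊆SY : SX ⊆ₑ SY
    SX⊆SY x y h with edgesOf-cases {eX} {oX} h
    ... | inj₁ p = edgesOf-edge {eY} {oY} (subE _ _ p)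
    ... | inj₂ (b , o) = edgesOf-boundary {eY} {oY} b (trans (sym oeq) o)

    SY-cases : ∀ {x y} → SY x y ≡ true → SX x y ≡ true ⊎ eD x y ≡ true
    SY-cases h with edgesOf-cases {eY} {oY} h
    ... | inj₂ (b , o) = inj₁ (edgesOf-boundary {eX} {oX} b (trans oeq o))
    ... | inj₁ p with eY-split p
    ...   | inj₁ q = inj₁ (edgesOf-edge {eX} {oX} q)
    ...   | inj₂ q = inj₂ q

    someNewEdge : Σ[ p ∈ Fin n ] Σ[ q ∈ Fin n ] eD p q ≡ true
    someNewEdge with nonempty
    ... | inj₁ (oy , ox) = ⊥-elim (true≢false (trans oeq oy) ox)
    ... | inj₂ e = e

    D-ne : ∀ {x y} → eD x y ≡ true → x ≢ y
    D-ne h = E-irrefl (eD-E h)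

    otherEnd : ∀ {x y p} → eD x y ≡ true → x ≡ p ⊎ y ≡ p →
               Σ[ t ∈ Fin n ] (eD p t ≡ true × ((x ≡ p × y ≡ t) ⊎ (y ≡ p × x ≡ t)))
    otherEnd {x} {y} h (inj₁ refl) = y , h , inj₁ (refl , refl)
    otherEnd {x} {y} h (inj₂ refl) = x , eDs h , inj₂ (refl , refl)

    otherEnd-≢ : ∀ {x y p t a : Fin n} → (x ≡ p × y ≡ t) ⊎ (y ≡ p × x ≡ t) → x ≢ a → y ≢ a → t ≢ a
    otherEnd-≢ (inj₁ (_ , e)) xa ya ta = ya (trans e ta)
    otherEnd-≢ (inj₂ (_ , e)) xa ya ta = xa (trans e ta)

    noNewTriangle : ∀ {a b c} → eD a b ≡ true → eD a c ≡ true → eD b c ≡ true → ⊥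
    noNewTriangle {a} {b} {c} ab ac bc with complete-sharedVertex a b c (λ e → D-ne bc e) ab ac
    ... | inj₁ x = true≢false x (eD-nX bc)
    ... | inj₂ (bb , bc' , _) = true≢false (eD-E bc) (bdNA b c bb bc')

    throughFirst : ∀ {p q x y} → eD p q ≡ true → eD x y ≡ true → x ≢ q → y ≢ q → x ≡ p ⊎ y ≡ p
    throughFirst {p} {q} {x} {y} dpq d xq yq with complete-commonVertex x y p q d dpq notSame
      where
        notSame : ¬ ((x ≡ p × y ≡ q) ⊎ (x ≡ q × y ≡ p))
        notSame (inj₁ (_ , e)) = yq e
        notSame (inj₂ (e , _)) = xq e
    ... | inj₁ e = inj₁ e
    ... | inj₂ (inj₁ e) = ⊥-elim (xq e)
    ... | inj₂ (inj₂ (inj₁ e)) = inj₂ e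
    ... | inj₂ (inj₂ (inj₂ e)) = ⊥-elim (yq e)

    Center : Set
    Center = Σ[ v ∈ Fin n ] ((∀ x y → eD x y ≡ true → x ≡ v ⊎ y ≡ v) × Σ[ w ∈ Fin n ] eD v w ≡ true)

    -- take a new edge p q: p is a centre unless some new edge r s avoids p;
    -- then q is a centre, since a new edge x y avoiding q would give new
    -- edges p t and q t' with t = t', a triangle
    findCenter : Center
    findCenter with someNewEdge
    ... | (p , q , dpq) with any? (λ x → any? (λ y → true? (eD x y) ×-dec ¬? (x ≟ p) ×-dec ¬? (y ≟ p)))
    ...   | no h = p , onP , q , dpq
      where
        onP : ∀ x y → eD x y ≡ true → x ≡ p ⊎ y ≡ p
        onP x y d with x ≟ p | y ≟ p
        ... | yes e | _ = inj₁ e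
        ... | no _ | yes e = inj₂ e
        ... | no a | no b = ⊥-elim (h (x , y , d , a , b))
    ...   | yes (r , s , drs , rp , sp) = q , onQ , p , eDs dpq
      where
        onQ : ∀ x y → eD x y ≡ true → x ≡ q ⊎ y ≡ q
        onQ x y d with x ≟ q | y ≟ q
        ... | yes e | _ = inj₁ e
        ... | no _ | yes e = inj₂ e
        ... | no xq | no yq with otherEnd d (throughFirst dpq d xq yq)
                              | otherEnd drs (throughFirst (eDs dpq) drs rp sp)
        ...   | (t , dpt , ot) | (t' , dqt' , ot')
                with throughFirst (eDs dpt) dqt' (D-ne (eDs dpq)) (otherEnd-≢ ot' rp sp)
        ...     | inj₁ q≡t = ⊥-elim (otherEnd-≢ ot xq yq (sym q≡t))
        ...     | inj₂ refl = ⊥-elim (noNewTriangle dpq dpt dqt')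

    module AroundCenter (v : Fin n) (centered : ∀ x y → eD x y ≡ true → x ≡ v ⊎ y ≡ v)
                        (w0 : Fin n) (dvw0 : eD v w0 ≡ true) where

      newNeighbours : Fin n → Bool
      newNeighbours w = eD v w

      center-notNeighbour : newNeighbours v ≡ false
      center-notNeighbour with bool-cases (eD v v)
      ... | inj₂ p = p
      ... | inj₁ p = ⊥-elim (D-ne p refl)

      -- the new neighbours of v form a clique of SX (completeness of X ⊆ Y)
      newNeighbours-clique : ∀ w w' → eD v w ≡ true → eD v w' ≡ true → w ≢ w' → SX w w' ≡ true
      newNeighbours-clique w w' a b ne with complete-sharedVertex v w w' ne a b
      ... | inj₁ x = edgesOf-edge {eX} {oX} x
      ... | inj₂ (bw , bw' , iv , inj₁ ox) = edgesOf-boundary {eX} {oX} (boundaryPair-intro bw bw' ne) ox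
      ... | inj₂ (bw , bw' , iv , inj₂ (b'' , bb , n1 , n2 , xv)) with bool-cases oX
      ...   | inj₁ ox = edgesOf-boundary {eX} {oX} (boundaryPair-intro bw bw' ne) ox
      ...   | inj₂ ox = ⊥-elim (n1 (oneBoundaryNeighbourY (trans (sym oeq) ox) v b'' w bb bw (subE _ _ xv) (eD-Y a)))

      -- no new edge closes a triangle with two edges of SX (closedness of X ⊆ Y)
      noTriangleWithNew : ∀ v' w y → eD v' w ≡ true → SX v' y ≡ true → SX y w ≡ false
      noTriangleWithNew v' w y d s1 with bool-cases (SX y w)
      ... | inj₂ p = p
      ... | inj₁ s2 with edgesOf-cases {eX} {oX} s1 | edgesOf-cases {eX} {oX} s2
      ...   | inj₁ a | inj₁ b = ⊥-elim (closed-triangle v' y w a b d)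
      ...   | inj₁ a | inj₂ (b , ox) = let (by , bw , ne) = boundaryPair⁻ b in
                ⊥-elim (closed-originPair ox v' y w by bw ne a d)
      ...   | inj₂ (a , ox) | inj₁ b = let (bv , by , ne) = boundaryPair⁻ a in
                ⊥-elim (closed-originPair ox w y v' by bv (λ e → ne (sym e)) (eXs b) (eDs d))
      ...   | inj₂ (a , _) | inj₂ (b , _) =
                ⊥-elim (true≢false (eD-E d) (bdNA v' w (proj₁ (boundaryPair⁻ a)) (proj₁ (proj₂ (boundaryPair⁻ b)))))

      starStep : (∀ w → eD v w ≡ true → MetBy w SX) → SX ⇝ SY
      starStep allMet = ⇝-≐ʳ (⇝-star SX v newNeighbours valid) (∪-≐ (starEdges v newNeighbours) SX⊆SY starInSY cover)
        where
          valid : ValidStar SX v newNeighbours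
          valid = esX , center-notNeighbour , (w0 , dvw0 , E⊆F (eD-E dvw0)) , allMet , newNeighbours-clique ,
                  (λ w d → SX-new d) , (λ w y d f s → noTriangleWithNew v w y d s)
          starInSY : starEdges v newNeighbours ⊆ₑ SY
          starInSY x y h with starEdges-cases v newNeighbours x y h
          ... | inj₁ (refl , d , _) = edgesOf-edge {eY} {oY} (eD-Y d)
          ... | inj₂ (refl , d , _) = edgesOf-edge {eY} {oY} (eYs (eD-Y d))
          cover : ∀ x y → SY x y ≡ true → SX x y ≡ true ⊎ starEdges v newNeighbours x y ≡ true
          cover x y h with SY-cases h
          ... | inj₁ s = inj₁ s
          ... | inj₂ d with centered x y d
          ...   | inj₁ refl = inj₂ (starEdges-out v newNeighbours d (E⊆F (eD-E d)) refl)
          ...   | inj₂ refl = inj₂ (starEdges-in v newNeighbours (eDs d) (E⊆F (eD-E d)) refl)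

      -- a new neighbour w not met by SX: vw is the only new edge, since any
      -- other new edge vt would put t w in SX
      module SingleNewEdge (w : Fin n) (dvw : eD v w ≡ true) (w∉SX : ¬ MetBy w SX) where
        only : ∀ x y → eD x y ≡ true → (x ≡ v × y ≡ w) ⊎ (x ≡ w × y ≡ v)
        only x y d with otherEnd d (centered x y d)
        ... | (t , dvt , o) with t ≟ w
        ...   | no tw = ⊥-elim (w∉SX (t , newNeighbours-clique w t dvw dvt (λ e → tw (sym e))))
        ...   | yes refl with o
        ...     | inj₁ (a , b) = inj₁ (a , b)
        ...     | inj₂ (a , b) = inj₂ (b , a)

        cover : ∀ (N : EdgeSet n) → N v w ≡ true → N w v ≡ true → ∀ x y → SY x y ≡ true → SX x y ≡ true ⊎ N x y ≡ true
        cover N nvw nwv x y h with SY-cases h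
        ... | inj₁ s = inj₁ s
        ... | inj₂ d with only x y d
        ...   | inj₁ (refl , refl) = inj₂ nvw
        ...   | inj₂ (refl , refl) = inj₂ nwv

        vw-inSY : ∀ {x y} → (x ≡ v × y ≡ w) ⊎ (x ≡ w × y ≡ v) → SY x y ≡ true
        vw-inSY (inj₁ (refl , refl)) = edgesOf-edge {eY} {oY} (eD-Y dvw)
        vw-inSY (inj₂ (refl , refl)) = edgesOf-edge {eY} {oY} (eYs (eD-Y dvw))

        viaStar : MetBy v SX → SX ⇝ SY
        viaStar mv = ⇝-≐ʳ (⇝-star SX w isV valid)
                          (∪-≐ (starEdges w isV) SX⊆SY inSY (cover (starEdges w isV) (starEdges-in w isV (==-refl v) fvw refl)
                                                 (starEdges-out w isV (==-refl v) fwv refl)))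
          where
            isV : Fin n → Bool
            isV z = z == v
            fvw : F v w ≡ true
            fvw = E⊆F (eD-E dvw)
            fwv : F w v ≡ true
            fwv = E⊆F (eD-E (eDs dvw))
            valid : ValidStar SX w isV
            valid = esX , ≢⇒==false (λ e → D-ne dvw (sym e)) , (v , ==-refl v , fwv) ,
                    (λ z pz → subst (λ q → MetBy q SX) (sym (==⇒≡ pz)) mv) ,
                    (λ z z' pz pz' ne → ⊥-elim (ne (trans (==⇒≡ pz) (sym (==⇒≡ pz'))))) ,
                    (λ z pz → subst (λ q → SX w q ≡ false) (sym (==⇒≡ pz)) (SX-new (eDs dvw))) ,
                    (λ z y pz f s → ⊥-elim (w∉SX (y , s)))
            inSY : starEdges w isV ⊆ₑ SY
            inSY x y h with starEdges-cases w isV x y h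
            ... | inj₁ (refl , d , _) = vw-inSY (inj₂ (refl , ==⇒≡ d))
            ... | inj₂ (refl , d , _) = vw-inSY (inj₁ (==⇒≡ d , refl))

        viaEdge : ¬ MetBy v SX → SX ⇝ SY
        viaEdge v∉SX = ⇝-≐ʳ (⇝-edge SX v w (esX , E⊆F (eD-E dvw) , v∉SX , w∉SX))
                            (∪-≐ (oneEdge v w) SX⊆SY (λ x y h → vw-inSY (oneEdge-cases v w x y h))
                                 (cover (oneEdge v w) (oneEdge-ab v w) (oneEdge-ba v w)))

        singleStep : SX ⇝ SY
        singleStep with metBy? v SX
        ... | yes mv = viaStar mv
        ... | no v∉SX = viaEdge v∉SX

      centerStep : SX ⇝ SY
      centerStep with all? (λ w → true? (eD v w) →-dec metBy? w SX)
      ... | yes allMet = starStep allMet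
      ... | no notAll with ¬∀⟶∃¬ n _ (λ w → true? (eD v w) →-dec metBy? w SX) notAll
      ...   | (w , h) with bool-cases (eD v w)
      ...     | inj₁ dvw = SingleNewEdge.singleStep w dvw (λ m → h (λ _ → m))
      ...     | inj₂ ¬dvw = ⊥-elim (h (λ d → ⊥-elim (true≢false d ¬dvw)))

    sameOrigin⇝ : SX ⇝ SY
    sameOrigin⇝ with findCenter
    ... | (v , centered , w0 , dvw0) = AroundCenter.centerStep v centered w0 dvw0

-- Adding all boundary pairs at once is not a solvable step, but it can be
-- done by a sequence of star steps, adding the boundary vertices to a
-- "current" clique one at a time.  This module does so in the generality
-- needed twice later: starting from an edge set S₀ in which a seed set C₀ of
-- boundary vertices is already a clique, it adds all boundary pairs together
-- with a set J of extra edges c i from boundary vertices c to interior i,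
-- ending at  S₀ ∪ {boundary pairs} ∪ J .
module BoundaryCliqueBuilder {n : ℕ} (E : Adjacency n) (inB : Fin n → Bool)
  (Esym : ∀ i j → E i j ≡ E j i) (Eirr : ∀ i → E i i ≡ false)
  (bdNA : ∀ b b' → inB b ≡ true → inB b' ≡ true → E b b' ≡ false) where

  open BoundaryCompletion E inB Esym Eirr bdNA
  open GraphHS F

  -- S₀ contains the seed clique C₀ and no edges from other boundary vertices
  -- to boundary vertices; the J-edges at c are new, their interior ends are a
  -- clique of S₀; no triangle would be closed; and J-order makes the
  -- J-neighbourhoods nested along the order of insertion
  record BuilderHyp (S₀ : EdgeSet n) (C₀ : Fin n → Bool) (J : Fin n → Fin n → Bool) : Set where
    field
      S₀-edgeSubset : IsEdgeSubset S₀
      J-edge : ∀ c i → J c i ≡ true → E c i ≡ true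
      J-boundary : ∀ c i → J c i ≡ true → inB c ≡ true
      seed-boundary : ∀ x → C₀ x ≡ true → inB x ≡ true
      seedVertex : Fin n
      seedVertex-inSeed : C₀ seedVertex ≡ true
      seed-met : ∀ x → C₀ x ≡ true → MetBy x S₀
      seed-clique : ∀ x y → C₀ x ≡ true → C₀ y ≡ true → x ≢ y → S₀ x y ≡ true
      S₀-noBoundaryEdge : ∀ c w → C₀ c ≡ false → inB c ≡ true → inB w ≡ true → S₀ c w ≡ false
      J-fresh : ∀ c i → J c i ≡ true → S₀ c i ≡ false
      J-clique : ∀ c i i' → J c i ≡ true → J c i' ≡ true → i ≢ i' → S₀ i i' ≡ true
      J-notSeed : ∀ c i → J c i ≡ true → C₀ c ≡ false
      J-met : ∀ c i → J c i ≡ true → MetBy i S₀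
      S₀-noTriangle-boundary : ∀ c y w → inB c ≡ true → C₀ c ≡ false → S₀ c y ≡ true → inB w ≡ true → w ≢ c →
            S₀ y w ≡ false × J w y ≡ false
      S₀-noTriangle-J : ∀ c y w → inB c ≡ true → C₀ c ≡ false → S₀ c y ≡ true → J c w ≡ true → S₀ y w ≡ false
      J-order : ∀ c i d → J c i ≡ true → (C₀ d ≡ true ⊎ Σ[ j ∈ Fin n ] J d j ≡ true) → d ≢ c →
             S₀ d i ≡ true ⊎ J d i ≡ true

  module Build {S₀ C₀ J} (H : BuilderHyp S₀ C₀ J) where
    open BuilderHyp H

    stage : (Fin n → Bool) → EdgeSet n
    stage Cur x y = S₀ x y ∨ (boundaryPair x y ∧ Cur x ∧ Cur y) ∨ (Cur x ∧ J x y) ∨ (Cur y ∧ J y x)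

    J-int : ∀ {c i} → J c i ≡ true → inB i ≡ false
    J-int {c} {i} h = E-boundary (J-edge c i h) (J-boundary c i h)

    J-ne : ∀ {c i} → J c i ≡ true → c ≢ i
    J-ne {c} {i} h = E-irrefl (J-edge c i h)

    CurrentOK : (Fin n → Bool) → Set
    CurrentOK Cur = (∀ d → Cur d ≡ true → inB d ≡ true) × (∀ d → C₀ d ≡ true → Cur d ≡ true)

    Ordered : (Fin n → Bool) → Fin n → Set
    Ordered Cur c = ∀ i → J c i ≡ true → ∀ d → Cur d ≡ true → S₀ d i ≡ true ⊎ J d i ≡ true

    withVertex : (Fin n → Bool) → Fin n → Fin n → Bool
    withVertex Cur c z = Cur z ∨ (z == c)

    stage-cases : ∀ Cur x y → stage Cur x y ≡ true →
      S₀ x y ≡ true ⊎ (boundaryPair x y ≡ true × Cur x ≡ true × Cur y ≡ true) ⊎ (Cur x ≡ true × J x y ≡ true) ⊎ (Cur y ≡ true × J y x ≡ true)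
    stage-cases Cur x y h with ∨-true⁻ (S₀ x y) h
    ... | inj₁ p = inj₁ p
    ... | inj₂ p with ∨-true⁻ (boundaryPair x y ∧ Cur x ∧ Cur y) p
    ...   | inj₁ q = let (a , b) = ∧-true⁻ (boundaryPair x y) q ; (c , d) = ∧-true⁻ (Cur x) b in inj₂ (inj₁ (a , c , d))
    ...   | inj₂ q with ∨-true⁻ (Cur x ∧ J x y) q
    ...     | inj₁ r = inj₂ (inj₂ (inj₁ (∧-true⁻ (Cur x) r)))
    ...     | inj₂ r = inj₂ (inj₂ (inj₂ (∧-true⁻ (Cur y) r)))

    stage-S₀ : ∀ Cur {x y} → S₀ x y ≡ true → stage Cur x y ≡ true
    stage-S₀ Cur h = ∨-trueˡ _ h
    stage-pair : ∀ Cur {x y} → boundaryPair x y ≡ true → Cur x ≡ true → Cur y ≡ true → stage Cur x y ≡ true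
    stage-pair Cur {x} {y} a b c = ∨-trueʳ (S₀ x y) (∨-trueˡ _ (∧-true a (∧-true b c)))
    stage-J : ∀ Cur {x y} → Cur x ≡ true → J x y ≡ true → stage Cur x y ≡ true
    stage-J Cur {x} {y} a b = ∨-trueʳ (S₀ x y) (∨-trueʳ (boundaryPair x y ∧ Cur x ∧ Cur y) (∨-trueˡ _ (∧-true a b)))
    stage-J' : ∀ Cur {x y} → Cur y ≡ true → J y x ≡ true → stage Cur x y ≡ true
    stage-J' Cur {x} {y} a b = ∨-trueʳ (S₀ x y) (∨-trueʳ (boundaryPair x y ∧ Cur x ∧ Cur y) (∨-trueʳ (Cur x ∧ J x y) (∧-true a b)))

    stage-cong : ∀ {Cur Cur'} → (∀ z → Cur z ≡ Cur' z) → stage Cur ≐ stage Cur'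
    stage-cong eq x y rewrite eq x | eq y = refl

    stage-sym : ∀ Cur x y → stage Cur x y ≡ stage Cur y x
    stage-sym Cur x y = bool-ext (f x y) (f y x)
      where
        f : ∀ x y → stage Cur x y ≡ true → stage Cur y x ≡ true
        f x y h with stage-cases Cur x y h
        ... | inj₁ p = stage-S₀ Cur (trans (sym (proj₁ S₀-edgeSubset x y)) p)
        ... | inj₂ (inj₁ (a , b , c)) = stage-pair Cur (trans (sym (boundaryPair-sym x y)) a) c b
        ... | inj₂ (inj₂ (inj₁ (a , b))) = stage-J' Cur a b
        ... | inj₂ (inj₂ (inj₂ (a , b))) = stage-J Cur a b

    stage-edgeSubset : ∀ Cur → IsEdgeSubset (stage Cur)
    stage-edgeSubset Cur = stage-sym Cur , sub
      where
        sub : ∀ x y → stage Cur x y ≡ true → F x y ≡ true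
        sub x y h with stage-cases Cur x y h
        ... | inj₁ p = proj₂ S₀-edgeSubset x y p
        ... | inj₂ (inj₁ (a , _)) = boundaryPair-F a
        ... | inj₂ (inj₂ (inj₁ (_ , b))) = E⊆F (J-edge x y b)
        ... | inj₂ (inj₂ (inj₂ (_ , b))) = E⊆F (trans (Esym x y) (J-edge y x b))

    J-notToBoundary : ∀ {w c} → inB c ≡ true → J w c ≡ false
    J-notToBoundary {w} {c} bc with bool-cases (J w c)
    ... | inj₂ p = p
    ... | inj₁ p = ⊥-elim (true≢false bc (J-int p))

    module AddVertex (Cur : Fin n → Bool) (c : Fin n) (ok : CurrentOK Cur) (bc : inB c ≡ true)
                     (cc : Cur c ≡ false) (ord : Ordered Cur c) where
      current-boundary : ∀ d → Cur d ≡ true → inB d ≡ true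
      current-boundary = proj₁ ok

      seed⊆current : ∀ d → C₀ d ≡ true → Cur d ≡ true
      seed⊆current = proj₂ ok


      starSet : Fin n → Bool
      starSet w = Cur w ∨ J c w
      star-cases : ∀ {w} → starSet w ≡ true → Cur w ≡ true ⊎ J c w ≡ true
      star-cases {w} h = ∨-true⁻ (Cur w) h
      c∉seed : C₀ c ≡ false
      c∉seed with bool-cases (C₀ c)
      ... | inj₂ p = p
      ... | inj₁ p = ⊥-elim (true≢false (seed⊆current c p) cc)
      current≢c : ∀ {d} → Cur d ≡ true → d ≢ c
      current≢c h refl = true≢false h cc
      stage-at-c : ∀ {y} → stage Cur c y ≡ true → S₀ c y ≡ true
      stage-at-c {y} h with stage-cases Cur c y h
      ... | inj₁ p = p
      ... | inj₂ (inj₁ (_ , a , _)) = ⊥-elim (true≢false a cc)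
      ... | inj₂ (inj₂ (inj₁ (a , _))) = ⊥-elim (true≢false a cc)
      ... | inj₂ (inj₂ (inj₂ (_ , b))) = ⊥-elim (true≢false b (J-notToBoundary bc))
      J-irrefl : J c c ≡ false
      J-irrefl with bool-cases (J c c)
      ... | inj₂ p = p
      ... | inj₁ p = ⊥-elim (J-ne p refl)

      star-met : ∀ w → starSet w ≡ true → MetBy w (stage Cur)
      star-met w pw with star-cases pw
      ... | inj₂ j = let (y , h) = J-met c w j in y , stage-S₀ Cur h
      ... | inj₁ cw with bool-cases (C₀ w)
      ...   | inj₁ c0 = let (y , h) = seed-met w c0 in y , stage-S₀ Cur h
      ...   | inj₂ c0 = seedVertex , stage-pair Cur (boundaryPair-intro (current-boundary w cw) (seed-boundary seedVertex seedVertex-inSeed) (λ e → true≢false (trans (cong C₀ e) seedVertex-inSeed) c0)) cw (seed⊆current seedVertex seedVertex-inSeed)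

      star-clique : ∀ w w' → starSet w ≡ true → starSet w' ≡ true → w ≢ w' → stage Cur w w' ≡ true
      star-clique w w' pw pw' ne with star-cases pw | star-cases pw'
      ... | inj₁ a | inj₁ b = stage-pair Cur (boundaryPair-intro (current-boundary w a) (current-boundary w' b) ne) a b
      ... | inj₂ a | inj₂ b = stage-S₀ Cur (J-clique c w w' a b ne)
      ... | inj₁ a | inj₂ b with ord w' b w a
      ...   | inj₁ s = stage-S₀ Cur s
      ...   | inj₂ j = stage-J Cur a j
      star-clique w w' pw pw' ne | inj₂ a | inj₁ b with ord w a w' b
      ...   | inj₁ s = stage-S₀ Cur (trans (proj₁ S₀-edgeSubset w w') s)
      ...   | inj₂ j = stage-J' Cur b j

      star-fresh : ∀ w → starSet w ≡ true → stage Cur c w ≡ false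
      star-fresh w pw with bool-cases (stage Cur c w)
      ... | inj₂ p = p
      ... | inj₁ s with star-cases pw
      ...   | inj₁ a = ⊥-elim (true≢false (stage-at-c s) (S₀-noBoundaryEdge c w c∉seed bc (current-boundary w a)))
      ...   | inj₂ b = ⊥-elim (true≢false (stage-at-c s) (J-fresh c w b))

      -- a triangle c y w would need S₀ c y, excluded by the hypotheses on S₀
      star-noTriangle : ∀ w y → starSet w ≡ true → F c w ≡ true → stage Cur c y ≡ true → stage Cur y w ≡ false
      star-noTriangle w y pw f s with bool-cases (stage Cur y w)
      ... | inj₂ p = p
      ... | inj₁ s2 = ⊥-elim (c-y-w-triangle (stage-at-c s))
        where
          yint : S₀ c y ≡ true → inB y ≡ false
          yint sc with bool-cases (inB y)
          ... | inj₂ p = p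
          ... | inj₁ p with bool-cases (C₀ y)
          ...   | inj₂ q = ⊥-elim (true≢false sc (trans (proj₁ S₀-edgeSubset c y) (S₀-noBoundaryEdge y c q p bc)))
          ...   | inj₁ q = ⊥-elim (true≢false sc (S₀-noBoundaryEdge c y c∉seed bc p))
          c-y-w-triangle : S₀ c y ≡ true → ⊥
          c-y-w-triangle sc with stage-cases Cur y w s2
          ... | inj₂ (inj₁ (a , _)) = true≢false (proj₁ (boundaryPair⁻ a)) (yint sc)
          ... | inj₂ (inj₂ (inj₁ (a , _))) = true≢false (current-boundary y a) (yint sc)
          ... | inj₁ syw with star-cases pw
          ...   | inj₁ a = true≢false syw (proj₁ (S₀-noTriangle-boundary c y w bc c∉seed sc (current-boundary w a) (current≢c a)))
          ...   | inj₂ b = true≢false syw (S₀-noTriangle-J c y w bc c∉seed sc b)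
          c-y-w-triangle sc | inj₂ (inj₂ (inj₂ (a , b))) with star-cases pw
          ...   | inj₁ a' = true≢false b (proj₂ (S₀-noTriangle-boundary c y w bc c∉seed sc (current-boundary w a') (current≢c a')))
          ...   | inj₂ b' = true≢false (current-boundary w a) (J-int b')

      seed≢c : seedVertex ≢ c
      seed≢c = current≢c (seed⊆current seedVertex seedVertex-inSeed)

      valid : ValidStar (stage Cur) c starSet
      valid = stage-edgeSubset Cur , ∨-false cc J-irrefl ,
          (seedVertex , ∨-trueˡ _ (seed⊆current seedVertex seedVertex-inSeed) , boundaryPair-F (boundaryPair-intro bc (seed-boundary seedVertex seedVertex-inSeed) (λ e → seed≢c (sym e)))) ,
          star-met , star-clique , star-fresh , star-noTriangle

      next : Fin n → Bool
      next = withVertex Cur c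

      addc : ∀ {z} → z ≡ c → next z ≡ true
      addc {z} refl = ∨-trueʳ (Cur z) (==-refl z)

      addE : ∀ z → next z ≡ true → Cur z ≡ true ⊎ z ≡ c
      addE z h with ∨-true⁻ (Cur z) h
      ... | inj₁ p = inj₁ p
      ... | inj₂ p = inj₂ (==⇒≡ p)

      mono : stage Cur ⊆ₑ stage next
      mono x y h with stage-cases Cur x y h
      ... | inj₁ p = stage-S₀ next p
      ... | inj₂ (inj₁ (a , b , d)) = stage-pair next a (∨-trueˡ _ b) (∨-trueˡ _ d)
      ... | inj₂ (inj₂ (inj₁ (a , b))) = stage-J next (∨-trueˡ _ a) b
      ... | inj₂ (inj₂ (inj₂ (a , b))) = stage-J' next (∨-trueˡ _ a) b

      starInNext : starEdges c starSet ⊆ₑ stage next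
      starInNext x y h with starEdges-cases c starSet x y h
      ... | inj₁ (refl , py , f) with star-cases py
      ...   | inj₁ cy = stage-pair next (boundaryPair-intro bc (current-boundary y cy) (λ e → current≢c cy (sym e))) (addc refl) (∨-trueˡ _ cy)
      ...   | inj₂ j = stage-J next (addc refl) j
      starInNext x y h | inj₂ (refl , px , f) with star-cases px
      ...   | inj₁ cx' = stage-pair next (boundaryPair-intro (current-boundary x cx') bc (current≢c cx')) (∨-trueˡ _ cx') (addc refl)
      ...   | inj₂ j = stage-J' next (addc refl) j

      cover : ∀ x y → stage next x y ≡ true → stage Cur x y ≡ true ⊎ starEdges c starSet x y ≡ true
      cover x y h with stage-cases next x y h
      ... | inj₁ p = inj₁ (stage-S₀ Cur p)
      ... | inj₂ (inj₁ (a , b , d)) with addE x b | addE y d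
      ...   | inj₁ p | inj₁ q = inj₁ (stage-pair Cur a p q)
      ...   | inj₂ p | inj₁ q = inj₂ (starEdges-out c starSet (∨-trueˡ _ q) (boundaryPair-F a) p)
      ...   | inj₁ p | inj₂ q = inj₂ (starEdges-in c starSet (∨-trueˡ _ p) (boundaryPair-F a) q)
      ...   | inj₂ refl | inj₂ refl = ⊥-elim (proj₂ (proj₂ (boundaryPair⁻ a)) refl)
      cover x y h | inj₂ (inj₂ (inj₁ (a , b))) with addE x a
      ...   | inj₁ p = inj₁ (stage-J Cur p b)
      ...   | inj₂ p = inj₂ (starEdges-out c starSet (∨-trueʳ (Cur y) (subst (λ z → J z y ≡ true) p b)) (E⊆F (J-edge x y b)) p)
      cover x y h | inj₂ (inj₂ (inj₂ (a , b))) with addE y a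
      ...   | inj₁ p = inj₁ (stage-J' Cur p b)
      ...   | inj₂ p = inj₂ (starEdges-in c starSet (∨-trueʳ (Cur x) (subst (λ z → J z x ≡ true) p b))
                                         (E⊆F (trans (Esym x y) (J-edge y x b))) p)

      step⇝ : stage Cur ⇝ stage next
      step⇝ = ⇝-≐ʳ (⇝-star (stage Cur) c starSet valid) (∪-≐ (starEdges c starSet) mono starInNext cover)

    addVertex⇝ : ∀ Cur c → CurrentOK Cur → inB c ≡ true → Cur c ≡ false → Ordered Cur c → stage Cur ⇝ stage (withVertex Cur c)
    addVertex⇝ Cur c ok bc cc ord = AddVertex.step⇝ Cur c ok bc cc ord

    withVertices : (Fin n → Bool) → List (Fin n) → Fin n → Bool
    withVertices Cur [] = Cur
    withVertices Cur (c ∷ L) = withVertices (withVertex Cur c) L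

    withVertices-⊇ : ∀ Cur L z → Cur z ≡ true → withVertices Cur L z ≡ true
    withVertices-⊇ Cur [] z h = h
    withVertices-⊇ Cur (c ∷ L) z h = withVertices-⊇ (withVertex Cur c) L z (∨-trueˡ _ h)

    withVertices-∈ : ∀ Cur L z → z ∈ L → withVertices Cur L z ≡ true
    withVertices-∈ Cur (c ∷ L) z (here refl) = withVertices-⊇ (withVertex Cur c) L z (∨-trueʳ (Cur z) (==-refl z))
    withVertices-∈ Cur (c ∷ L) z (there m) = withVertices-∈ (withVertex Cur c) L z m

    withVertices-⊆ : ∀ Cur L z → withVertices Cur L z ≡ true → Cur z ≡ true ⊎ z ∈ L
    withVertices-⊆ Cur [] z h = inj₁ h
    withVertices-⊆ Cur (c ∷ L) z h with withVertices-⊆ (withVertex Cur c) L z h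
    ... | inj₂ m = inj₂ (there m)
    ... | inj₁ a with ∨-true⁻ (Cur z) a
    ...   | inj₁ p = inj₁ p
    ...   | inj₂ p = inj₂ (here (==⇒≡ p))

    withVertex-present : ∀ Cur c → Cur c ≡ true → ∀ z → Cur z ≡ withVertex Cur c z
    withVertex-present Cur c p z =
      bool-ext (∨-trueˡ _) (λ h → [ (λ q → q) , (λ q → subst (λ w → Cur w ≡ true) (sym (==⇒≡ q)) p) ] (∨-true⁻ (Cur z) h))

    addVertices⇝ : ∀ (L : List (Fin n)) (Ok : (Fin n → Bool) → Set) →
            (∀ Cur → Ok Cur → CurrentOK Cur) →
            (∀ Cur c → Ok Cur → c ∈ L → Ok (withVertex Cur c)) →
            (∀ Cur c → Ok Cur → c ∈ L → Cur c ≡ false → Ordered Cur c) →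
            (∀ c → c ∈ L → inB c ≡ true) →
            ∀ Cur → Ok Cur → (stage Cur) ⇝ (stage (withVertices Cur L))
    addVertices⇝ [] Ok okC okP okO Lb Cur ok = ⇝-refl
    addVertices⇝ (c ∷ L) Ok okC okP okO Lb Cur ok = ⇝-trans first rest
      where
        rest : (stage (withVertex Cur c)) ⇝ (stage (withVertices (withVertex Cur c) L))
        rest = addVertices⇝ L Ok okC (λ Cur c ok m → okP Cur c ok (there m)) (λ Cur c ok m → okO Cur c ok (there m))
                 (λ c m → Lb c (there m)) (withVertex Cur c) (okP Cur c ok (here refl))
        first : (stage Cur) ⇝ (stage (withVertex Cur c))
        first with bool-cases (Cur c)
        ... | inj₁ p = ⇝-≐ (stage-cong (withVertex-present Cur c p))
        ... | inj₂ p = addVertex⇝ Cur c (okC Cur ok) (Lb c (here refl)) p (okO Cur c ok (here refl) p)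

    touched : Fin n → Bool
    touched c = does (any? (λ i → true? (J c i)))

    touched-t : ∀ {c} → touched c ≡ true → Σ[ i ∈ Fin n ] J c i ≡ true
    touched-t {c} h with any? (λ i → true? (J c i))
    ... | yes p = p
    ... | no _ = ⊥-elim (true≢false h refl)

    touched-i : ∀ {c i} → J c i ≡ true → touched c ≡ true
    touched-i {c} {i} h with any? (λ i → true? (J c i))
    ... | yes _ = refl
    ... | no np = ⊥-elim (np (i , h))

    touchedList : List (Fin n)
    touchedList = listOf touched

    boundaryList : List (Fin n)
    boundaryList = listOf inB

    stage-seed : stage C₀ ≐ S₀
    stage-seed x y = bool-ext f (λ h → stage-S₀ C₀ h)
      where
        f : stage C₀ x y ≡ true → S₀ x y ≡ true
        f h with stage-cases C₀ x y h
        ... | inj₁ p = p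
        ... | inj₂ (inj₁ (a , b , c)) = seed-clique x y b c (proj₂ (proj₂ (boundaryPair⁻ a)))
        ... | inj₂ (inj₂ (inj₁ (a , b))) = ⊥-elim (true≢false a (J-notSeed x y b))
        ... | inj₂ (inj₂ (inj₂ (a , b))) = ⊥-elim (true≢false a (J-notSeed y x b))

    withVertex-boundary : ∀ Cur c → (∀ d → Cur d ≡ true → inB d ≡ true) → inB c ≡ true →
                          ∀ d → withVertex Cur c d ≡ true → inB d ≡ true
    withVertex-boundary Cur c cb bc d h with ∨-true⁻ (Cur d) h
    ... | inj₁ p = cb d p
    ... | inj₂ p = subst (λ z → inB z ≡ true) (sym (==⇒≡ p)) bc

    touchedList-boundary : ∀ c → c ∈ touchedList → inB c ≡ true
    touchedList-boundary c m = let (i , j) = touched-t (listOf-sound touched c m) in J-boundary c i j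

    -- phase 1 keeps every current vertex a seed or a vertex with J-edges,
    -- which makes J-order applicable
    Phase₁ : (Fin n → Bool) → Set
    Phase₁ Cur = CurrentOK Cur × (∀ d → Cur d ≡ true → C₀ d ≡ true ⊎ Σ[ j ∈ Fin n ] J d j ≡ true)

    afterPhase₁ : Fin n → Bool
    afterPhase₁ = withVertices C₀ touchedList

    phase₁⇝ : stage C₀ ⇝ stage afterPhase₁
    phase₁⇝ = addVertices⇝ touchedList Phase₁ (λ _ ok → proj₁ ok) preserve ordered touchedList-boundary C₀
                ((seed-boundary , (λ d h → h)) , (λ d h → inj₁ h))
      where
        preserve : ∀ Cur c → Phase₁ Cur → c ∈ touchedList → Phase₁ (withVertex Cur c)
        preserve Cur c ((cb , c0) , o) m =
          (withVertex-boundary Cur c cb (touchedList-boundary c m) , (λ d h → ∨-trueˡ _ (c0 d h))) , o'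
          where
            o' : ∀ d → withVertex Cur c d ≡ true → C₀ d ≡ true ⊎ Σ[ j ∈ Fin n ] J d j ≡ true
            o' d h with ∨-true⁻ (Cur d) h
            ... | inj₁ p = o d p
            ... | inj₂ p = subst (λ z → C₀ z ≡ true ⊎ Σ[ j ∈ Fin n ] J z j ≡ true) (sym (==⇒≡ p))
                                 (inj₂ (touched-t (listOf-sound touched c m)))
        ordered : ∀ Cur c → Phase₁ Cur → c ∈ touchedList → Cur c ≡ false → Ordered Cur c
        ordered Cur c (_ , o) m cc i j d cd = J-order c i d j (o d cd) (λ e → true≢false (trans (cong Cur (sym e)) cd) cc)

    -- phase 2 starts with every vertex carrying J-edges present, so the
    -- remaining stars contain boundary vertices only
    Phase₂ : (Fin n → Bool) → Set
    Phase₂ Cur = CurrentOK Cur × (∀ d i → J d i ≡ true → Cur d ≡ true)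

    afterPhase₁-ok : Phase₂ afterPhase₁
    afterPhase₁-ok = (current-boundary , (λ d h → withVertices-⊇ C₀ touchedList d h)) ,
                     (λ d i j → withVertices-∈ C₀ touchedList d (listOf-complete touched d (touched-i j)))
      where
        current-boundary : ∀ d → afterPhase₁ d ≡ true → inB d ≡ true
        current-boundary d h with withVertices-⊆ C₀ touchedList d h
        ... | inj₁ p = seed-boundary d p
        ... | inj₂ m = touchedList-boundary d m

    phase₂⇝ : stage afterPhase₁ ⇝ stage (withVertices afterPhase₁ boundaryList)
    phase₂⇝ = addVertices⇝ boundaryList Phase₂ (λ _ ok → proj₁ ok) preserve ordered
                (λ c m → listOf-sound inB c m) afterPhase₁ afterPhase₁-ok
      where
        preserve : ∀ Cur c → Phase₂ Cur → c ∈ boundaryList → Phase₂ (withVertex Cur c)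
        preserve Cur c ((cb , c0) , o) m =
          (withVertex-boundary Cur c cb (listOf-sound inB c m) , (λ d h → ∨-trueˡ _ (c0 d h))) ,
          (λ d i j → ∨-trueˡ _ (o d i j))
        ordered : ∀ Cur c → Phase₂ Cur → c ∈ boundaryList → Cur c ≡ false → Ordered Cur c
        ordered Cur c (_ , o) m cc i j = ⊥-elim (true≢false (o c i j) cc)

    afterPhase₂ : ∀ z → withVertices afterPhase₁ boundaryList z ≡ inB z
    afterPhase₂ z = bool-ext sound (λ h → withVertices-∈ afterPhase₁ boundaryList z (listOf-complete inB z h))
      where
        sound : withVertices afterPhase₁ boundaryList z ≡ true → inB z ≡ true
        sound h with withVertices-⊆ afterPhase₁ boundaryList z h
        ... | inj₂ m = listOf-sound inB z m
        ... | inj₁ p = proj₁ (proj₁ afterPhase₁-ok) z p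

    fullBuild⇝ : S₀ ⇝ stage inB
    fullBuild⇝ = ⇝-trans (⇝-≐ (≐-sym stage-seed)) (⇝-trans phase₁⇝ (⇝-≐ʳ phase₂⇝ (stage-cong afterPhase₂)))

  module SingletonSeed (s : Fin n) where
    seed : Fin n → Bool
    seed z = z == s

    seed-boundary : inB s ≡ true → ∀ x → seed x ≡ true → inB x ≡ true
    seed-boundary bs x h = subst (λ z → inB z ≡ true) (sym (==⇒≡ h)) bs

    seed-met : ∀ {S : EdgeSet n} → MetBy s S → ∀ x → seed x ≡ true → MetBy x S
    seed-met {S} ms x h = subst (λ z → MetBy z S) (sym (==⇒≡ h)) ms

    seed-clique : ∀ (S : EdgeSet n) x y → seed x ≡ true → seed y ≡ true → x ≢ y → S x y ≡ true
    seed-clique S x y hx hy ne = ⊥-elim (ne (trans (==⇒≡ hx) (sym (==⇒≡ hy))))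

  module PairSeed (b₁ b₂ : Fin n) (b₁₂ : b₁ ≢ b₂) (bb₁ : inB b₁ ≡ true) (bb₂ : inB b₂ ≡ true) where
    seed : Fin n → Bool
    seed z = (z == b₁) ∨ (z == b₂)

    seed-cases : ∀ {z} → seed z ≡ true → z ≡ b₁ ⊎ z ≡ b₂
    seed-cases {z} h with ∨-true⁻ (z == b₁) h
    ... | inj₁ p = inj₁ (==⇒≡ p)
    ... | inj₂ p = inj₂ (==⇒≡ p)

    seed-b₁ : seed b₁ ≡ true
    seed-b₁ = ∨-trueˡ _ (==-refl b₁)

    seed-b₂ : seed b₂ ≡ true
    seed-b₂ = ∨-trueʳ (b₂ == b₁) (==-refl b₂)

    seed-boundary : ∀ x → seed x ≡ true → inB x ≡ true
    seed-boundary x h with seed-cases {x} h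
    ... | inj₁ refl = bb₁
    ... | inj₂ refl = bb₂

    seed-clique : ∀ {S : EdgeSet n} → oneEdge b₁ b₂ ⊆ₑ S → ∀ x y → seed x ≡ true → seed y ≡ true → x ≢ y → S x y ≡ true
    seed-clique sub x y hx hy ne with seed-cases {x} hx | seed-cases {y} hy
    ... | inj₁ refl | inj₁ refl = ⊥-elim (ne refl)
    ... | inj₂ refl | inj₂ refl = ⊥-elim (ne refl)
    ... | inj₁ refl | inj₂ refl = sub x y (oneEdge-ab x y)
    ... | inj₂ refl | inj₁ refl = sub x y (oneEdge-ba y x)

    seed-met : ∀ {S : EdgeSet n} → oneEdge b₁ b₂ ⊆ₑ S → ∀ x → seed x ≡ true → MetBy x S
    seed-met {S} sub x h with seed-cases {x} h
    ... | inj₁ refl = b₂ , seed-clique {S} sub x b₂ h seed-b₂ b₁₂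
    ... | inj₂ refl = b₁ , seed-clique {S} sub x b₁ h seed-b₁ (λ e → b₁₂ (sym e))

-- Case II of the translation: x₀ = 0 is added, X ⊆ Y with x₀ ∉ X , x₀ ∈ Y.
-- Then SY \ SX consists of all missing boundary pairs and the new edges,
-- each of which joins a boundary vertex c to an interior vertex i.  They are
-- added by the boundary clique builder with J = the new edges, seeded by a
-- single boundary vertex b' joined in X to all interior ends of new edges
-- (solvable-originPairs), or, if there are no new edges, by any boundary vertex
-- met by SX, or else by the pair b₁ b₂ after adding the isolated edge b₁ b₂.
module OriginAdded {n : ℕ} (E : Adjacency n) (inB : Fin n → Bool)
  (Esym : ∀ i j → E i j ≡ E j i) (Eirr : ∀ i → E i i ≡ false)
  (bdNA : ∀ b b' → inB b ≡ true → inB b' ≡ true → E b b' ≡ false)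
  (b₁ b₂ : Fin n) (b₁≢b₂ : b₁ ≢ b₂) (bb₁ : inB b₁ ≡ true) (bb₂ : inB b₂ ≡ true) where

  open BoundaryCompletion E inB Esym Eirr bdNA
  open BoundaryCliqueBuilder E inB Esym Eirr bdNA
  open GraphHS F

  module Step {eX eY oX oY} (sh : SolvableShadow eX eY oX oY) (ox : oX ≡ false) (oy : oY ≡ true) where
    open ShadowFacts sh

    J : Fin n → Fin n → Bool
    J c i = inB c ∧ eD c i

    J⁻ : ∀ {c i} → J c i ≡ true → inB c ≡ true × eD c i ≡ true
    J⁻ {c} {i} h = ∧-true⁻ (inB c) h

    J-intro : ∀ {c i} → inB c ≡ true → eD c i ≡ true → J c i ≡ true
    J-intro a b = ∧-true a b

    J-interior : ∀ {c i} → eD c i ≡ true → inB c ≡ true → inB i ≡ false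
    J-interior d b = E-boundary (eD-E d) b

    module ViaBuilder (S₀ : EdgeSet n) (C₀ : Fin n → Bool) (s : Fin n) (hs : C₀ s ≡ true)
              (S₀-shape : ∀ x y → S₀ x y ≡ true → eX x y ≡ true ⊎ (boundaryPair x y ≡ true × C₀ x ≡ true × C₀ y ≡ true))
              (X⊆S₀ : ∀ x y → eX x y ≡ true → S₀ x y ≡ true)
              (S₀-edges : IsEdgeSubset S₀)
              (seed-bd : ∀ x → C₀ x ≡ true → inB x ≡ true)
              (seed-mt : ∀ x → C₀ x ≡ true → MetBy x S₀)
              (seed-cl : ∀ x y → C₀ x ≡ true → C₀ y ≡ true → x ≢ y → S₀ x y ≡ true)
              (J-toSeed : ∀ c i → J c i ≡ true → ∀ d → C₀ d ≡ true → eX i d ≡ true) where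

      S₀-atBoundary : ∀ {c y} → inB c ≡ true → C₀ c ≡ false → S₀ c y ≡ true → eX c y ≡ true
      S₀-atBoundary {c} {y} bc cc h with S₀-shape c y h
      ... | inj₁ p = p
      ... | inj₂ (_ , q , _) = ⊥-elim (true≢false q cc)

      S₀-noBoundaryEdge : ∀ c w → C₀ c ≡ false → inB c ≡ true → inB w ≡ true → S₀ c w ≡ false
      S₀-noBoundaryEdge c w cc bc bw with bool-cases (S₀ c w)
      ... | inj₂ p = p
      ... | inj₁ p = ⊥-elim (true≢false (eX-E (S₀-atBoundary bc cc p)) (bdNA c w bc bw))

      J-fresh : ∀ c i → J c i ≡ true → S₀ c i ≡ false
      J-fresh c i j with bool-cases (S₀ c i)
      ... | inj₂ p = p
      ... | inj₁ p with S₀-shape c i p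
      ...   | inj₁ q = ⊥-elim (true≢false q (eD-nX (proj₂ (J⁻ j))))
      ...   | inj₂ (q , _) = ⊥-elim (true≢false (proj₁ (proj₂ (boundaryPair⁻ q))) (J-interior (proj₂ (J⁻ j)) (proj₁ (J⁻ j))))

      J-clique : ∀ c i i' → J c i ≡ true → J c i' ≡ true → i ≢ i' → S₀ i i' ≡ true
      J-clique c i i' j j' ne with complete-sharedVertex c i i' ne (proj₂ (J⁻ j)) (proj₂ (J⁻ j'))
      ... | inj₁ x = X⊆S₀ i i' x
      ... | inj₂ (bi , _) = ⊥-elim (true≢false bi (J-interior (proj₂ (J⁻ j)) (proj₁ (J⁻ j))))

      J-notSeed : ∀ c i → J c i ≡ true → C₀ c ≡ false
      J-notSeed c i j with bool-cases (C₀ c)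
      ... | inj₂ p = p
      ... | inj₁ p = ⊥-elim (true≢false (eXs (J-toSeed c i j c p)) (eD-nX (proj₂ (J⁻ j))))

      S₀-noTriangle-boundary : ∀ c y w → inB c ≡ true → C₀ c ≡ false → S₀ c y ≡ true → inB w ≡ true → w ≢ c →
            S₀ y w ≡ false × J w y ≡ false
      S₀-noTriangle-boundary c y w bc cc scy bw wc = a1 , a2
        where
          xcy : eX c y ≡ true
          xcy = S₀-atBoundary bc cc scy
          iy : inB y ≡ false
          iy = E-boundary (eX-E xcy) bc
          a1 : S₀ y w ≡ false
          a1 with bool-cases (S₀ y w)
          ... | inj₂ p = p
          ... | inj₁ p with S₀-shape y w p
          ...   | inj₁ q = ⊥-elim (wc (sym (oneBoundaryNeighbourX ox y c w bc bw (eXs xcy) q)))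
          ...   | inj₂ (q , _) = ⊥-elim (true≢false (proj₁ (boundaryPair⁻ q)) iy)
          a2 : J w y ≡ false
          a2 with bool-cases (J w y)
          ... | inj₂ p = p
          ... | inj₁ p = ⊥-elim (true≢false (subst (λ z → C₀ z ≡ true) (sym (oneBoundaryNeighbourX ox y c s bc (seed-bd s hs) (eXs xcy) (J-toSeed w y p s hs))) hs) cc)

      S₀-noTriangle-J : ∀ c y w → inB c ≡ true → C₀ c ≡ false → S₀ c y ≡ true → J c w ≡ true → S₀ y w ≡ false
      S₀-noTriangle-J c y w bc cc scy j with bool-cases (S₀ y w)
      ... | inj₂ p = p
      ... | inj₁ p with S₀-shape y w p
      ...   | inj₁ q = ⊥-elim (closed-triangle c y w (S₀-atBoundary bc cc scy) q (proj₂ (J⁻ j)))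
      ...   | inj₂ (q , _) = ⊥-elim (true≢false (proj₁ (boundaryPair⁻ q)) (E-boundary (eX-E (S₀-atBoundary bc cc scy)) bc))

      J-order : ∀ c i d → J c i ≡ true → (C₀ d ≡ true ⊎ Σ[ j ∈ Fin n ] J d j ≡ true) → d ≢ c →
             S₀ d i ≡ true ⊎ J d i ≡ true
      J-order c i d j (inj₁ cd) ne = inj₁ (X⊆S₀ d i (eXs (J-toSeed c i j d cd)))
      J-order c i d j (inj₂ (j' , jd)) ne = inj₂ (J-intro bd (subst (λ z → eD d z ≡ true) (sym ij) dd))
        where
          bc : inB c ≡ true
          bc = proj₁ (J⁻ j)
          dc : eD c i ≡ true
          dc = proj₂ (J⁻ j)
          bd : inB d ≡ true
          bd = proj₁ (J⁻ jd)
          dd : eD d j' ≡ true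
          dd = proj₂ (J⁻ jd)
          ic : inB i ≡ false
          ic = J-interior dc bc
          ij' : inB j' ≡ false
          ij' = J-interior dd bd
          notSame : ¬ ((c ≡ d × i ≡ j') ⊎ (c ≡ j' × i ≡ d))
          notSame (inj₁ (e , _)) = ne (sym e)
          notSame (inj₂ (e , _)) = boundary≢interior bc ij' e
          ij : i ≡ j'
          ij with complete-commonVertex c i d j' dc dd notSame
          ... | inj₁ e = ⊥-elim (ne (sym e))
          ... | inj₂ (inj₁ e) = ⊥-elim (boundary≢interior bc ij' e)
          ... | inj₂ (inj₂ (inj₁ e)) = ⊥-elim (boundary≢interior bd ic (sym e))
          ... | inj₂ (inj₂ (inj₂ e)) = e

      hyp : BuilderHyp S₀ C₀ J
      hyp = record
        { S₀-edgeSubset = S₀-edges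
        ; J-edge = λ c i j → eD-E (proj₂ (J⁻ j))
        ; J-boundary = λ c i j → proj₁ (J⁻ j)
        ; seed-boundary = seed-bd
        ; seedVertex = s
        ; seedVertex-inSeed = hs
        ; seed-met = seed-mt
        ; seed-clique = seed-cl
        ; S₀-noBoundaryEdge = S₀-noBoundaryEdge
        ; J-fresh = J-fresh
        ; J-clique = J-clique
        ; J-notSeed = J-notSeed
        ; J-met = λ c i j → s , X⊆S₀ i s (J-toSeed c i j s hs)
        ; S₀-noTriangle-boundary = S₀-noTriangle-boundary
        ; S₀-noTriangle-J = S₀-noTriangle-J
        ; J-order = J-order
        }

      open Build hyp

      -- the builder ends exactly at SY (every new edge joins a boundary vertex
      -- to an interior one, by complete-withOrigin)
      finalEq : stage inB ≐ SY
      finalEq x y = bool-ext fwd bwd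
        where
          fwd : stage inB x y ≡ true → SY x y ≡ true
          fwd h with stage-cases inB x y h
          ... | inj₁ p with S₀-shape x y p
          ...   | inj₁ q = edgesOf-edge {eY} {oY} (subE x y q)
          ...   | inj₂ (q , _) = edgesOf-boundary {eY} {oY} q oy
          fwd h | inj₂ (inj₁ (a , _)) = edgesOf-boundary {eY} {oY} a oy
          fwd h | inj₂ (inj₂ (inj₁ (_ , j))) = edgesOf-edge {eY} {oY} (eD-Y (proj₂ (J⁻ j)))
          fwd h | inj₂ (inj₂ (inj₂ (_ , j))) = edgesOf-edge {eY} {oY} (eYs (eD-Y (proj₂ (J⁻ j))))
          bwd : SY x y ≡ true → stage inB x y ≡ true
          bwd h with edgesOf-cases {eY} {oY} h
          ... | inj₂ (q , _) = stage-pair inB q (proj₁ (boundaryPair⁻ q)) (proj₁ (proj₂ (boundaryPair⁻ q)))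
          ... | inj₁ p with eY-split p
          ...   | inj₁ q = stage-S₀ inB (X⊆S₀ x y q)
          ...   | inj₂ d with complete-withOrigin oy ox x y d
          ...     | (i , c , b , inj₁ (refl , refl) , _ , bc , _) = stage-J' inB bc (J-intro bc (eDs d))
          ...     | (i , c , b , inj₂ (refl , refl) , _ , bc , _) = stage-J inB bc (J-intro bc d)

      result : S₀ ⇝ SY
      result = ⇝-≐ʳ fullBuild⇝ finalEq

    SX-inX : ∀ x y → SX x y ≡ true → eX x y ≡ true
    SX-inX x y h with edgesOf-cases {eX} {oX} h
    ... | inj₁ p = p
    ... | inj₂ (_ , o) = ⊥-elim (true≢false o ox)

    -- some new edge c₀ i₀ , and a boundary vertex b' joined to i₀ in X: every
    -- J-edge c i has the same boundary end c₀, and i is joined to b' in X too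
    module WithNewEdges (i₀ c₀ b' : Fin n) (d₀ : eD c₀ i₀ ≡ true) (ii₀ : inB i₀ ≡ false)
                        (bc₀ : inB c₀ ≡ true) (bb' : inB b' ≡ true) (xi₀b' : eX i₀ b' ≡ true) where
      open SingletonSeed b'

      J-toSeed : ∀ c i → J c i ≡ true → eX i b' ≡ true
      J-toSeed c i j with i ≟ i₀
      ... | yes refl = xi₀b'
      ... | no ne with complete-withOrigin oy ox c i (proj₂ (J⁻ j))
      ...   | (i' , c' , bi , o , ii' , bc' , bbi , _ , xi'bi) =
                subst (λ z → eX i z ≡ true) (solvable-originPairs oy ox i i₀ c₀ bi b' ne dic (eDs d₀) bc₀ bbi bb' xibi xi₀b') xibi
        where
          bc : inB c ≡ true
          bc = proj₁ (J⁻ j)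
          dci : eD c i ≡ true
          dci = proj₂ (J⁻ j)
          i'≡i : i' ≡ i
          i'≡i = [ (λ p → ⊥-elim (boundary≢interior bc ii' (proj₁ p))) , (λ p → sym (proj₂ p)) ] o
          xibi : eX i bi ≡ true
          xibi = subst (λ z → eX z bi ≡ true) i'≡i xi'bi
          notSame : ¬ ((c ≡ c₀ × i ≡ i₀) ⊎ (c ≡ i₀ × i ≡ c₀))
          notSame (inj₁ (_ , e)) = ne e
          notSame (inj₂ (e , _)) = boundary≢interior bc ii₀ e
          c≡c₀ : c ≡ c₀
          c≡c₀ with complete-commonVertex c i c₀ i₀ dci d₀ notSame
          ... | inj₁ e = e
          ... | inj₂ (inj₁ e) = ⊥-elim (boundary≢interior bc ii₀ e)
          ... | inj₂ (inj₂ (inj₁ e)) = ⊥-elim (boundary≢interior bc₀ (J-interior dci bc) (sym e))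
          ... | inj₂ (inj₂ (inj₂ e)) = ⊥-elim (ne e)
          dic : eD i c₀ ≡ true
          dic = subst (λ z → eD i z ≡ true) c≡c₀ (eDs dci)

      withNewEdges⇝ : SX ⇝ SY
      withNewEdges⇝ =
        ViaBuilder.result SX seed b' (==-refl b')
          (λ x y h → inj₁ (SX-inX x y h)) (λ x y h → edgesOf-edge {eX} {oX} h) esX
          (seed-boundary bb') (seed-met (i₀ , edgesOf-edge {eX} {oX} (eXs xi₀b'))) (seed-clique SX)
          (λ c i j d hd → subst (λ z → eX i z ≡ true) (sym (==⇒≡ hd)) (J-toSeed c i j))

    module WithoutNewEdges (noNew : ¬ (Σ[ x ∈ Fin n ] Σ[ y ∈ Fin n ] eD x y ≡ true)) where
      noJ : ∀ c i → J c i ≡ true → ⊥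
      noJ c i j = noNew (c , i , proj₂ (J⁻ j))

      seededBy : ∀ s → inB s ≡ true → MetBy s SX → SX ⇝ SY
      seededBy s bs ms =
        ViaBuilder.result SX seed s (==-refl s)
          (λ x y h → inj₁ (SX-inX x y h)) (λ x y h → edgesOf-edge {eX} {oX} h) esX
          (seed-boundary bs) (seed-met ms) (seed-clique SX) (λ c i j → ⊥-elim (noJ c i j))
        where open SingletonSeed s

      viaPair : ¬ MetBy b₁ SX → ¬ MetBy b₂ SX → SX ⇝ SY
      viaPair n1 n2 = ⇝-trans (⇝-edge SX b₁ b₂ valid) (ViaBuilder.result S₀ seed b₁ seed-b₁ shape
                        (λ x y h → ∨-trueˡ _ (edgesOf-edge {eX} {oX} h))
                        (proj₁ (proj₂ (edgeSolvable SX b₁ b₂ valid))) seed-boundary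
                        (seed-met (λ x y h → ∨-trueʳ (SX x y) h)) (seed-clique (λ x y h → ∨-trueʳ (SX x y) h))
                        (λ c i j → ⊥-elim (noJ c i j)))
        where
          open PairSeed b₁ b₂ b₁≢b₂ bb₁ bb₂
          valid : ValidEdge SX b₁ b₂
          valid = esX , boundaryPair-F (boundaryPair-intro bb₁ bb₂ b₁≢b₂) , n1 , n2
          S₀ : EdgeSet n
          S₀ = addEdge SX b₁ b₂
          shape : ∀ x y → S₀ x y ≡ true → eX x y ≡ true ⊎ (boundaryPair x y ≡ true × seed x ≡ true × seed y ≡ true)
          shape x y h with ∨-true⁻ (SX x y) h
          ... | inj₁ p = inj₁ (SX-inX x y p)
          ... | inj₂ p with oneEdge-cases b₁ b₂ x y p
          ...   | inj₁ (refl , refl) = inj₂ (boundaryPair-intro bb₁ bb₂ b₁≢b₂ , seed-b₁ , seed-b₂)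
          ...   | inj₂ (refl , refl) = inj₂ (boundaryPair-intro bb₂ bb₁ (λ e → b₁≢b₂ (sym e)) , seed-b₂ , seed-b₁)

      withoutNewEdges⇝ : SX ⇝ SY
      withoutNewEdges⇝ with metBy? b₁ SX | metBy? b₂ SX
      ... | yes m1 | _ = seededBy b₁ bb₁ m1
      ... | no _ | yes m2 = seededBy b₂ bb₂ m2
      ... | no n1 | no n2 = viaPair n1 n2

    originAdded⇝ : SX ⇝ SY
    originAdded⇝ with any? (λ x → any? (λ y → true? (eD x y)))
    ... | no noNew = WithoutNewEdges.withoutNewEdges⇝ noNew
    ... | yes (x₀ , y₀ , d) with complete-withOrigin oy ox x₀ y₀ d
    ...   | (i₀ , c₀ , b' , ori , ii₀ , bc₀ , bb' , _ , xi₀b') =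
              WithNewEdges.withNewEdges⇝ i₀ c₀ b' d₀ ii₀ bc₀ bb' xi₀b'
      where
        d₀ : eD c₀ i₀ ≡ true
        d₀ = [ (λ (e1 , e2) → subst₂ (λ a b → eD a b ≡ true) e2 e1 (eDs d)) ,
               (λ (e1 , e2) → subst₂ (λ a b → eD a b ≡ true) e1 e2 d) ] ori

-- The graph-theoretic half: the edge sets of Γ̃ attached to a solvable step
-- X ⊆ Y are connected by solvable steps (Case I or Case II; x₀ cannot be lost).
module ShadowSteps {n : ℕ} (E : Adjacency n) (inB : Fin n → Bool)
  (Esym : ∀ i j → E i j ≡ E j i) (Eirr : ∀ i → E i i ≡ false)
  (bdNA : ∀ b b' → inB b ≡ true → inB b' ≡ true → E b b' ≡ false)
  (b₁ b₂ : Fin n) (b₁≢b₂ : b₁ ≢ b₂) (bb₁ : inB b₁ ≡ true) (bb₂ : inB b₂ ≡ true) where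

  open BoundaryCompletion E inB Esym Eirr bdNA public
  private
    module Same = SameOrigin E inB Esym Eirr bdNA
    module Added = OriginAdded E inB Esym Eirr bdNA b₁ b₂ b₁≢b₂ bb₁ bb₂

  shadow⇝ : ∀ {eX eY oX oY} → SolvableShadow eX eY oX oY → edgesOf eX oX ⇝ edgesOf eY oY
  shadow⇝ {eX} {eY} {oX} {oY} sh with bool-cases oX | bool-cases oY
  ... | inj₁ x | inj₁ y = Same.Step.sameOrigin⇝ sh (trans x (sym y))
  ... | inj₂ x | inj₂ y = Same.Step.sameOrigin⇝ sh (trans x (sym y))
  ... | inj₂ x | inj₁ y = Added.Step.originAdded⇝ sh x y
  ... | inj₁ x | inj₂ y = ⊥-elim (true≢false (SolvableShadow.subO sh x) y)

-- The arrangement-theoretic half: a solvable step X ⊆ Y of subarrangements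
-- of A(Γ,u) (both members of a chain ending in the whole arrangement) has a
-- SolvableShadow.
module ArrangementShadow {c ℓ} (K : Field c ℓ) {n : ℕ} (E : Adjacency n) (inB : Fin n → Bool)
  (u : Fin n → Field.Carrier K)
  (Esym : ∀ i j → E i j ≡ E j i) (Eirr : ∀ i → E i i ≡ false)
  (bdNA : ∀ b b' → inB b ≡ true → inB b' ≡ true → E b b' ≡ false)
  (uinj : ∀ b b' → inB b ≡ true → inB b' ≡ true → Field._≈_ K (u b) (u b') → b ≡ b') where

  open DependentTriples K E inB u Esym Eirr bdNA uinj public
  module AH = ArrHS K normal
  module Graph = BoundaryCompletion E inB Esym Eirr bdNA
  open Graph using (boundary≢interior)

  edgesIn : (Idx → Bool) → Fin n → Fin n → Bool
  edgesIn Zb x y = E x y ∧ Zb (hypOf x y)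

  edgesIn⁻ : ∀ {Zb x y} → edgesIn Zb x y ≡ true → E x y ≡ true × Zb (hypOf x y) ≡ true
  edgesIn⁻ {Zb} {x} {y} h = ∧-true⁻ (E x y) h

  edgesIn-intro : ∀ {Zb x y} → E x y ≡ true → Zb (hypOf x y) ≡ true → edgesIn Zb x y ≡ true
  edgesIn-intro a b = ∧-true a b

  edgesIn-false : ∀ {Zb x y} → edgesIn Zb x y ≡ false → E x y ≡ true → Zb (hypOf x y) ≡ false
  edgesIn-false {Zb} {x} {y} h e with bool-cases (Zb (hypOf x y))
  ... | inj₂ p = p
  ... | inj₁ p = ⊥-elim (true≢false (edgesIn-intro {Zb} e p) h)

  edgesIn-sym : ∀ Zb x y → edgesIn Zb x y ≡ edgesIn Zb y x
  edgesIn-sym Zb x y with bool-cases (E x y)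
  ... | inj₁ e = cong₂ _∧_ (Esym x y) (cong Zb (hypOf-sym e))
  ... | inj₂ e = trans (∧-falseˡ (Zb (hypOf x y)) e) (sym (∧-falseˡ (Zb (hypOf y x)) (trans (sym (Esym x y)) e)))

  interior-of-boundaryNeighbour : ∀ {i b} → E i b ≡ true → inB b ≡ true → inB i ≡ false
  interior-of-boundaryNeighbour {i} {b} e bb with bool-cases (inB i)
  ... | inj₂ p = p
  ... | inj₁ p = ⊥-elim (true≢false e (bdNA i b p bb))

  hypOf-≢ : ∀ {x y z w} → E x y ≡ true → E z w ≡ true → ¬ ((x ≡ z × y ≡ w) ⊎ (x ≡ w × y ≡ z)) → hypOf x y ≢ hypOf z w
  hypOf-≢ {x} {y} {z} {w} e1 e2 ns eq = ns (edgeHyp-ends (subst (λ h → EdgeHyp h x y) eq (hypOf-edgeHyp e1)) (hypOf-edgeHyp e2))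

  originPair-dependent' : ∀ {i b b'} → E i b ≡ true → E i b' ≡ true → inB b ≡ true → inB b' ≡ true → Dep nothing (hypOf i b) (hypOf i b')
  originPair-dependent' {i} {b} {b'} e e' bb bb' with boundaryHyp-form (hypOf-edgeHyp e) bb | boundaryHyp-form (hypOf-edgeHyp e') bb'
  ... | (t , q) | (t' , q') rewrite q | q' = originPair-dependent i b b' t t' bb bb'

  -- if x₀ ∉ Z and Z starts a chain, no interior vertex i has two boundary
  -- neighbours b ≠ b' with both hyperplanes in Z: at the step where x₀ is
  -- added, {x_i = u(b)x₀ , x_i = u(b')x₀ , x₀} would violate closedness
  oneBoundaryNeighbour-chain : ∀ {Z} → AH.ChainFrom Z → ¬ Z nothing → ∀ i b b' → inB b ≡ true → inB b' ≡ true →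
             E i b ≡ true → E i b' ≡ true → Z (hypOf i b) → Z (hypOf i b') → b ≡ b'
  oneBoundaryNeighbour-chain {Z} ch nO i b b' bb bb' e e' z1 z2 with b ≟ b'
  ... | yes p = p
  ... | no ne = ⊥-elim (stepsUntilOrigin ch nO z1 z2)
    where
      qne : hypOf i b ≢ hypOf i b'
      qne = hypOf-≢ e e' (λ { (inj₁ (_ , q)) → ne q ; (inj₂ (q , _)) → true≢false bb' (trans (cong inB (sym q)) (interior-of-boundaryNeighbour e bb)) })
      D : Dep (hypOf i b) (hypOf i b') nothing
      D = dep-rotate {hypOf i b'} {nothing} {hypOf i b} (dep-rotate {nothing} {hypOf i b} {hypOf i b'} (originPair-dependent' e e' bb bb'))
      stepsUntilOrigin : ∀ {W} → AH.ChainFrom W → ¬ W nothing → W (hypOf i b) → W (hypOf i b') → ⊥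
      stepsUntilOrigin (AH.done all) nO _ _ = nO (all nothing)
      stepsUntilOrigin {W} (AH.step {Y = Y} (sub , (_ , closed) , _) chY) nO w1 w2 = ¬¬-decide (Y nothing) cases
        where
          cases : Dec (Y nothing) → ⊥
          cases (yes yO) = closed (hypOf i b) (hypOf i b') nothing w1 w2 qne yO nO D
          cases (no nyO) = stepsUntilOrigin chY nyO (sub _ w1) (sub _ w2)

  -- a solvable step between members of a chain, with Boolean versions
  -- Xb , Yb of the (classically decidable) subarrangements X , Y
  module ShadowOf {X Y : AH.Sub} (sol : AH.Solvable X Y) (chX : AH.ChainFrom X) (chY : AH.ChainFrom Y)
            (Xb Yb : Idx → Bool)
            (rX : ∀ h → X h → Xb h ≡ true) (rX' : ∀ h → Xb h ≡ true → X h)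
            (rY : ∀ h → Y h → Yb h ≡ true) (rY' : ∀ h → Yb h ≡ true → Y h) where

    sub : ∀ h → X h → Y h
    sub = proj₁ sol

    someNew : Σ[ h ∈ Idx ] (Y h × ¬ X h)
    someNew = proj₁ (proj₁ (proj₂ sol))

    closed : ∀ a b d → X a → X b → a ≢ b → Y d → ¬ X d → ¬ Dep a b d
    closed = proj₂ (proj₁ (proj₂ sol))

    complete : ∀ a b → Y a → ¬ X a → Y b → ¬ X b → a ≢ b → Σ[ γ ∈ Idx ] (X γ × Dep a b γ)
    complete = proj₂ (proj₁ (proj₂ (proj₂ sol)))

    solvable : ∀ a b d p q r → Y a → ¬ X a → Y b → ¬ X b → Y d → ¬ X d → a ≢ b → a ≢ d → b ≢ d →
               X p → Dep a b p → X q → Dep a d q → X r → Dep b d r → p ≢ q → p ≢ r → q ≢ r → Dep p q r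
    solvable = proj₂ (proj₂ (proj₂ sol))

    eX eY : Fin n → Fin n → Bool
    eX = edgesIn Xb
    eY = edgesIn Yb

    oX oY : Bool
    oX = Xb nothing
    oY = Yb nothing

    eD : Fin n → Fin n → Bool
    eD x y = eY x y ∧ not (eX x y)

    notInX : ∀ {h} → Xb h ≡ false → ¬ X h
    notInX {h} f xh = true≢false (rX h xh) f

    inX : ∀ {x y} → eX x y ≡ true → X (hypOf x y)
    inX h = rX' _ (proj₂ (edgesIn⁻ {Xb} h))
    inY : ∀ {x y} → eY x y ≡ true → Y (hypOf x y)
    inY h = rY' _ (proj₂ (edgesIn⁻ {Yb} h))
    edgeOfY : ∀ {x y} → eY x y ≡ true → E x y ≡ true
    edgeOfY h = proj₁ (edgesIn⁻ {Yb} h)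

    newEdge⁻ : ∀ {x y} → eD x y ≡ true → E x y ≡ true × Y (hypOf x y) × ¬ X (hypOf x y)
    newEdge⁻ {x} {y} h = let (a , b) = ∧-true⁻ (eY x y) h in edgeOfY a , inY a , notInX (edgesIn-false {Xb} (not-true⁻ b) (edgeOfY a))

    eX-intro : ∀ {x y} → E x y ≡ true → X (hypOf x y) → eX x y ≡ true
    eX-intro e xh = edgesIn-intro {Xb} e (rX _ xh)

    eX-ofEdgeHyp : ∀ {γ x y} → X γ → EdgeHyp γ x y → eX x y ≡ true
    eX-ofEdgeHyp {γ} xg eg = eX-intro (edgeHyp-E eg) (subst X (edgeHyp-hypOf eg) xg)

    oneBoundaryNeighbourX : oX ≡ false → ∀ i b b' → inB b ≡ true → inB b' ≡ true → eX i b ≡ true → eX i b' ≡ true → b ≡ b'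
    oneBoundaryNeighbourX ox i b b' bb bb' h1 h2 = oneBoundaryNeighbour-chain chX (notInX ox) i b b' bb bb' (proj₁ (edgesIn⁻ {Xb} h1)) (proj₁ (edgesIn⁻ {Xb} h2)) (inX h1) (inX h2)

    oneBoundaryNeighbourY : oY ≡ false → ∀ i b b' → inB b ≡ true → inB b' ≡ true → eY i b ≡ true → eY i b' ≡ true → b ≡ b'
    oneBoundaryNeighbourY oy i b b' bb bb' h1 h2 = oneBoundaryNeighbour-chain chY (λ y → true≢false (rY nothing y) oy) i b b' bb bb' (edgeOfY h1) (edgeOfY h2) (inY h1) (inY h2)

    nonempty : (oY ≡ true × oX ≡ false) ⊎ (Σ[ x ∈ Fin n ] Σ[ y ∈ Fin n ] eD x y ≡ true)
    nonempty with someNew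
    ... | (nothing , yh , nxh) = inj₁ (rY nothing yh , x₀∉X)
      where
        x₀∉X : oX ≡ false
        x₀∉X with bool-cases oX
        ... | inj₂ p = p
        ... | inj₁ p = ⊥-elim (nxh (rX' nothing p))
    ... | (just ((i , j) , t) , yh , nxh) = inj₂ (i , j , ∧-true (edgesIn-intro {Yb} (rep-edge t) (subst (λ h → Yb h ≡ true) (sym (hypOf-just i j t)) (rY _ yh)))
                                                    (not-true ij∉X))
      where
        ij∉X : eX i j ≡ false
        ij∉X with bool-cases (eX i j)
        ... | inj₂ p = p
        ... | inj₁ p = ⊥-elim (nxh (subst X (hypOf-just i j t) (inX p)))

    -- the three sides of a triangle are dependent
    closed-triangle : ∀ x y z → eX x y ≡ true → eX y z ≡ true → eD x z ≡ true → ⊥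
    closed-triangle x y z a b d with newEdge⁻ d
    ... | (exz , yxz , nxz) = closed (hypOf x y) (hypOf y z) (hypOf x z) (inX a) (inX b) ne yxz nxz
                                (triangle-dependent (hypOf-edgeHyp exy) (hypOf-edgeHyp eyz) (hypOf-edgeHyp exz))
      where
        exy : E x y ≡ true
        exy = proj₁ (edgesIn⁻ {Xb} a)
        eyz : E y z ≡ true
        eyz = proj₁ (edgesIn⁻ {Xb} b)
        ne : hypOf x y ≢ hypOf y z
        ne = hypOf-≢ exy eyz (λ { (inj₁ (p , _)) → E-irrefl exy p ; (inj₂ (p , _)) → E-irrefl exz p })

    -- {x₀ , ib , ib'} is dependent
    closed-originPair : oX ≡ true → ∀ i b b' → inB b ≡ true → inB b' ≡ true → b ≢ b' →
            eX i b ≡ true → eD i b' ≡ true → ⊥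
    closed-originPair ox i b b' bb bb' ne h1 d with newEdge⁻ d
    ... | (e' , y' , nx') = closed nothing (hypOf i b) (hypOf i b') (rX' nothing ox) (inX h1) nothing≢ y' nx'
                              (originPair-dependent' (proj₁ (edgesIn⁻ {Xb} h1)) e' bb bb')
      where
        nothing≢ : nothing ≢ hypOf i b
        nothing≢ q = edgeHyp-≢x₀ (hypOf-edgeHyp (proj₁ (edgesIn⁻ {Xb} h1))) (sym q)

    eD-sym : ∀ x y → eD x y ≡ eD y x
    eD-sym x y rewrite edgesIn-sym Xb x y | edgesIn-sym Yb x y = refl

    eDs : ∀ {x y} → eD x y ≡ true → eD y x ≡ true
    eDs {x} {y} h = trans (sym (eD-sym x y)) h

    complete-sharedVertex : ∀ v w1 w2 → w1 ≢ w2 → eD v w1 ≡ true → eD v w2 ≡ true →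
         eX w1 w2 ≡ true ⊎ (inB w1 ≡ true × inB w2 ≡ true × inB v ≡ false ×
           (oX ≡ true ⊎ Σ[ b'' ∈ Fin n ] (inB b'' ≡ true × b'' ≢ w1 × b'' ≢ w2 × eX v b'' ≡ true)))
    complete-sharedVertex v w1 w2 ne d1 d2 with newEdge⁻ d1 | newEdge⁻ d2
    ... | (e1 , y1 , nx1) | (e2 , y2 , nx2) with complete (hypOf v w1) (hypOf v w2) y1 nx1 y2 nx2 ab
      where
        ab : hypOf v w1 ≢ hypOf v w2
        ab = hypOf-≢ e1 e2 (λ { (inj₁ (_ , q)) → ne q ; (inj₂ (q , _)) → E-irrefl e2 q })
    ... | (γ , xγ , D) with dependent-shape {hypOf v w1} {hypOf v w2} {γ} (hypOf-≢ e1 e2 (λ { (inj₁ (_ , q)) → ne q ; (inj₂ (q , _)) → E-irrefl e2 q }))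
                              (λ q → nx1 (subst X q xγ)) (λ q → nx2 (subst X q xγ)) D (hypOf-edgeHyp e1) (hypOf-edgeHyp e2)
    ...   | (v' , w1' , w2' , ea , eb , w12 , res) with edgeHyp-ends ea (hypOf-edgeHyp e1) | edgeHyp-ends eb (hypOf-edgeHyp e2)
    ...     | inj₂ (p , _) | inj₁ (r , _) = ⊥-elim (E-irrefl e1 (trans (sym r) p))
    ...     | inj₂ (p , _) | inj₂ (r , _) = ⊥-elim (ne (trans (sym p) r))
    ...     | inj₁ (p , _) | inj₂ (r , _) = ⊥-elim (E-irrefl e2 (trans (sym p) r))
    ...     | inj₁ (refl , refl) | inj₁ (_ , refl) = fromShape res
      where
        fromShape : EdgeHyp γ w1 w2 ⊎ (inB w1 ≡ true × inB w2 ≡ true × inB v ≡ false ×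
                       (γ ≡ nothing ⊎ Σ[ b'' ∈ Fin n ] (EdgeHyp γ v b'' × inB b'' ≡ true))) →
              eX w1 w2 ≡ true ⊎ (inB w1 ≡ true × inB w2 ≡ true × inB v ≡ false ×
                (oX ≡ true ⊎ Σ[ b'' ∈ Fin n ] (inB b'' ≡ true × b'' ≢ w1 × b'' ≢ w2 × eX v b'' ≡ true)))
        fromShape (inj₁ eγ) = inj₁ (eX-ofEdgeHyp xγ eγ)
        fromShape (inj₂ (a , b , c , inj₁ refl)) = inj₂ (a , b , c , inj₁ (rX nothing xγ))
        fromShape (inj₂ (a , b , c , inj₂ (b'' , eγ , bb))) = inj₂ (a , b , c , inj₂ (b'' , bb , n1 , n2 , eX-ofEdgeHyp xγ eγ))
          where
            n1 : b'' ≢ w1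
            n1 refl = nx1 (subst X (edgeHyp-unique eγ (hypOf-edgeHyp e1)) xγ)
            n2 : b'' ≢ w2
            n2 refl = nx2 (subst X (edgeHyp-unique eγ (hypOf-edgeHyp e2)) xγ)

    complete-commonVertex : ∀ x y z w → eD x y ≡ true → eD z w ≡ true → ¬ ((x ≡ z × y ≡ w) ⊎ (x ≡ w × y ≡ z)) →
          x ≡ z ⊎ x ≡ w ⊎ y ≡ z ⊎ y ≡ w
    complete-commonVertex x y z w d1 d2 ns with newEdge⁻ d1 | newEdge⁻ d2
    ... | (e1 , y1 , nx1) | (e2 , y2 , nx2) with complete (hypOf x y) (hypOf z w) y1 nx1 y2 nx2 (hypOf-≢ e1 e2 ns)
    ... | (γ , xγ , D) with dependent-shape {hypOf x y} {hypOf z w} {γ} (hypOf-≢ e1 e2 ns)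
                              (λ q → nx1 (subst X q xγ)) (λ q → nx2 (subst X q xγ)) D (hypOf-edgeHyp e1) (hypOf-edgeHyp e2)
    ...   | (v , w1 , w2 , ea , eb , _ , _) with edgeHyp-ends ea (hypOf-edgeHyp e1) | edgeHyp-ends eb (hypOf-edgeHyp e2)
    ...     | inj₁ (p , _) | inj₁ (q , _) = inj₁ (trans (sym p) q)
    ...     | inj₁ (p , _) | inj₂ (q , _) = inj₂ (inj₁ (trans (sym p) q))
    ...     | inj₂ (p , _) | inj₁ (q , _) = inj₂ (inj₂ (inj₁ (trans (sym p) q)))
    ...     | inj₂ (p , _) | inj₂ (q , _) = inj₂ (inj₂ (inj₂ (trans (sym p) q)))

    complete-withOrigin : oY ≡ true → oX ≡ false → ∀ x y → eD x y ≡ true →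
         Σ[ i ∈ Fin n ] Σ[ c' ∈ Fin n ] Σ[ b ∈ Fin n ]
           (((x ≡ i × y ≡ c') ⊎ (x ≡ c' × y ≡ i)) × inB i ≡ false × inB c' ≡ true × inB b ≡ true × b ≢ c' × eX i b ≡ true)
    complete-withOrigin oy ox x y d with newEdge⁻ d
    ... | (e , yh , nxh) with complete nothing (hypOf x y) (rY' nothing oy) (notInX ox) yh nxh (λ q → edgeHyp-≢x₀ (hypOf-edgeHyp e) (sym q))
    ... | (γ , xγ , D) with dependent-with-x₀ {hypOf x y} {γ} (λ q → nxh (subst X q xγ)) (λ q → notInX ox (subst X q xγ)) D (hypOf-edgeHyp e)
    ...   | (i , c' , b , eI , ii , bc , eγ , bb , ne) = i , c' , b , ori , ii , bc , bb , ne , eX-ofEdgeHyp xγ eγ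
      where
        ori : (x ≡ i × y ≡ c') ⊎ (x ≡ c' × y ≡ i)
        ori with edgeHyp-ends eI (hypOf-edgeHyp e)
        ... | inj₁ (p , q) = inj₁ (sym p , sym q)
        ... | inj₂ (p , q) = inj₂ (sym q , sym p)

    -- solvability for x₀ and new edges i c' , j c' (c' boundary): with
    -- f(x₀ , ic') = ib₁ , f(x₀ , jc') = jb₂ and f(ic' , jc') = ij , the triple
    -- {ib₁ , jb₂ , ij} is dependent, which forces b₁ = b₂
    solvable-originPairs : oY ≡ true → oX ≡ false → ∀ i j c' b1 b2 → i ≢ j → eD i c' ≡ true → eD j c' ≡ true → inB c' ≡ true →
         inB b1 ≡ true → inB b2 ≡ true → eX i b1 ≡ true → eX j b2 ≡ true → b1 ≡ b2
    solvable-originPairs oy ox i j c' b1 b2 ne d1 d2 bc bb1 bb2 x1 x2 with newEdge⁻ d1 | newEdge⁻ d2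
    ... | (ei , yb , nxb) | (ej , yd , nxd) = result
      where
        ii : inB i ≡ false
        ii = interior-of-boundaryNeighbour ei bc
        ij : inB j ≡ false
        ij = interior-of-boundaryNeighbour ej bc
        exij : eX i j ≡ true
        exij = [ (λ p → p) , (λ p → ⊥-elim (true≢false (proj₁ p) ii)) ]
                 (complete-sharedVertex c' i j ne (eDs d1) (eDs d2))
        eij : E i j ≡ true
        eij = proj₁ (edgesIn⁻ {Xb} exij)
        ex1 : E i b1 ≡ true
        ex1 = proj₁ (edgesIn⁻ {Xb} x1)
        ex2 : E j b2 ≡ true
        ex2 = proj₁ (edgesIn⁻ {Xb} x2)
        Dpqr : Dep (hypOf i b1) (hypOf j b2) (hypOf i j)
        Dpqr = solvable nothing (hypOf i c') (hypOf j c') (hypOf i b1) (hypOf j b2) (hypOf i j)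
                 (rY' nothing oy) (notInX ox) yb nxb yd nxd
                 (λ q → edgeHyp-≢x₀ (hypOf-edgeHyp ei) (sym q))
                 (λ q → edgeHyp-≢x₀ (hypOf-edgeHyp ej) (sym q))
                 (hypOf-≢ ei ej (λ { (inj₁ (p , _)) → ne p ; (inj₂ (p , _)) → boundary≢interior bc ii (sym p) }))
                 (inX x1) (originPair-dependent' ei ex1 bc bb1)
                 (inX x2) (originPair-dependent' ej ex2 bc bb2)
                 (inX exij) (triangle-dependent {hypOf i c'} {hypOf j c'} {hypOf i j} {i} {c'} {j} (hypOf-edgeHyp ei) (edgeHyp-swap (hypOf-edgeHyp ej)) (hypOf-edgeHyp eij))
                 (hypOf-≢ ex1 ex2 (λ { (inj₁ (p , _)) → ne p ; (inj₂ (p , _)) → boundary≢interior bb2 ii (sym p) }))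
                 (hypOf-≢ ex1 eij (λ { (inj₁ (_ , q)) → boundary≢interior bb1 ij q ; (inj₂ (p , _)) → ne p }))
                 (hypOf-≢ ex2 eij (λ { (inj₁ (p , _)) → ne (sym p) ; (inj₂ (_ , q)) → boundary≢interior bb2 ii q }))
        result : b1 ≡ b2
        result with boundaryHyp-form (hypOf-edgeHyp ex1) bb1 | boundaryHyp-form (hypOf-edgeHyp ex2) bb2
        ... | (t1 , q1) | (t2 , q2) =
          spread-independent {hypOf i j} {i} {j} {b1} {b2} {t1} {t2} (hypOf-edgeHyp eij) bb1 bb2
            (subst (λ h → Dep (hypOf i j) (just ((i , b1) , t1)) h) q2
              (subst (λ h → Dep (hypOf i j) h (hypOf j b2)) q1 (dep-rotate {hypOf i b1} {hypOf j b2} {hypOf i j} Dpqr)))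

    shadow : Graph.SolvableShadow eX eY oX oY
    shadow = record
      { symX = edgesIn-sym Xb
      ; symY = edgesIn-sym Yb
      ; edgeY = λ x y h → edgeOfY h
      ; subE = λ x y h → edgesIn-intro {Yb} (proj₁ (edgesIn⁻ {Xb} h)) (rY _ (sub _ (inX h)))
      ; subO = λ h → rY nothing (sub nothing (rX' nothing h))
      ; nonempty = nonempty
      ; closed-triangle = closed-triangle
      ; closed-originPair = closed-originPair
      ; complete-sharedVertex = complete-sharedVertex
      ; complete-commonVertex = complete-commonVertex
      ; complete-withOrigin = complete-withOrigin
      ; solvable-originPairs = solvable-originPairs
      ; oneBoundaryNeighbourX = oneBoundaryNeighbourX
      ; oneBoundaryNeighbourY = oneBoundaryNeighbourY
      }


-- Along a chain X₁ ⊆ … ⊆ A, each edge set of Γ̃ attached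
-- to a member leads to F (chain⇝full).  The chain starts with one hyperplane:
-- an edge hyperplane gives a single edge of Γ̃; x₀ = 0 gives the boundary
-- clique, which is grown from the single edge b₁ b₂ by the builder.  Since
-- "some single edge is completable" is decidable, the double negation
-- disappears and yields a chain of solvable steps of Γ̃.
module ChainTranslation {c ℓ} (K : Field c ℓ) {n : ℕ} (E : Adjacency n) (inB : Fin n → Bool)
  (u : Fin n → Field.Carrier K)
  (Esym : ∀ i j → E i j ≡ E j i) (Eirr : ∀ i → E i i ≡ false)
  (bdNA : ∀ b b' → inB b ≡ true → inB b' ≡ true → E b b' ≡ false)
  (uinj : ∀ b b' → inB b ≡ true → inB b' ≡ true → Field._≈_ K (u b) (u b') → b ≡ b')
  (b₁ b₂ : Fin n) (b₁≢b₂ : b₁ ≢ b₂) (bb₁ : inB b₁ ≡ true) (bb₂ : inB b₂ ≡ true) where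

  open ArrangementShadow K E inB u Esym Eirr bdNA uinj
  open ShadowSteps E inB Esym Eirr bdNA b₁ b₂ b₁≢b₂ bb₁ bb₂
  open GraphHS F

  ¬¬-decidable : (P : Idx → Set) → ¬ ¬ (∀ h → Dec (P h))
  ¬¬-decidable P ng =
    ¬¬-decide (P nothing) (λ p0 →
    ¬¬-∀Fin (λ i → ¬¬-∀Fin (λ j → ¬¬-∀T (isRep i j) (λ t → ¬¬-decide (P (just ((i , j) , t)))))) (λ p1 →
    ng (λ { nothing → p0 ; (just ((i , j) , t)) → p1 i j t })))

  edgesOfArr : (Idx → Bool) → EdgeSet n
  edgesOfArr Xb = edgesOf (edgesIn Xb) (Xb nothing)

  edgesOfArr-full : ∀ Xb → (∀ h → Xb h ≡ true) → ∀ x y → edgesOfArr Xb x y ≡ F x y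
  edgesOfArr-full Xb all x y rewrite all (hypOf x y) | all nothing | ∧-identityʳ (E x y) | ∧-identityʳ (boundaryPair x y) = refl

  -- induction along the chain: at each solvable step, decide the next
  -- member (under double negation) and follow its shadow
  chain⇝full : ∀ {X} → AH.ChainFrom X → (Xb : Idx → Bool) → (∀ h → X h → Xb h ≡ true) → (∀ h → Xb h ≡ true → X h) →
               ∀ S → S ≐ edgesOfArr Xb → ∀ f → missing S ≤ f → ¬¬Completable f S
  chain⇝full (AH.done all) Xb rX rX' S eq f le ng = ng (completed f)
    where
      full : IsFull S
      full x y = trans (eq x y) (edgesOfArr-full Xb (λ h → rX h (all h)) x y)
      completed : ∀ f → Completable f S
      completed zero = full
      completed (suc f) = inj₁ full
  chain⇝full ch@(AH.step {Y = Y} sol chY) Xb rX rX' S eq f le ng = ¬¬-decidable Y (λ dY → viaNext dY)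
    where
      viaNext : (∀ h → Dec (Y h)) → ⊥
      viaNext dY = step⇝ f le (λ f' le' → chain⇝full chY Yb rY rY' (edgesOfArr Yb) (λ _ _ → refl) f' le') ng
        where
          Yb : Idx → Bool
          Yb h = does (dY h)
          rY : ∀ h → Y h → Yb h ≡ true
          rY h y = dec-true (dY h) y
          rY' : ∀ h → Yb h ≡ true → Y h
          rY' h p with dY h
          ... | yes y = y
          step⇝ : S ⇝ edgesOfArr Yb
          step⇝ = ⇝-trans (⇝-≐ eq) (shadow⇝ (ShadowOf.shadow sol ch chY Xb Yb rX rX' rY rY'))

  _≟ₕ_ : (h h' : Idx) → Dec (h ≡ h')
  nothing ≟ₕ nothing = yes refl
  nothing ≟ₕ just _ = no (λ ())
  just _ ≟ₕ nothing = no (λ ())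
  just ((i , j) , t) ≟ₕ just ((i' , j') , t') with i ≟ i' | j ≟ j'
  ... | yes refl | yes refl = yes (just-≡ refl refl)
  ... | no ne | _ = no (λ e → ne (proj₁ (just-injective e)))
  ... | yes _ | no ne = no (λ e → ne (proj₂ (just-injective e)))

  StartsCompletable : Set
  StartsCompletable = Σ[ x ∈ Fin n ] Σ[ y ∈ Fin n ] (F x y ≡ true × Completable (missing (oneEdge x y)) (oneEdge x y))

  startsCompletable? : Dec StartsCompletable
  startsCompletable? = any? (λ x → any? (λ y → true? (F x y) ×-dec completable? (missing (oneEdge x y)) (oneEdge x y)))

  oneEdge-edgeSubset : ∀ x y → F x y ≡ true → IsEdgeSubset (oneEdge x y)
  oneEdge-edgeSubset x y fxy = oneEdge-sym x y , oneEdge-F fxy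

  hypersolvable-fromStart : StartsCompletable → HypersolvableGraph
  hypersolvable-fromStart (x , y , fxy , g) =
    oneEdge x y , oneEdge-edgeSubset x y fxy , (x , y , oneEdge-ab x y , oneEdge-cases x y) , completable⇒chain _ _ g

  module OriginFirst where
    open BoundaryCliqueBuilder E inB Esym Eirr bdNA
    open PairSeed b₁ b₂ b₁≢b₂ bb₁ bb₂

    noJ : Fin n → Fin n → Bool
    noJ _ _ = false

    fromSeed : ∀ c w → seed c ≡ false → oneEdge b₁ b₂ c w ≡ false
    fromSeed c w cc with bool-cases (oneEdge b₁ b₂ c w)
    ... | inj₂ p = p
    ... | inj₁ p with oneEdge-cases b₁ b₂ c w p
    ...   | inj₁ (refl , _) = ⊥-elim (true≢false seed-b₁ cc)
    ...   | inj₂ (refl , _) = ⊥-elim (true≢false seed-b₂ cc)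

    hyp : BuilderHyp (oneEdge b₁ b₂) seed noJ
    hyp = record
      { S₀-edgeSubset = oneEdge-edgeSubset b₁ b₂ (boundaryPair-F (boundaryPair-intro bb₁ bb₂ b₁≢b₂))
      ; J-edge = λ c i ()
      ; J-boundary = λ c i ()
      ; seed-boundary = seed-boundary
      ; seedVertex = b₁
      ; seedVertex-inSeed = seed-b₁
      ; seed-met = seed-met (λ x y h → h)
      ; seed-clique = seed-clique (λ x y h → h)
      ; S₀-noBoundaryEdge = λ c w cc _ _ → fromSeed c w cc
      ; J-fresh = λ c i ()
      ; J-clique = λ c i i' ()
      ; J-notSeed = λ c i ()
      ; J-met = λ c i ()
      ; S₀-noTriangle-boundary = λ c y w _ cc s → ⊥-elim (true≢false s (fromSeed c y cc))
      ; S₀-noTriangle-J = λ c y w _ cc s → ⊥-elim (true≢false s (fromSeed c y cc))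
      ; J-order = λ c i d ()
      }
    open Build hyp

    origin⇝ : ∀ (Xb : Idx → Bool) → Xb nothing ≡ true → (∀ x y → E x y ≡ true → Xb (hypOf x y) ≡ false) →
              oneEdge b₁ b₂ ⇝ edgesOfArr Xb
    origin⇝ Xb xo xe = ⇝-≐ʳ fullBuild⇝ (λ x y → bool-ext (fwd x y) (bwd x y))
      where
        fwd : ∀ x y → stage inB x y ≡ true → edgesOfArr Xb x y ≡ true
        fwd x y h with stage-cases inB x y h
        ... | inj₂ (inj₁ (a , _)) = edgesOf-boundary {edgesIn Xb} {Xb nothing} a xo
        ... | inj₂ (inj₂ (inj₁ (_ , ())))
        ... | inj₂ (inj₂ (inj₂ (_ , ())))
        ... | inj₁ s with oneEdge-cases b₁ b₂ x y s
        ...   | inj₁ (refl , refl) = edgesOf-boundary {edgesIn Xb} {Xb nothing} (boundaryPair-intro bb₁ bb₂ b₁≢b₂) xo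
        ...   | inj₂ (refl , refl) = edgesOf-boundary {edgesIn Xb} {Xb nothing} (boundaryPair-intro bb₂ bb₁ (λ e → b₁≢b₂ (sym e))) xo
        bwd : ∀ x y → edgesOfArr Xb x y ≡ true → stage inB x y ≡ true
        bwd x y h with edgesOf-cases {edgesIn Xb} {Xb nothing} h
        ... | inj₁ p = let (e , q) = edgesIn⁻ {Xb} p in ⊥-elim (true≢false q (xe x y e))
        ... | inj₂ (b , _) = stage-pair inB b (proj₁ (boundaryPair⁻ b)) (proj₁ (proj₂ (boundaryPair⁻ b)))

  module FirstHyperplane (X₁ : AH.Sub) (h : Idx) (x₁h : X₁ h) (only : ∀ h' → X₁ h' → h' ≡ h)
                         (ch : AH.ChainFrom X₁) where
    Xb : Idx → Bool
    Xb h' = does (h' ≟ₕ h)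

    rX : ∀ h' → X₁ h' → Xb h' ≡ true
    rX h' x = dec-true (h' ≟ₕ h) (only h' x)

    rX' : ∀ h' → Xb h' ≡ true → X₁ h'
    rX' h' p with h' ≟ₕ h
    ... | yes e = subst X₁ (sym e) x₁h

    toFull : ∀ S → S ≐ edgesOfArr Xb → ∀ f → missing S ≤ f → ¬¬Completable f S
    toFull = chain⇝full ch Xb rX rX'

    edgeFirst : ∀ i j t → h ≡ just ((i , j) , t) → ¬ ¬ StartsCompletable
    edgeFirst i j t e ng =
      toFull (oneEdge i j) oneEdge≐ (missing (oneEdge i j)) ≤-refl (λ g → ng (i , j , E⊆F (rep-edge t) , g))
      where
        h≡ij : h ≡ hypOf i j
        h≡ij = trans e (sym (hypOf-just i j t))
        inXb : ∀ {x y} → E x y ≡ true → h ≡ hypOf x y → edgesOfArr Xb x y ≡ true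
        inXb exy q = edgesOf-edge {edgesIn Xb} {Xb nothing} (edgesIn-intro {Xb} exy (rX _ (subst X₁ q x₁h)))
        oneEdge≐ : oneEdge i j ≐ edgesOfArr Xb
        oneEdge≐ x y = bool-ext fwd bwd
          where
            fwd : oneEdge i j x y ≡ true → edgesOfArr Xb x y ≡ true
            fwd s with oneEdge-cases i j x y s
            ... | inj₁ (refl , refl) = inXb (rep-edge t) h≡ij
            ... | inj₂ (refl , refl) = inXb (trans (Esym x y) (rep-edge t)) (trans h≡ij (hypOf-sym (rep-edge t)))
            bwd : edgesOfArr Xb x y ≡ true → oneEdge i j x y ≡ true
            bwd h' with edgesOf-cases {edgesIn Xb} {Xb nothing} h'
            ... | inj₂ (_ , xo) = ⊥-elim (edgeHyp-≢x₀ (just-edgeHyp i j t) (trans (sym e) (sym (==ₕ xo))))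
              where
                ==ₕ : Xb nothing ≡ true → nothing ≡ h
                ==ₕ p with nothing ≟ₕ h
                ... | yes q = q
            ... | inj₁ p with edgesIn⁻ {Xb} p
            ...   | (exy , q) with hypOf x y ≟ₕ h
            ...     | yes q' with edgeHyp-ends (subst (λ z → EdgeHyp z x y) (trans q' e) (hypOf-edgeHyp exy)) (just-edgeHyp i j t)
            ...       | inj₁ (refl , refl) = oneEdge-ab x y
            ...       | inj₂ (refl , refl) = oneEdge-ba y x

    originFirst : h ≡ nothing → ¬ ¬ StartsCompletable
    originFirst e ng =
      ⇝-trans (OriginFirst.origin⇝ Xb (rX nothing (subst X₁ e x₁h)) noEdges)
              (⇝-≐ (λ _ _ → refl))
        (missing (oneEdge b₁ b₂)) ≤-refl (toFull (edgesOfArr Xb) (λ _ _ → refl))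
        (λ g → ng (b₁ , b₂ , boundaryPair-F (boundaryPair-intro bb₁ bb₂ b₁≢b₂) , g))
      where
        noEdges : ∀ x y → E x y ≡ true → Xb (hypOf x y) ≡ false
        noEdges x y exy = dec-false (hypOf x y ≟ₕ h) (λ q → edgeHyp-≢x₀ (hypOf-edgeHyp exy) (trans q e))

  ¬¬startsCompletable : AH.Hypersolvable → ¬ ¬ StartsCompletable
  ¬¬startsCompletable (X₁ , (h , x₁h , only) , ch) = byFirst h refl
    where
      open FirstHyperplane X₁ h x₁h only ch
      byFirst : ∀ h₀ → h ≡ h₀ → ¬ ¬ StartsCompletable
      byFirst nothing e = originFirst e
      byFirst (just ((i , j) , t)) e = edgeFirst i j t e

  hypersolvableGraph : AH.Hypersolvable → HypersolvableGraph
  hypersolvableGraph H with startsCompletable?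
  ... | yes start = hypersolvable-fromStart start
  ... | no ¬start = ⊥-elim (¬¬startsCompletable H ¬start)

-- Proposition 4.12: if A(Γ,u) is hypersolvable, so is Γ̃.
proposition4p12 :
    ∀ {c ℓ : Level} (K : Field c ℓ) → CharZero K →
    ∀ {n : ℕ} (E : Adjacency n) → IsSimpleGraph E → Connected E →
    (inB : Fin n → Bool) →
    (Σ[ b ∈ Fin n ] Σ[ b' ∈ Fin n ] (b ≢ b' × inB b ≡ true × inB b' ≡ true)) →
    (∀ b b' → inB b ≡ true → inB b' ≡ true → E b b' ≡ false) →
    (u : Fin n → Field.Carrier K) →
    (∀ b b' → inB b ≡ true → inB b' ≡ true → Field._≈_ K (u b) (u b') → b ≡ b') →
    GraphicArr.Hypersolvable K E inB u →
    GraphHS.HypersolvableGraph (completeBoundary E inB)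
proposition4p12 K _ E (Esym , Eirr) _ inB (b₁ , b₂ , b₁≢b₂ , bb₁ , bb₂) boundaryIndependent u uInjective =
  ChainTranslation.hypersolvableGraph K E inB u Esym Eirr boundaryIndependent uInjective b₁ b₂ b₁≢b₂ bb₁ bb₂
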